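{- For all integers $q,n$ with $0\le q<n$, \[\sum_{m=0}^{n}\frac{c_{2n-2m,n}}{(2m)!} \sum_{p=1}^{m}\binom{2m}{2m-2p}\, \Omega_{q,m-p}\, \frac{2^{2p-1}(2^{2p}-1)}{p}\,B_{2p} = (-1)^{q+n+1}\, \frac12\,\frac{q!\,(n-q-1)!}{n!}\] and \[\sum_{m=0}^{n-1}\frac{d_{2n-2m-2,n}}{(2m+1)!} \sum_{p=0}^{m}\binom{2m+1}{2m-2p}\, \Omega_{q,m-p}\, E_{2p} = (-1)^{q+n+1}\, 2^{2q+1}\,q!\, \frac{n!\,(2n-2q-2)!}{(n-q-1)!\,(2n)!}.\]
   Context: For integers $k\ge0$, $r\ge0$, $c_{k,r}$ denotes the coefficient of $x^k$ in the Taylor expansion at $0$ of $\left(\frac{x}{\sinh x}\right)^{2r+1}$, and $d_{k,r}$ ($r\ge1$) the coefficient of $x^k$ in the Taylor expansion at $0$ of $\left(\frac{x}{\sinh x}\right)^{2r}$. For integers $q\ge0$, $p\ge0$, $\Omega_{q,p} := \frac{1}{4^{q}}\sum_{k=0}^{q} \binom{2q+1}{k}(2q+1-2k)^{2p}$. $B_j$ are the Bernoulli numbers ($B_2=1/6$) and $E_j$ the Euler numbers defined by $\frac{1}{\cosh x}=\sum_{j\ge0}E_j\frac{x^j}{j!}$ ($E_0=1$, $E_2=-1$). -}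

module Defs where

open import Data.Nat as ℕ using (ℕ; zero; suc; _∸_; _!)
open import Data.Nat.Properties using (_!≢0; m^n≢0)
open import Data.Nat.Combinatorics using (_C_)
open import Data.Integer using (+_)
open import Data.Rational using (ℚ; 0ℚ; 1ℚ; _+_; _*_; -_; _/_)
open import Data.List using (List; []; _∷_; zipWith; map; foldr; upTo)

ℕ→ℚ : ℕ → ℚ
ℕ→ℚ k = + k / 1

invFact : ℕ → ℚ
invFact k = _/_ (+ 1) (k !) {{k !≢0}}

∑ : ℕ → (ℕ → ℚ) → ℚ
∑ zero    f = 0ℚ
∑ (suc n) f = ∑ n f + f n

sgn : ℕ → ℚ
sgn zero    = 1ℚ
sgn (suc k) = - sgn k

-- formal power series over ℚ, given by their coefficient sequence
PS : Set
PS = ℕ → ℚ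

one : PS
one zero    = 1ℚ
one (suc _) = 0ℚ

_⊛_ : PS → PS → PS
(f ⊛ g) n = ∑ (suc n) (λ k → f k * g (n ∸ k))

_^PS_ : PS → ℕ → PS
f ^PS zero  = one
f ^PS suc r = f ⊛ (f ^PS r)

sumL : List ℚ → ℚ
sumL = foldr _+_ 0ℚ

coeffs1 : PS → ℕ → List ℚ
coeffs1 f n = map (λ k → f (suc k)) (upTo n)

-- For a series f with constant term 1, invRev f n = [h n, h (n-1), ..., h 0]
-- where h is the multiplicative inverse series 1/f, computed by the recursion
-- h 0 = 1,  h n = - ∑_{k=1}^{n} f k * h (n - k).
-- (The constant term of f is not inspected: it is assumed to be 1; this is
-- only applied to series with constant term 1 below.)
invRev : PS → ℕ → List ℚ
invRev f zero    = 1ℚ ∷ []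
invRev f (suc n) = (- sumL (zipWith _*_ (coeffs1 f (suc n)) v)) ∷ v
  where v = invRev f n

headOr0 : List ℚ → ℚ
headOr0 []      = 0ℚ
headOr0 (x ∷ _) = x

inv1 : PS → PS
inv1 f n = headOr0 (invRev f n)

-- even series: evenPart g has coefficient g j at x^(2j) and 0 at odd powers
evenPart : (ℕ → ℚ) → PS
evenPart g zero          = g 0
evenPart g (suc zero)    = 0ℚ
evenPart g (suc (suc k)) = evenPart (λ j → g (suc j)) k

sinhOverX : PS
sinhOverX = evenPart (λ j → invFact (suc (2 ℕ.* j)))

xOverSinh : PS
xOverSinh = inv1 sinhOverX

c : ℕ → ℕ → ℚ
c k r = (xOverSinh ^PS suc (2 ℕ.* r)) k

d : ℕ → ℕ → ℚ
d k r = (xOverSinh ^PS (2 ℕ.* r)) k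

expm1OverX : PS
expm1OverX k = invFact (suc k)

-- Bernoulli numbers: x / (e^x - 1) = ∑_j B j x^j / j!   (B 1 = -1/2, B 2 = 1/6)
B : ℕ → ℚ
B j = ℕ→ℚ (j !) * inv1 expm1OverX j

coshPS : PS
coshPS = evenPart (λ j → invFact (2 ℕ.* j))

-- Euler numbers: 1 / cosh x = ∑_j E j x^j / j!   (E 0 = 1, E 2 = -1)
E : ℕ → ℚ
E j = ℕ→ℚ (j !) * inv1 coshPS j

Ω : ℕ → ℕ → ℚ
Ω q p = (_/_ (+ 1) (4 ℕ.^ q) {{m^n≢0 4 q}})
        * ∑ (suc q) (λ k → ℕ→ℚ (((suc (2 ℕ.* q)) C k) ℕ.* ((suc (2 ℕ.* q) ∸ 2 ℕ.* k) ℕ.^ (2 ℕ.* p))))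

{-# OPTIONS --safe #-}
module Submission where

-- Let T = x / sinh x and res_k H = [x^k] T^(k+1) H, the residue of H / sinh^(k+1).  Expanding
-- cosh^(2q+1) = 4^(-q) Σ_k C(2q+1,k) cosh((2q+1-2k) x) identifies the inner sums with Taylor
-- coefficients of cosh^(2q+1) log cosh and of cosh^(2q+1) gd, where gd = ∫ sech has the Euler
-- numbers as coefficients and (log cosh)' = tanh = 2 coth 2x - coth x is expanded by Bernoulli
-- numbers; hence the left-hand sides are res_(2n) (cosh^(2q+1) log cosh) and
-- res_(2n-1) (cosh^(2q+1) gd).  Because res_(k+2) (sinh² H) = res_k H and cosh² = 1 + sinh²,
-- these residues a(q, t), with n = q + t + 1, satisfy a(q+1, t) = a(q, t+1) + a(q, t).  For q = 0,
-- integration by parts, (k+1) res_(k+1) (cosh F) = res_k F', reduces them to res_(2t) sech,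
-- which is (-1)^t because sech + sinh² sech = cosh has vanishing residues.  The closed forms are
-- (-1)^t B(q+1, t+1) / 2 and (-1)^t B(q+1, t+½) / 2, which satisfy the same recurrence, by
-- B(a, b) = B(a+1, b) + B(a, b+1), and have the same values at q = 0.

open import Defs
open import Data.Nat as ℕ using (ℕ; zero; suc; _∸_; _!; _<_; _≤_)
import Data.Nat.Properties as ℕP
open import Data.Nat.Combinatorics using (_C_; nCk≡nC[n∸k]; k![n∸k]!∣n!)
open import Data.Nat.Combinatorics.Specification using (nCk≡n!/k![n-k]!)
open import Data.Nat.DivMod using (m/n*n≡m)
import Data.Nat.Solver
open import Data.Integer as ℤ using (+_)
import Data.Integer.Properties as ℤP
open import Data.Rational using (ℚ; 0ℚ; 1ℚ; ½; _+_; _*_; -_; _/_; toℚᵘ)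
import Data.Rational.Properties as ℚP
import Data.Rational.Unnormalised as ℚᵘ
import Data.Rational.Unnormalised.Properties as ℚᵘP
import Data.Rational.Solver
open import Data.Fin using (toℕ)
import Data.Vec.Functional as Vector
open import Data.List using (List; []; _∷_; zipWith; map; applyUpTo)
open import Data.Maybe using (Maybe; just; nothing)
open import Data.Product using (_×_; _,_)
open import Relation.Nullary using (yes; no)
open import Algebra.Bundles using (CommutativeRing; CommutativeMonoid; CommutativeSemiring)
open import Algebra.Structures using (IsCommutativeRing)
import Algebra.Solver.Ring.AlmostCommutativeRing as ACR
import Algebra.Properties.CommutativeSemiring.Binomial
import Algebra.Definitions.RawMonoid
open import Algebra.Properties.CommutativeSemiring.Exp
  (CommutativeRing.commutativeSemiring ℚP.+-*-commutativeRing) using (_^_; ^-homo-*; ^-distrib-*)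
open import Algebra.Properties.CommutativeSemigroup
  (CommutativeMonoid.commutativeSemigroup ℚP.+-0-commutativeMonoid) using () renaming (interchange to +-interchange)
open import Algebra.Properties.Group ℚP.+-0-group
  using () renaming (⁻¹-involutive to neg-involutive; inverseˡ-unique to +-inverseˡ-unique)
open import Relation.Binary.Structures using (IsEquivalence)
open import Relation.Binary.Bundles using (Setoid)
open import Relation.Binary.PropositionalEquality
import Relation.Binary.Reasoning.Setoid

module ℚ-Solver = Data.Rational.Solver.+-*-Solver
module ℕ-Solver = Data.Nat.Solver.+-*-Solver

module Arithmetic where
  open ≡-Reasoning

  ∑-cong-< : ∀ n {f g : ℕ → ℚ} → (∀ k → k < n → f k ≡ g k) → ∑ n f ≡ ∑ n g
  ∑-cong-< zero    f≡g = refl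
  ∑-cong-< (suc n) f≡g =
    cong₂ _+_ (∑-cong-< n (λ k k<n → f≡g k (ℕP.m<n⇒m<1+n k<n))) (f≡g n (ℕP.n<1+n n))

  ∑-cong : ∀ n {f g : ℕ → ℚ} → (∀ k → f k ≡ g k) → ∑ n f ≡ ∑ n g
  ∑-cong n f≡g = ∑-cong-< n (λ k _ → f≡g k)

  ∑-zero : ∀ n → ∑ n (λ _ → 0ℚ) ≡ 0ℚ
  ∑-zero zero    = refl
  ∑-zero (suc n) = trans (ℚP.+-identityʳ _) (∑-zero n)

  ∑-distrib-+ : ∀ n (f g : ℕ → ℚ) → ∑ n (λ k → f k + g k) ≡ ∑ n f + ∑ n g
  ∑-distrib-+ zero    f g = refl
  ∑-distrib-+ (suc n) f g = begin
    ∑ n (λ k → f k + g k) + (f n + g n) ≡⟨ cong (_+ (f n + g n)) (∑-distrib-+ n f g) ⟩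
    (∑ n f + ∑ n g) + (f n + g n)       ≡⟨ +-interchange (∑ n f) (∑ n g) (f n) (g n) ⟩
    (∑ n f + f n) + (∑ n g + g n)       ∎

  *-distribˡ-∑ : ∀ n a (f : ℕ → ℚ) → a * ∑ n f ≡ ∑ n (λ k → a * f k)
  *-distribˡ-∑ zero    a f = ℚP.*-zeroʳ a
  *-distribˡ-∑ (suc n) a f =
    trans (ℚP.*-distribˡ-+ a (∑ n f) (f n)) (cong (_+ a * f n) (*-distribˡ-∑ n a f))

  *-distribʳ-∑ : ∀ n a (f : ℕ → ℚ) → ∑ n f * a ≡ ∑ n (λ k → f k * a)
  *-distribʳ-∑ n a f = begin
    ∑ n f * a            ≡⟨ ℚP.*-comm (∑ n f) a ⟩
    a * ∑ n f            ≡⟨ *-distribˡ-∑ n a f ⟩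
    ∑ n (λ k → a * f k)  ≡⟨ ∑-cong n (λ k → ℚP.*-comm a (f k)) ⟩
    ∑ n (λ k → f k * a)  ∎

  neg-distrib-∑ : ∀ n (f : ℕ → ℚ) → - ∑ n f ≡ ∑ n (λ k → - f k)
  neg-distrib-∑ zero    f = refl
  neg-distrib-∑ (suc n) f =
    trans (ℚP.neg-distrib-+ (∑ n f) (f n)) (cong (_+ - f n) (neg-distrib-∑ n f))

  ∑-unfoldˡ : ∀ n (f : ℕ → ℚ) → ∑ (suc n) f ≡ f 0 + ∑ n (λ k → f (suc k))
  ∑-unfoldˡ zero    f = trans (ℚP.+-identityˡ (f 0)) (sym (ℚP.+-identityʳ (f 0)))
  ∑-unfoldˡ (suc n) f = begin
    ∑ (suc n) f + f (suc n)                    ≡⟨ cong (_+ f (suc n)) (∑-unfoldˡ n f) ⟩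
    (f 0 + ∑ n (λ k → f (suc k))) + f (suc n)  ≡⟨ ℚP.+-assoc (f 0) _ _ ⟩
    f 0 + (∑ n (λ k → f (suc k)) + f (suc n))  ∎

  ∑-split : ∀ m n (f : ℕ → ℚ) → ∑ (m ℕ.+ n) f ≡ ∑ m f + ∑ n (λ k → f (m ℕ.+ k))
  ∑-split m zero    f = trans (cong (λ z → ∑ z f) (ℕP.+-identityʳ m)) (sym (ℚP.+-identityʳ (∑ m f)))
  ∑-split m (suc n) f = begin
    ∑ (m ℕ.+ suc n) f                                       ≡⟨ cong (λ z → ∑ z f) (ℕP.+-suc m n) ⟩
    ∑ (m ℕ.+ n) f + f (m ℕ.+ n)                             ≡⟨ cong (_+ f (m ℕ.+ n)) (∑-split m n f) ⟩
    (∑ m f + ∑ n (λ k → f (m ℕ.+ k))) + f (m ℕ.+ n)         ≡⟨ ℚP.+-assoc (∑ m f) _ _ ⟩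
    ∑ m f + (∑ n (λ k → f (m ℕ.+ k)) + f (m ℕ.+ n))         ∎

  ∑-reverse : ∀ n (f : ℕ → ℚ) → ∑ n f ≡ ∑ n (λ k → f (n ∸ suc k))
  ∑-reverse zero    f = refl
  ∑-reverse (suc n) f = begin
    ∑ n f + f n                              ≡⟨ cong (_+ f n) (∑-reverse n f) ⟩
    ∑ n (λ k → f (n ∸ suc k)) + f n          ≡⟨ ℚP.+-comm _ (f n) ⟩
    f n + ∑ n (λ k → f (n ∸ suc k))          ≡⟨ ∑-unfoldˡ n (λ k → f (n ∸ k)) ⟨
    ∑ (suc n) (λ k → f (suc n ∸ suc k))      ∎

  2*suc : ∀ m → 2 ℕ.* suc m ≡ suc (suc (2 ℕ.* m))
  2*suc m = ℕP.*-suc 2 m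

  ∑-evens-odds : ∀ m (f : ℕ → ℚ) →
    ∑ (2 ℕ.* m) f ≡ ∑ m (λ i → f (2 ℕ.* i)) + ∑ m (λ i → f (suc (2 ℕ.* i)))
  ∑-evens-odds zero    f = refl
  ∑-evens-odds (suc m) f = begin
    ∑ (2 ℕ.* suc m) f                         ≡⟨ cong (λ z → ∑ z f) (2*suc m) ⟩
    (∑ (2 ℕ.* m) f + f (2 ℕ.* m)) + f (suc (2 ℕ.* m))
      ≡⟨ cong (λ z → (z + f (2 ℕ.* m)) + f (suc (2 ℕ.* m))) (∑-evens-odds m f) ⟩
    ((evens + odds) + f (2 ℕ.* m)) + f (suc (2 ℕ.* m))
      ≡⟨ ℚP.+-assoc (evens + odds) _ _ ⟩
    (evens + odds) + (f (2 ℕ.* m) + f (suc (2 ℕ.* m)))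
      ≡⟨ +-interchange evens odds _ _ ⟩
    (evens + f (2 ℕ.* m)) + (odds + f (suc (2 ℕ.* m))) ∎
    where
    evens = ∑ m (λ i → f (2 ℕ.* i))
    odds  = ∑ m (λ i → f (suc (2 ℕ.* i)))

  -- ℕ→ℚ a is by definition fromℚᵘ (a / 1), so identities for it are checked in ℚᵘ.
  toℚᵘ-ℕ→ℚ : ∀ a → toℚᵘ (ℕ→ℚ a) ℚᵘ.≃ ℚᵘ.mkℚᵘ (+ a) 0
  toℚᵘ-ℕ→ℚ a = ℚP.toℚᵘ-fromℚᵘ (ℚᵘ.mkℚᵘ (+ a) 0)

  ℕ→ℚ-+ : ∀ a b → ℕ→ℚ (a ℕ.+ b) ≡ ℕ→ℚ a + ℕ→ℚ b
  ℕ→ℚ-+ a b = ℚP.toℚᵘ-injective (ℚᵘP.≃-trans (toℚᵘ-ℕ→ℚ (a ℕ.+ b)) (ℚᵘP.≃-trans (ℚᵘ.*≡* num)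
    (ℚᵘP.≃-sym (ℚᵘP.≃-trans (ℚP.toℚᵘ-homo-+ (ℕ→ℚ a) (ℕ→ℚ b)) (ℚᵘP.+-cong (toℚᵘ-ℕ→ℚ a) (toℚᵘ-ℕ→ℚ b))))))
    where
    num : + (a ℕ.+ b) ℤ.* + 1 ≡ (+ a ℤ.* + 1 ℤ.+ + b ℤ.* + 1) ℤ.* + 1
    num = cong (ℤ._* + 1) (trans (ℤP.pos-+ a b)
            (sym (cong₂ ℤ._+_ (ℤP.*-identityʳ (+ a)) (ℤP.*-identityʳ (+ b)))))

  ℕ→ℚ-* : ∀ a b → ℕ→ℚ (a ℕ.* b) ≡ ℕ→ℚ a * ℕ→ℚ b
  ℕ→ℚ-* a b = ℚP.toℚᵘ-injective (ℚᵘP.≃-trans (toℚᵘ-ℕ→ℚ (a ℕ.* b)) (ℚᵘP.≃-trans (ℚᵘ.*≡* num)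
    (ℚᵘP.≃-sym (ℚᵘP.≃-trans (ℚP.toℚᵘ-homo-* (ℕ→ℚ a) (ℕ→ℚ b)) (ℚᵘP.*-cong (toℚᵘ-ℕ→ℚ a) (toℚᵘ-ℕ→ℚ b))))))
    where
    num : + (a ℕ.* b) ℤ.* + 1 ≡ (+ a ℤ.* + b) ℤ.* + 1
    num = cong (ℤ._* + 1) (ℤP.pos-* a b)

  ℕ→ℚ-suc : ∀ a → ℕ→ℚ (suc a) ≡ 1ℚ + ℕ→ℚ a
  ℕ→ℚ-suc = ℕ→ℚ-+ 1

  ℕ→ℚ-^ : ∀ a n → ℕ→ℚ a ^ n ≡ ℕ→ℚ (a ℕ.^ n)
  ℕ→ℚ-^ a zero    = refl
  ℕ→ℚ-^ a (suc n) = trans (cong (ℕ→ℚ a *_) (ℕ→ℚ-^ a n)) (sym (ℕ→ℚ-* a (a ℕ.^ n)))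

  ℕ→ℚ-∸ : ∀ {m n} → n ≤ m → ℕ→ℚ (m ∸ n) ≡ ℕ→ℚ m + - ℕ→ℚ n
  ℕ→ℚ-∸ {m} {n} n≤m = begin
    ℕ→ℚ (m ∸ n)                          ≡⟨ ℚ-Solver.solve 2 (λ a b → a := (a :+ b) :+ :- b) refl (ℕ→ℚ (m ∸ n)) (ℕ→ℚ n) ⟩
    (ℕ→ℚ (m ∸ n) + ℕ→ℚ n) + - ℕ→ℚ n      ≡⟨ cong (_+ - ℕ→ℚ n) (ℕ→ℚ-+ (m ∸ n) n) ⟨
    ℕ→ℚ (m ∸ n ℕ.+ n) + - ℕ→ℚ n          ≡⟨ cong (λ k → ℕ→ℚ k + - ℕ→ℚ n) (ℕP.m∸n+n≡m n≤m) ⟩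
    ℕ→ℚ m + - ℕ→ℚ n                      ∎
    where open ℚ-Solver

  ℕ→ℚ-*-/ : ∀ d a .{{_ : ℕ.NonZero d}} → ℕ→ℚ d * (+ a / d) ≡ ℕ→ℚ a
  ℕ→ℚ-*-/ (suc d) a = ℚP.toℚᵘ-injective (ℚᵘP.≃-trans (ℚP.toℚᵘ-homo-* (ℕ→ℚ (suc d)) (+ a / suc d))
    (ℚᵘP.≃-trans (ℚᵘP.*-cong (toℚᵘ-ℕ→ℚ (suc d)) (ℚP.toℚᵘ-fromℚᵘ (ℚᵘ.mkℚᵘ (+ a) d)))
    (ℚᵘP.≃-trans (ℚᵘ.*≡* num) (ℚᵘP.≃-sym (toℚᵘ-ℕ→ℚ a)))))
    where
    num : (+ suc d ℤ.* + a) ℤ.* + 1 ≡ + a ℤ.* + (1 ℕ.* suc d)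
    num = trans (ℤP.*-identityʳ _) (trans (ℤP.*-comm (+ suc d) (+ a))
            (cong (λ z → + a ℤ.* + z) (sym (ℕP.*-identityˡ (suc d)))))

  ℕ→ℚ-inverseʳ : ∀ d .{{_ : ℕ.NonZero d}} → ℕ→ℚ d * (+ 1 / d) ≡ 1ℚ
  ℕ→ℚ-inverseʳ d = ℕ→ℚ-*-/ d 1

  *-cancelˡ-ℕ→ℚ : ∀ d .{{_ : ℕ.NonZero d}} {x y} → ℕ→ℚ d * x ≡ ℕ→ℚ d * y → x ≡ y
  *-cancelˡ-ℕ→ℚ d {x} {y} eq = begin
    x                   ≡⟨ ℚP.*-identityˡ x ⟨
    1ℚ * x              ≡⟨ cong (_* x) inverseˡ ⟨
    (i * ℕ→ℚ d) * x     ≡⟨ ℚP.*-assoc i _ x ⟩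
    i * (ℕ→ℚ d * x)     ≡⟨ cong (i *_) eq ⟩
    i * (ℕ→ℚ d * y)     ≡⟨ ℚP.*-assoc i _ y ⟨
    (i * ℕ→ℚ d) * y     ≡⟨ cong (_* y) inverseˡ ⟩
    1ℚ * y              ≡⟨ ℚP.*-identityˡ y ⟩
    y                   ∎
    where
    i = + 1 / d
    inverseˡ : i * ℕ→ℚ d ≡ 1ℚ
    inverseˡ = trans (ℚP.*-comm i _) (ℕ→ℚ-inverseʳ d)

  x≡-x⇒x≡0 : ∀ x → x ≡ - x → x ≡ 0ℚ
  x≡-x⇒x≡0 x x≡-x = begin
    x               ≡⟨ ℚ-Solver.solve 1 (λ x → x := con ½ :* (x :+ x)) refl x ⟩
    ½ * (x + x)     ≡⟨ cong (λ z → ½ * (z + x)) x≡-x ⟩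
    ½ * (- x + x)   ≡⟨ cong (½ *_) (ℚP.+-inverseˡ x) ⟩
    0ℚ              ∎
    where open ℚ-Solver

  !*invFact : ∀ k → ℕ→ℚ (k !) * invFact k ≡ 1ℚ
  !*invFact k = ℕ→ℚ-inverseʳ (k !) {{k ℕP.!≢0}}

  invFact-suc : ∀ k → ℕ→ℚ (suc k) * invFact (suc k) ≡ invFact k
  invFact-suc k = begin
    ℕ→ℚ (suc k) * i′                               ≡⟨ ℚP.*-identityʳ _ ⟨
    (ℕ→ℚ (suc k) * i′) * 1ℚ                        ≡⟨ cong ((ℕ→ℚ (suc k) * i′) *_) (!*invFact k) ⟨
    (ℕ→ℚ (suc k) * i′) * (ℕ→ℚ (k !) * i)
      ≡⟨ ℚ-Solver.solve 4 (λ a b c d → (a :* b) :* (c :* d) := ((a :* c) :* b) :* d) refl (ℕ→ℚ (suc k)) i′ (ℕ→ℚ (k !)) i ⟩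
    ((ℕ→ℚ (suc k) * ℕ→ℚ (k !)) * i′) * i           ≡⟨ cong (λ z → (z * i′) * i) (ℕ→ℚ-* (suc k) (k !)) ⟨
    (ℕ→ℚ (suc k !) * i′) * i                       ≡⟨ cong (_* i) (!*invFact (suc k)) ⟩
    1ℚ * i                                         ≡⟨ ℚP.*-identityˡ i ⟩
    i                                              ∎
    where
    open ℚ-Solver
    i′ = invFact (suc k)
    i  = invFact k

  binomial-invFact : ∀ {n k} → k ≤ n → invFact n * ℕ→ℚ (n C k) ≡ invFact k * invFact (n ∸ k)
  binomial-invFact {n} {k} k≤n = *-cancelˡ-ℕ→ℚ (k ! ℕ.* (n ∸ k) !) {{ℕP._!*_!≢0 k (n ∸ k)}} (begin
    ℕ→ℚ (k ! ℕ.* (n ∸ k) !) * (invFact n * ℕ→ℚ (n C k))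
      ≡⟨ ℚ-Solver.solve 3 (λ a i c → a :* (i :* c) := (c :* a) :* i) refl (ℕ→ℚ (k ! ℕ.* (n ∸ k) !)) (invFact n) (ℕ→ℚ (n C k)) ⟩
    (ℕ→ℚ (n C k) * ℕ→ℚ (k ! ℕ.* (n ∸ k) !)) * invFact n
      ≡⟨ cong (_* invFact n) (trans (sym (ℕ→ℚ-* (n C k) _)) (cong ℕ→ℚ C*!*!≡!)) ⟩
    ℕ→ℚ (n !) * invFact n
      ≡⟨ !*invFact n ⟩
    1ℚ
      ≡⟨ cong₂ _*_ (!*invFact k) (!*invFact (n ∸ k)) ⟨
    (ℕ→ℚ (k !) * invFact k) * (ℕ→ℚ ((n ∸ k) !) * invFact (n ∸ k))
      ≡⟨ ℚ-Solver.solve 4 (λ a i b j → (a :* i) :* (b :* j) := (a :* b) :* (i :* j)) refl (ℕ→ℚ (k !)) (invFact k) (ℕ→ℚ ((n ∸ k) !)) (invFact (n ∸ k)) ⟩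
    (ℕ→ℚ (k !) * ℕ→ℚ ((n ∸ k) !)) * (invFact k * invFact (n ∸ k))
      ≡⟨ cong (_* (invFact k * invFact (n ∸ k))) (ℕ→ℚ-* (k !) ((n ∸ k) !)) ⟨
    ℕ→ℚ (k ! ℕ.* (n ∸ k) !) * (invFact k * invFact (n ∸ k)) ∎)
    where
    open ℚ-Solver
    C*!*!≡! : (n C k) ℕ.* (k ! ℕ.* (n ∸ k) !) ≡ n !
    C*!*!≡! = trans (cong (ℕ._* (k ! ℕ.* (n ∸ k) !)) (nCk≡n!/k![n-k]! k≤n))
                    (m/n*n≡m {{ℕP._!*_!≢0 k (n ∸ k)}} (k![n∸k]!∣n! k≤n))

  sgn-2*+ : ∀ k n → sgn (2 ℕ.* k ℕ.+ n) ≡ sgn n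
  sgn-2*+ zero    n = refl
  sgn-2*+ (suc k) n = begin
    sgn (2 ℕ.* suc k ℕ.+ n)          ≡⟨ cong (λ z → sgn (z ℕ.+ n)) (2*suc k) ⟩
    - - sgn (2 ℕ.* k ℕ.+ n)          ≡⟨ neg-involutive _ ⟩
    sgn (2 ℕ.* k ℕ.+ n)              ≡⟨ sgn-2*+ k n ⟩
    sgn n                            ∎

  -1^-even : ∀ j → (- 1ℚ) ^ (2 ℕ.* j) ≡ 1ℚ
  -1^-even zero    = refl
  -1^-even (suc j) = begin
    (- 1ℚ) ^ (2 ℕ.* suc j)                 ≡⟨ cong ((- 1ℚ) ^_) (2*suc j) ⟩
    - 1ℚ * (- 1ℚ * (- 1ℚ) ^ (2 ℕ.* j))     ≡⟨ cong (λ z → - 1ℚ * (- 1ℚ * z)) (-1^-even j) ⟩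
    1ℚ                                     ∎

  -1^-odd : ∀ j → (- 1ℚ) ^ suc (2 ℕ.* j) ≡ - 1ℚ
  -1^-odd j = cong (- 1ℚ *_) (-1^-even j)

  -1*x : ∀ x → - 1ℚ * x ≡ - x
  -1*x x = sym (trans (cong -_ (sym (ℚP.*-identityˡ x))) (ℚP.neg-distribˡ-* 1ℚ x))

  ^-neg-even : ∀ a p → (- a) ^ (2 ℕ.* p) ≡ a ^ (2 ℕ.* p)
  ^-neg-even a p = begin
    (- a) ^ (2 ℕ.* p)                      ≡⟨ cong (_^ (2 ℕ.* p)) (-1*x a) ⟨
    (- 1ℚ * a) ^ (2 ℕ.* p)                 ≡⟨ ^-distrib-* (- 1ℚ) a (2 ℕ.* p) ⟩
    (- 1ℚ) ^ (2 ℕ.* p) * a ^ (2 ℕ.* p)     ≡⟨ cong (_* a ^ (2 ℕ.* p)) (-1^-even p) ⟩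
    1ℚ * a ^ (2 ℕ.* p)                     ≡⟨ ℚP.*-identityˡ _ ⟩
    a ^ (2 ℕ.* p)                          ∎

  ½^-even : ∀ q → ½ ^ (2 ℕ.* q) ≡ (+ 1 / 4 ℕ.^ q) {{ℕP.m^n≢0 4 q}}
  ½^-even q = *-cancelˡ-ℕ→ℚ (4 ℕ.^ q) {{ℕP.m^n≢0 4 q}}
    (trans (ℚP.*-comm _ (½ ^ (2 ℕ.* q))) (trans (4^*½^ q) (sym (ℕ→ℚ-inverseʳ (4 ℕ.^ q) {{ℕP.m^n≢0 4 q}}))))
    where
    4^*½^ : ∀ q → ½ ^ (2 ℕ.* q) * ℕ→ℚ (4 ℕ.^ q) ≡ 1ℚ
    4^*½^ zero    = refl
    4^*½^ (suc q) = begin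
      ½ ^ (2 ℕ.* suc q) * ℕ→ℚ (4 ℕ.^ suc q)
        ≡⟨ cong₂ (λ m x → ½ ^ m * x) (2*suc q) (ℕ→ℚ-* 4 (4 ℕ.^ q)) ⟩
      (½ * (½ * ½ ^ (2 ℕ.* q))) * (ℕ→ℚ 4 * ℕ→ℚ (4 ℕ.^ q))
        ≡⟨ ℚ-Solver.solve 2 (λ a b → (con ½ :* (con ½ :* a)) :* (con (ℕ→ℚ 4) :* b) := a :* b) refl (½ ^ (2 ℕ.* q)) (ℕ→ℚ (4 ℕ.^ q)) ⟩
      ½ ^ (2 ℕ.* q) * ℕ→ℚ (4 ℕ.^ q)
        ≡⟨ 4^*½^ q ⟩
      1ℚ ∎
      where open ℚ-Solver

open Arithmetic

module Pascal where
  open ≡-Reasoning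

  PascalRecurrence : (ℕ → ℕ → ℚ) → Set
  PascalRecurrence a = ∀ q t → a (suc q) t ≡ a q (suc t) + a q t

  pascal-unique : ∀ {a b} → PascalRecurrence a → PascalRecurrence b →
                  (∀ t → a 0 t ≡ b 0 t) → ∀ q t → a q t ≡ b q t
  pascal-unique             ra rb a0≡b0 zero    t = a0≡b0 t
  pascal-unique {a} {b} ra rb a0≡b0 (suc q) t = begin
    a (suc q) t             ≡⟨ ra q t ⟩
    a q (suc t) + a q t     ≡⟨ cong₂ _+_ (pascal-unique {a} {b} ra rb a0≡b0 q (suc t)) (pascal-unique {a} {b} ra rb a0≡b0 q t) ⟩
    b q (suc t) + b q t     ≡⟨ rb q t ⟨
    b (suc q) t             ∎

  BetaRecurrence : (ℕ → ℕ → ℚ) → Set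
  BetaRecurrence c = ∀ q t → c q t ≡ c (suc q) t + c q (suc t)

  alternating-pascal : ∀ {c} → BetaRecurrence c → PascalRecurrence (λ q t → sgn t * c q t)
  alternating-pascal {c} rec q t = begin
    sgn t * c (suc q) t
      ≡⟨ ℚ-Solver.solve 3 (λ s a b → s :* a := :- s :* b :+ s :* (a :+ b)) refl (sgn t) (c (suc q) t) (c q (suc t)) ⟩
    - sgn t * c q (suc t) + sgn t * (c (suc q) t + c q (suc t)) ≡⟨ cong (λ z → - sgn t * c q (suc t) + sgn t * z) (rec q t) ⟨
    - sgn t * c q (suc t) + sgn t * c q t                 ∎
    where open ℚ-Solver

open Pascal

module PowerSeries where
  open ≡-Reasoning

  infix 4 _≈_
  _≈_ : PS → PS → Set
  f ≈ g = ∀ n → f n ≡ g n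

  ≈-refl : ∀ {f} → f ≈ f
  ≈-refl _ = refl

  ≈-sym : ∀ {f g} → f ≈ g → g ≈ f
  ≈-sym f≈g n = sym (f≈g n)

  ≈-trans : ∀ {f g h} → f ≈ g → g ≈ h → f ≈ h
  ≈-trans f≈g g≈h n = trans (f≈g n) (g≈h n)

  ≈-isEquivalence : IsEquivalence _≈_
  ≈-isEquivalence = record { refl = ≈-refl ; sym = ≈-sym ; trans = ≈-trans }

  PS-setoid : Setoid _ _
  PS-setoid = record { Carrier = PS ; _≈_ = _≈_ ; isEquivalence = ≈-isEquivalence }

  module ≈-Reasoning = Relation.Binary.Reasoning.Setoid PS-setoid

  -- _⊛_ and _^PS_ have no fixity declaration in Defs, so they bind tighter than _⊕_ and _·_.
  infixl 6 _⊕_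
  _⊕_ : PS → PS → PS
  (f ⊕ g) n = f n + g n

  ⊖_ : PS → PS
  (⊖ f) n = - f n

  𝟘 : PS
  𝟘 _ = 0ℚ

  infixl 7 _·_
  _·_ : ℚ → PS → PS
  (a · f) n = a * f n

  shift : PS → PS
  shift f n = f (suc n)

  ⊕-cong : ∀ {f f′ g g′} → f ≈ f′ → g ≈ g′ → f ⊕ g ≈ f′ ⊕ g′
  ⊕-cong f≈f′ g≈g′ n = cong₂ _+_ (f≈f′ n) (g≈g′ n)

  ⊖-cong : ∀ {f g} → f ≈ g → ⊖ f ≈ ⊖ g
  ⊖-cong f≈g n = cong -_ (f≈g n)

  ·-cong : ∀ a {f g} → f ≈ g → a · f ≈ a · g
  ·-cong a f≈g n = cong (a *_) (f≈g n)

  ⊛-congˡ : ∀ f {g g′} → g ≈ g′ → f ⊛ g ≈ f ⊛ g′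
  ⊛-congˡ f g≈g′ n = ∑-cong (suc n) (λ k → cong (f k *_) (g≈g′ (n ∸ k)))

  ⊛-congʳ : ∀ {f f′} g → f ≈ f′ → f ⊛ g ≈ f′ ⊛ g
  ⊛-congʳ g f≈f′ n = ∑-cong (suc n) (λ k → cong (_* g (n ∸ k)) (f≈f′ k))

  ⊛-cong : ∀ {f f′ g g′} → f ≈ f′ → g ≈ g′ → f ⊛ g ≈ f′ ⊛ g′
  ⊛-cong {f′ = f′} {g = g} f≈f′ g≈g′ = ≈-trans (⊛-congʳ g f≈f′) (⊛-congˡ f′ g≈g′)

  ⊛-sucˡ : ∀ f g n → (f ⊛ g) (suc n) ≡ f 0 * g (suc n) + (shift f ⊛ g) n
  ⊛-sucˡ f g n = ∑-unfoldˡ (suc n) (λ k → f k * g (suc n ∸ k))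

  ⊛-sucʳ : ∀ f g n → (f ⊛ g) (suc n) ≡ (f ⊛ shift g) n + f (suc n) * g 0
  ⊛-sucʳ f g n = cong₂ _+_
    (∑-cong-< (suc n) (λ k k<sn → cong (λ z → f k * g z) (ℕP.+-∸-assoc 1 (ℕP.≤-pred k<sn))))
    (cong (λ z → f (suc n) * g z) (ℕP.n∸n≡0 n))

  ⊛-zeroˡ : ∀ g → 𝟘 ⊛ g ≈ 𝟘
  ⊛-zeroˡ g n = trans (∑-cong (suc n) (λ k → ℚP.*-zeroˡ (g (n ∸ k)))) (∑-zero (suc n))

  ⊛-comm : ∀ f g → f ⊛ g ≈ g ⊛ f
  ⊛-comm f g zero    = cong (_+_ 0ℚ) (ℚP.*-comm (f 0) (g 0))
  ⊛-comm f g (suc n) = begin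
    (f ⊛ g) (suc n)                       ≡⟨ ⊛-sucʳ f g n ⟩
    (f ⊛ shift g) n + f (suc n) * g 0     ≡⟨ cong₂ _+_ (⊛-comm f (shift g) n) (ℚP.*-comm (f (suc n)) (g 0)) ⟩
    (shift g ⊛ f) n + g 0 * f (suc n)     ≡⟨ ℚP.+-comm ((shift g ⊛ f) n) (g 0 * f (suc n)) ⟩
    g 0 * f (suc n) + (shift g ⊛ f) n     ≡⟨ ⊛-sucˡ g f n ⟨
    (g ⊛ f) (suc n)                       ∎

  ⊛-distribˡ-⊕ : ∀ f g h → f ⊛ (g ⊕ h) ≈ f ⊛ g ⊕ f ⊛ h
  ⊛-distribˡ-⊕ f g h n = trans
    (∑-cong (suc n) (λ k → ℚP.*-distribˡ-+ (f k) (g (n ∸ k)) (h (n ∸ k))))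
    (∑-distrib-+ (suc n) _ _)

  ⊛-·ʳ : ∀ a f g → f ⊛ (a · g) ≈ a · (f ⊛ g)
  ⊛-·ʳ a f g n = trans
    (∑-cong (suc n) (λ k → ℚ-Solver.solve 3 (λ x y z → x :* (y :* z) := y :* (x :* z)) refl (f k) a (g (n ∸ k))))
    (sym (*-distribˡ-∑ (suc n) a (λ k → f k * g (n ∸ k))))
    where open ℚ-Solver

  ⊛-assoc : ∀ f g h → (f ⊛ g) ⊛ h ≈ f ⊛ (g ⊛ h)
  ⊛-assoc f g h zero    = ℚ-Solver.solve 3
    (λ x y z → con 0ℚ :+ (con 0ℚ :+ x :* y) :* z := con 0ℚ :+ x :* (con 0ℚ :+ y :* z)) refl (f 0) (g 0) (h 0)
    where open ℚ-Solver
  ⊛-assoc f g h (suc n) = begin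
    ((f ⊛ g) ⊛ h) (suc n)
      ≡⟨ ⊛-sucʳ (f ⊛ g) h n ⟩
    ((f ⊛ g) ⊛ shift h) n + (f ⊛ g) (suc n) * h 0
      ≡⟨ cong₂ _+_ (⊛-assoc f g (shift h) n) (cong (_* h 0) (⊛-sucʳ f g n)) ⟩
    (f ⊛ (g ⊛ shift h)) n + ((f ⊛ shift g) n + f (suc n) * g 0) * h 0
      ≡⟨ ℚ-Solver.solve 5 (λ A B c x y → A :+ (B :+ c :* x) :* y := (A :+ y :* B) :+ c :* (con 0ℚ :+ x :* y)) refl
           ((f ⊛ (g ⊛ shift h)) n) ((f ⊛ shift g) n) (f (suc n)) (g 0) (h 0) ⟩
    ((f ⊛ (g ⊛ shift h)) n + h 0 * (f ⊛ shift g) n) + f (suc n) * (g ⊛ h) 0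
      ≡⟨ cong (_+ f (suc n) * (g ⊛ h) 0) (sym shift-f⊛[g⊛h]) ⟩
    (f ⊛ shift (g ⊛ h)) n + f (suc n) * (g ⊛ h) 0
      ≡⟨ ⊛-sucʳ f (g ⊛ h) n ⟨
    (f ⊛ (g ⊛ h)) (suc n) ∎
    where
    open ℚ-Solver
    shift-g⊛h : shift (g ⊛ h) ≈ g ⊛ shift h ⊕ h 0 · shift g
    shift-g⊛h m = trans (⊛-sucʳ g h m) (cong (_+_ ((g ⊛ shift h) m)) (ℚP.*-comm (g (suc m)) (h 0)))
    shift-f⊛[g⊛h] : (f ⊛ shift (g ⊛ h)) n ≡ (f ⊛ (g ⊛ shift h)) n + h 0 * (f ⊛ shift g) n
    shift-f⊛[g⊛h] = trans (⊛-congˡ f shift-g⊛h n)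
      (trans (⊛-distribˡ-⊕ f (g ⊛ shift h) (h 0 · shift g) n) (cong (_+_ ((f ⊛ (g ⊛ shift h)) n)) (⊛-·ʳ (h 0) f (shift g) n)))

  ⊛-identityˡ : ∀ f → one ⊛ f ≈ f
  ⊛-identityˡ f zero    = trans (ℚP.+-identityˡ (1ℚ * f 0)) (ℚP.*-identityˡ (f 0))
  ⊛-identityˡ f (suc n) = begin
    (one ⊛ f) (suc n)                     ≡⟨ ⊛-sucˡ one f n ⟩
    1ℚ * f (suc n) + (shift one ⊛ f) n    ≡⟨ cong₂ _+_ (ℚP.*-identityˡ (f (suc n))) (⊛-zeroˡ f n) ⟩
    f (suc n) + 0ℚ                        ≡⟨ ℚP.+-identityʳ _ ⟩
    f (suc n)                             ∎

  ⊛-identityʳ : ∀ f → f ⊛ one ≈ f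
  ⊛-identityʳ f = ≈-trans (⊛-comm f one) (⊛-identityˡ f)

  ⊛-zeroʳ : ∀ f → f ⊛ 𝟘 ≈ 𝟘
  ⊛-zeroʳ f = ≈-trans (⊛-comm f 𝟘) (⊛-zeroˡ f)

  ⊛-·ˡ : ∀ a f g → (a · f) ⊛ g ≈ a · (f ⊛ g)
  ⊛-·ˡ a f g = ≈-trans (⊛-comm (a · f) g) (≈-trans (⊛-·ʳ a g f) (·-cong a (⊛-comm g f)))

  ⊖-⊛ : ∀ f g → (⊖ f) ⊛ g ≈ ⊖ (f ⊛ g)
  ⊖-⊛ f g n = trans (∑-cong (suc n) (λ k → sym (ℚP.neg-distribˡ-* (f k) (g (n ∸ k)))))
                    (sym (neg-distrib-∑ (suc n) (λ k → f k * g (n ∸ k))))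

  PS-isCommutativeRing : IsCommutativeRing _≈_ _⊕_ _⊛_ ⊖_ 𝟘 one
  PS-isCommutativeRing = record
    { isRing = record
      { +-isAbelianGroup = record
        { isGroup = record
          { isMonoid = record
            { isSemigroup = record
              { isMagma = record { isEquivalence = ≈-isEquivalence ; ∙-cong = ⊕-cong }
              ; assoc = λ f g h n → ℚP.+-assoc (f n) (g n) (h n) }
            ; identity = (λ f n → ℚP.+-identityˡ (f n)) , (λ f n → ℚP.+-identityʳ (f n)) }
          ; inverse = (λ f n → ℚP.+-inverseˡ (f n)) , (λ f n → ℚP.+-inverseʳ (f n))
          ; ⁻¹-cong = ⊖-cong }
        ; comm = λ f g n → ℚP.+-comm (f n) (g n) }
      ; *-cong = ⊛-cong
      ; *-assoc = ⊛-assoc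
      ; *-identity = ⊛-identityˡ , ⊛-identityʳ
      ; distrib = ⊛-distribˡ-⊕ , λ f g h → ≈-trans (⊛-comm (g ⊕ h) f)
          (≈-trans (⊛-distribˡ-⊕ f g h) (⊕-cong (⊛-comm f g) (⊛-comm f h)))
      }
    ; *-comm = ⊛-comm }

  PS-commutativeRing : CommutativeRing _ _
  PS-commutativeRing = record { isCommutativeRing = PS-isCommutativeRing }

  const : ℚ → PS
  const a = a · one

  const-⊛ : ∀ a f → const a ⊛ f ≈ a · f
  const-⊛ a f = ≈-trans (⊛-·ˡ a one f) (·-cong a (⊛-identityˡ f))

  const-+ : ∀ a b → const (a + b) ≈ const a ⊕ const b
  const-+ a b n = ℚP.*-distribʳ-+ (one n) a b

  -- A solver constant con a denotes const a, which is not definitionally 𝟘 (for a = 0) or one (for a = 1).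
  module PS-Solver where
    private
      PS-almostCommutativeRing : ACR.AlmostCommutativeRing _ _
      PS-almostCommutativeRing = ACR.fromCommutativeRing PS-commutativeRing

      const-homomorphism : ACR._-Raw-AlmostCommutative⟶_ ℚP.+-*-rawRing PS-almostCommutativeRing
      const-homomorphism = record
        { ⟦_⟧    = const
        ; +-homo = const-+
        ; *-homo = λ a b → ≈-sym (≈-trans (const-⊛ a (const b)) (λ n → sym (ℚP.*-assoc a b (one n))))
        ; -‿homo = λ a n → sym (ℚP.neg-distribˡ-* a (one n))
        ; 0-homo = λ n → ℚP.*-zeroˡ (one n)
        ; 1-homo = λ n → ℚP.*-identityˡ (one n) }

      const-≟ : ∀ a b → Maybe (const a ≈ const b)
      const-≟ a b with a ℚP.≟ b
      ... | yes refl = just ≈-refl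
      ... | no _     = nothing

    open import Algebra.Solver.Ring ℚP.+-*-rawRing PS-almostCommutativeRing const-homomorphism const-≟ public

  data Parity : ℕ → Set where
    even : ∀ j → Parity (2 ℕ.* j)
    odd  : ∀ j → Parity (suc (2 ℕ.* j))

  parity : ∀ n → Parity n
  parity zero = even 0
  parity (suc n) with parity n
  ... | even j = odd j
  ... | odd j  = subst Parity (2*suc j) (even (suc j))

  X : PS
  X zero    = 0ℚ
  X (suc n) = one n

  X-⊛-zero : ∀ f → (X ⊛ f) 0 ≡ 0ℚ
  X-⊛-zero f = trans (ℚP.+-identityˡ _) (ℚP.*-zeroˡ (f 0))

  X-⊛-suc : ∀ f n → (X ⊛ f) (suc n) ≡ f n
  X-⊛-suc f n = begin
    (X ⊛ f) (suc n)                  ≡⟨ ⊛-sucˡ X f n ⟩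
    0ℚ * f (suc n) + (one ⊛ f) n     ≡⟨ cong₂ _+_ (ℚP.*-zeroˡ (f (suc n))) (⊛-identityˡ f n) ⟩
    0ℚ + f n                         ≡⟨ ℚP.+-identityˡ _ ⟩
    f n                              ∎

  X-⊛-cancel : ∀ {f g} → X ⊛ f ≈ X ⊛ g → f ≈ g
  X-⊛-cancel {f} {g} Xf≈Xg n = trans (sym (X-⊛-suc f n)) (trans (Xf≈Xg (suc n)) (X-⊛-suc g n))

  -- The Euler operator x d/dx.
  θ : PS → PS
  θ f n = ℕ→ℚ n * f n

  θ-cong : ∀ {f g} → f ≈ g → θ f ≈ θ g
  θ-cong f≈g n = cong (ℕ→ℚ n *_) (f≈g n)

  θ-⊕ : ∀ f g → θ (f ⊕ g) ≈ θ f ⊕ θ g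
  θ-⊕ f g n = ℚP.*-distribˡ-+ (ℕ→ℚ n) (f n) (g n)

  θ-⊖ : ∀ f → θ (⊖ f) ≈ ⊖ θ f
  θ-⊖ f n = sym (ℚP.neg-distribʳ-* (ℕ→ℚ n) (f n))

  θ-one : θ one ≈ 𝟘
  θ-one zero    = refl
  θ-one (suc n) = ℚP.*-zeroʳ (ℕ→ℚ (suc n))

  θ-⊛ : ∀ f g → θ (f ⊛ g) ≈ θ f ⊛ g ⊕ f ⊛ θ g
  θ-⊛ f g n = begin
    ℕ→ℚ n * ∑ (suc n) (λ k → f k * g (n ∸ k))
      ≡⟨ *-distribˡ-∑ (suc n) (ℕ→ℚ n) _ ⟩
    ∑ (suc n) (λ k → ℕ→ℚ n * (f k * g (n ∸ k)))
      ≡⟨ ∑-cong-< (suc n) (λ k k<sn → leibniz k (ℕP.≤-pred k<sn)) ⟩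
    ∑ (suc n) (λ k → (ℕ→ℚ k * f k) * g (n ∸ k) + f k * (ℕ→ℚ (n ∸ k) * g (n ∸ k)))
      ≡⟨ ∑-distrib-+ (suc n) _ _ ⟩
    (θ f ⊛ g ⊕ f ⊛ θ g) n ∎
    where
    leibniz : ∀ k → k ≤ n → ℕ→ℚ n * (f k * g (n ∸ k)) ≡ (ℕ→ℚ k * f k) * g (n ∸ k) + f k * (ℕ→ℚ (n ∸ k) * g (n ∸ k))
    leibniz k k≤n = begin
      ℕ→ℚ n * (f k * g (n ∸ k))
        ≡⟨ cong (λ z → ℕ→ℚ z * (f k * g (n ∸ k))) (ℕP.m+[n∸m]≡n k≤n) ⟨
      ℕ→ℚ (k ℕ.+ (n ∸ k)) * (f k * g (n ∸ k))
        ≡⟨ cong (_* (f k * g (n ∸ k))) (ℕ→ℚ-+ k (n ∸ k)) ⟩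
      (ℕ→ℚ k + ℕ→ℚ (n ∸ k)) * (f k * g (n ∸ k))
        ≡⟨ ℚ-Solver.solve 4 (λ a b x y → (a :+ b) :* (x :* y) := (a :* x) :* y :+ x :* (b :* y)) refl
             (ℕ→ℚ k) (ℕ→ℚ (n ∸ k)) (f k) (g (n ∸ k)) ⟩
      (ℕ→ℚ k * f k) * g (n ∸ k) + f k * (ℕ→ℚ (n ∸ k) * g (n ∸ k)) ∎
      where open ℚ-Solver

  θ≈𝟘⇒const : ∀ f → θ f ≈ 𝟘 → f ≈ const (f 0)
  θ≈𝟘⇒const f θf≈𝟘 zero    = sym (ℚP.*-identityʳ (f 0))
  θ≈𝟘⇒const f θf≈𝟘 (suc m) = trans
    (*-cancelˡ-ℕ→ℚ (suc m) (trans (θf≈𝟘 (suc m)) (sym (ℚP.*-zeroʳ (ℕ→ℚ (suc m))))))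
    (sym (ℚP.*-zeroʳ (f 0)))

  -- σ a f is f(a x).
  σ : ℚ → PS → PS
  σ a f n = a ^ n * f n

  σ-cong : ∀ a {f g} → f ≈ g → σ a f ≈ σ a g
  σ-cong a f≈g n = cong (a ^ n *_) (f≈g n)

  σ-⊕ : ∀ a f g → σ a (f ⊕ g) ≈ σ a f ⊕ σ a g
  σ-⊕ a f g n = ℚP.*-distribˡ-+ (a ^ n) (f n) (g n)

  σ-⊖ : ∀ a f → σ a (⊖ f) ≈ ⊖ σ a f
  σ-⊖ a f n = sym (ℚP.neg-distribʳ-* (a ^ n) (f n))

  σ-· : ∀ a c f → σ a (c · f) ≈ c · σ a f
  σ-· a c f n = ℚ-Solver.solve 3 (λ a c x → a :* (c :* x) := c :* (a :* x)) refl (a ^ n) c (f n)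
    where open ℚ-Solver

  σ-one : ∀ a → σ a one ≈ one
  σ-one a zero    = ℚP.*-identityˡ 1ℚ
  σ-one a (suc n) = ℚP.*-zeroʳ (a ^ suc n)

  σ-X : ∀ a → σ a X ≈ a · X
  σ-X a zero             = trans (ℚP.*-zeroʳ 1ℚ) (sym (ℚP.*-zeroʳ a))
  σ-X a (suc zero)       = trans (ℚP.*-identityʳ (a * 1ℚ)) (trans (ℚP.*-identityʳ a) (sym (ℚP.*-identityʳ a)))
  σ-X a (suc (suc n))    = trans (ℚP.*-zeroʳ (a ^ suc (suc n))) (sym (ℚP.*-zeroʳ a))

  σ-σ : ∀ a b f → σ a (σ b f) ≈ σ (a * b) f
  σ-σ a b f n = trans (sym (ℚP.*-assoc (a ^ n) _ _)) (cong (_* f n) (sym (^-distrib-* a b n)))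

  σ-θ : ∀ a f → θ (σ a f) ≈ σ a (θ f)
  σ-θ a f n = ℚ-Solver.solve 3 (λ a b x → b :* (a :* x) := a :* (b :* x)) refl (a ^ n) (ℕ→ℚ n) (f n)
    where open ℚ-Solver

  σ-⊛ : ∀ a f g → σ a (f ⊛ g) ≈ σ a f ⊛ σ a g
  σ-⊛ a f g n = trans (*-distribˡ-∑ (suc n) (a ^ n) _) (∑-cong-< (suc n) (λ k k<sn → split k (ℕP.≤-pred k<sn)))
    where
    split : ∀ k → k ≤ n → a ^ n * (f k * g (n ∸ k)) ≡ (a ^ k * f k) * (a ^ (n ∸ k) * g (n ∸ k))
    split k k≤n = begin
      a ^ n * (f k * g (n ∸ k))
        ≡⟨ cong (λ z → a ^ z * (f k * g (n ∸ k))) (ℕP.m+[n∸m]≡n k≤n) ⟨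
      a ^ (k ℕ.+ (n ∸ k)) * (f k * g (n ∸ k))
        ≡⟨ cong (_* (f k * g (n ∸ k))) (^-homo-* a k (n ∸ k)) ⟩
      (a ^ k * a ^ (n ∸ k)) * (f k * g (n ∸ k))
        ≡⟨ ℚ-Solver.solve 4 (λ a b x y → (a :* b) :* (x :* y) := (a :* x) :* (b :* y)) refl (a ^ k) (a ^ (n ∸ k)) (f k) (g (n ∸ k)) ⟩
      (a ^ k * f k) * (a ^ (n ∸ k) * g (n ∸ k)) ∎
      where open ℚ-Solver

  reversedPrefix : PS → ℕ → List ℚ
  reversedPrefix h zero    = h 0 ∷ []
  reversedPrefix h (suc n) = h (suc n) ∷ reversedPrefix h n

  invRev≡reversedPrefix : ∀ f n → invRev f n ≡ reversedPrefix (inv1 f) n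
  invRev≡reversedPrefix f zero    = refl
  invRev≡reversedPrefix f (suc n) = cong (inv1 f (suc n) ∷_) (invRev≡reversedPrefix f n)

  sumL-zipWith-reversedPrefix : ∀ (g h : PS) n (a : ℕ → ℕ) →
    sumL (zipWith _*_ (map g (applyUpTo a (suc n))) (reversedPrefix h n)) ≡ ∑ (suc n) (λ k → g (a k) * h (n ∸ k))
  sumL-zipWith-reversedPrefix g h zero    a = trans (ℚP.+-identityʳ (g (a 0) * h 0)) (sym (ℚP.+-identityˡ (g (a 0) * h 0)))
  sumL-zipWith-reversedPrefix g h (suc n) a = begin
    g (a 0) * h (suc n) + sumL (zipWith _*_ (map g (applyUpTo (λ k → a (suc k)) (suc n))) (reversedPrefix h n))
      ≡⟨ cong (_+_ (g (a 0) * h (suc n))) (sumL-zipWith-reversedPrefix g h n (λ k → a (suc k))) ⟩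
    g (a 0) * h (suc n) + ∑ (suc n) (λ k → g (a (suc k)) * h (n ∸ k))
      ≡⟨ ∑-unfoldˡ (suc n) (λ k → g (a k) * h (suc n ∸ k)) ⟨
    ∑ (suc (suc n)) (λ k → g (a k) * h (suc n ∸ k)) ∎

  ⊛-inv1 : ∀ f → f 0 ≡ 1ℚ → f ⊛ inv1 f ≈ one
  ⊛-inv1 f f0≡1 zero    = cong (λ z → 0ℚ + z * 1ℚ) f0≡1
  ⊛-inv1 f f0≡1 (suc n) = begin
    (f ⊛ h) (suc n)                             ≡⟨ ⊛-sucˡ f h n ⟩
    f 0 * h (suc n) + (shift f ⊛ h) n           ≡⟨ cong₂ (λ u v → u * (- v) + (shift f ⊛ h) n) f0≡1 recursion ⟩
    1ℚ * (- (shift f ⊛ h) n) + (shift f ⊛ h) n  ≡⟨ cong (_+ (shift f ⊛ h) n) (ℚP.*-identityˡ (- (shift f ⊛ h) n)) ⟩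
    - (shift f ⊛ h) n + (shift f ⊛ h) n         ≡⟨ ℚP.+-inverseˡ ((shift f ⊛ h) n) ⟩
    0ℚ                                          ∎
    where
    h = inv1 f
    recursion : sumL (zipWith _*_ (coeffs1 f (suc n)) (invRev f n)) ≡ (shift f ⊛ h) n
    recursion = trans (cong (λ v → sumL (zipWith _*_ (coeffs1 f (suc n)) v)) (invRev≡reversedPrefix f n))
                      (sumL-zipWith-reversedPrefix (shift f) h n (λ k → k))

  inverse-unique : ∀ {f g h} → f ⊛ g ≈ one → f ⊛ h ≈ one → g ≈ h
  inverse-unique {f} {g} {h} fg≈1 fh≈1 =
    ≈-trans (≈-sym (⊛-identityˡ g)) (≈-trans (⊛-congʳ g (≈-sym fh≈1))
    (≈-trans (solve 3 (λ f h g → (f :* h) :* g := (f :* g) :* h) ≈-refl f h g)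
    (≈-trans (⊛-congʳ h fg≈1) (⊛-identityˡ h))))
    where open PS-Solver

  Even : PS → Set
  Even f = ∀ j → f (suc (2 ℕ.* j)) ≡ 0ℚ

  Odd : PS → Set
  Odd f = ∀ j → f (2 ℕ.* j) ≡ 0ℚ

  even⇒σ-1≈ : ∀ {f} → Even f → σ (- 1ℚ) f ≈ f
  even⇒σ-1≈ {f} ef n with parity n
  ... | even j = trans (cong (_* f (2 ℕ.* j)) (-1^-even j)) (ℚP.*-identityˡ _)
  ... | odd j  = begin
    (- 1ℚ) ^ suc (2 ℕ.* j) * f (suc (2 ℕ.* j)) ≡⟨ cong ((- 1ℚ) ^ suc (2 ℕ.* j) *_) (ef j) ⟩
    (- 1ℚ) ^ suc (2 ℕ.* j) * 0ℚ                ≡⟨ ℚP.*-zeroʳ ((- 1ℚ) ^ suc (2 ℕ.* j)) ⟩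
    0ℚ                                        ≡⟨ ef j ⟨
    f (suc (2 ℕ.* j))                         ∎

  σ-1≈⇒even : ∀ {f} → σ (- 1ℚ) f ≈ f → Even f
  σ-1≈⇒even {f} σf≈f j = x≡-x⇒x≡0 _ (begin
    f (suc (2 ℕ.* j))                            ≡⟨ σf≈f (suc (2 ℕ.* j)) ⟨
    (- 1ℚ) ^ suc (2 ℕ.* j) * f (suc (2 ℕ.* j))   ≡⟨ cong (_* f (suc (2 ℕ.* j))) (-1^-odd j) ⟩
    - 1ℚ * f (suc (2 ℕ.* j))                     ≡⟨ -1*x _ ⟩
    - f (suc (2 ℕ.* j))                          ∎)

  odd⇒σ-1≈ : ∀ {f} → Odd f → σ (- 1ℚ) f ≈ ⊖ f
  odd⇒σ-1≈ {f} of n with parity n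
  ... | even j = begin
    (- 1ℚ) ^ (2 ℕ.* j) * f (2 ℕ.* j) ≡⟨ cong ((- 1ℚ) ^ (2 ℕ.* j) *_) (of j) ⟩
    (- 1ℚ) ^ (2 ℕ.* j) * 0ℚ          ≡⟨ ℚP.*-zeroʳ ((- 1ℚ) ^ (2 ℕ.* j)) ⟩
    - 0ℚ                             ≡⟨ cong -_ (of j) ⟨
    - f (2 ℕ.* j)                    ∎
  ... | odd j  = trans (cong (_* f (suc (2 ℕ.* j))) (-1^-odd j)) (-1*x _)

  σ-1≈⊖⇒odd : ∀ {f} → σ (- 1ℚ) f ≈ ⊖ f → Odd f
  σ-1≈⊖⇒odd {f} σf≈-f j = x≡-x⇒x≡0 _ (begin
    f (2 ℕ.* j)                      ≡⟨ ℚP.*-identityˡ _ ⟨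
    1ℚ * f (2 ℕ.* j)                 ≡⟨ cong (_* f (2 ℕ.* j)) (-1^-even j) ⟨
    (- 1ℚ) ^ (2 ℕ.* j) * f (2 ℕ.* j) ≡⟨ σf≈-f (2 ℕ.* j) ⟩
    - f (2 ℕ.* j)                    ∎)

  even-⊛ : ∀ {f g} → Even f → Even g → Even (f ⊛ g)
  even-⊛ {f} {g} ef eg = σ-1≈⇒even {f ⊛ g}
    (≈-trans (σ-⊛ (- 1ℚ) f g) (⊛-cong {σ (- 1ℚ) f} {f} {σ (- 1ℚ) g} {g} (even⇒σ-1≈ {f} ef) (even⇒σ-1≈ {g} eg)))

  odd-⊛ : ∀ {f g} → Odd f → Even g → Odd (f ⊛ g)
  odd-⊛ {f} {g} of eg = σ-1≈⊖⇒odd {f ⊛ g} (≈-trans (σ-⊛ (- 1ℚ) f g)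
    (≈-trans (⊛-cong {σ (- 1ℚ) f} {⊖ f} {σ (- 1ℚ) g} {g} (odd⇒σ-1≈ {f} of) (even⇒σ-1≈ {g} eg)) (⊖-⊛ f g)))

  even-^ : ∀ {f} r → Even f → Even (f ^PS r)
  even-^ zero    ef j   = refl
  even-^ {f} (suc r) ef = even-⊛ {f} {f ^PS r} ef (even-^ r ef)

  even-inv1 : ∀ {f} → f 0 ≡ 1ℚ → Even f → Even (inv1 f)
  even-inv1 {f} f0≡1 ef = σ-1≈⇒even {inv1 f} (inverse-unique {f} {σ (- 1ℚ) (inv1 f)} {inv1 f}
    (≈-trans (⊛-congʳ (σ (- 1ℚ) (inv1 f)) (≈-sym (even⇒σ-1≈ {f} ef)))
      (≈-trans (≈-sym (σ-⊛ (- 1ℚ) f (inv1 f))) (≈-trans (σ-cong (- 1ℚ) (⊛-inv1 f f0≡1)) (σ-one (- 1ℚ)))))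
    (⊛-inv1 f f0≡1))

  evenPart-even : ∀ g j → evenPart g (2 ℕ.* j) ≡ g j
  evenPart-even g zero    = refl
  evenPart-even g (suc j) = trans (cong (evenPart g) (2*suc j)) (evenPart-even (λ i → g (suc i)) j)

  evenPart-odd : ∀ g → Even (evenPart g)
  evenPart-odd g zero    = refl
  evenPart-odd g (suc j) = trans (cong (λ z → evenPart g (suc z)) (2*suc j)) (evenPart-odd (λ i → g (suc i)) j)

  evenPart-scale : ∀ g h (r : ℕ → ℚ) → (∀ j → h j ≡ r (2 ℕ.* j) * g j) → ∀ n → evenPart h n ≡ r n * evenPart g n
  evenPart-scale g h r h≡rg n with parity n
  ... | even j = trans (evenPart-even h j) (trans (h≡rg j) (cong (r (2 ℕ.* j) *_) (sym (evenPart-even g j))))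
  ... | odd j  = trans (evenPart-odd h j)
    (sym (trans (cong (r (suc (2 ℕ.* j)) *_) (evenPart-odd g j)) (ℚP.*-zeroʳ (r (suc (2 ℕ.* j))))))

open PowerSeries

module Residues where
  open ≈-Reasoning using (begin_; _∎; step-≈-⟩; step-≈-⟨)
  open PS-Solver using (solve; _:+_; _:*_; _:-_; :-_; _:=_; con)

  sinhPS sechPS : PS
  sinhPS = X ⊛ sinhOverX
  sechPS = inv1 coshPS

  sinhOverX-⊛-xOverSinh : sinhOverX ⊛ xOverSinh ≈ one
  sinhOverX-⊛-xOverSinh = ⊛-inv1 sinhOverX refl

  xOverSinh-⊛-sinhOverX : xOverSinh ⊛ sinhOverX ≈ one
  xOverSinh-⊛-sinhOverX = ≈-trans (⊛-comm xOverSinh sinhOverX) sinhOverX-⊛-xOverSinh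

  cosh-⊛-sech : coshPS ⊛ sechPS ≈ one
  cosh-⊛-sech = ⊛-inv1 coshPS refl

  xOverSinh-⊛-sinh : xOverSinh ⊛ sinhPS ≈ X
  xOverSinh-⊛-sinh = begin
    xOverSinh ⊛ (X ⊛ sinhOverX) ≈⟨ solve 3 (λ t x u → t :* (x :* u) := x :* (t :* u)) ≈-refl xOverSinh X sinhOverX ⟩
    X ⊛ (xOverSinh ⊛ sinhOverX) ≈⟨ ⊛-congˡ X xOverSinh-⊛-sinhOverX ⟩
    X ⊛ one                     ≈⟨ ⊛-identityʳ X ⟩
    X                           ∎

  cosh≈suc*sinhOverX : ∀ n → coshPS n ≡ ℕ→ℚ (suc n) * sinhOverX n
  cosh≈suc*sinhOverX = evenPart-scale (λ j → invFact (suc (2 ℕ.* j))) (λ j → invFact (2 ℕ.* j)) (λ n → ℕ→ℚ (suc n))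
    (λ j → sym (invFact-suc (2 ℕ.* j)))

  sinhOverX≈cosh : ∀ k → sinhOverX k ≡ ℕ→ℚ (suc (suc k)) * coshPS (suc (suc k))
  sinhOverX≈cosh = evenPart-scale (λ j → invFact (2 ℕ.* suc j)) (λ j → invFact (suc (2 ℕ.* j))) (λ n → ℕ→ℚ (suc (suc n)))
    (λ j → trans (sym (invFact-suc (suc (2 ℕ.* j)))) (cong (λ z → ℕ→ℚ (suc (suc (2 ℕ.* j))) * invFact z) (sym (2*suc j))))

  θ-sinhOverX : θ sinhOverX ⊕ sinhOverX ≈ coshPS
  θ-sinhOverX n = trans
    (ℚ-Solver.solve 2 (λ a u → a ℚ-Solver.:* u ℚ-Solver.:+ u ℚ-Solver.:= (ℚ-Solver.con 1ℚ ℚ-Solver.:+ a) ℚ-Solver.:* u) refl (ℕ→ℚ n) (sinhOverX n))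
    (trans (cong (_* sinhOverX n) (sym (ℕ→ℚ-suc n))) (sym (cosh≈suc*sinhOverX n)))

  θ-sinh : θ sinhPS ≈ X ⊛ coshPS
  θ-sinh zero    = trans (ℚP.*-zeroˡ (sinhPS 0)) (sym (X-⊛-zero coshPS))
  θ-sinh (suc m) = trans (cong (ℕ→ℚ (suc m) *_) (X-⊛-suc sinhOverX m))
    (trans (sym (cosh≈suc*sinhOverX m)) (sym (X-⊛-suc coshPS m)))

  θ-cosh : θ coshPS ≈ X ⊛ sinhPS
  θ-cosh zero          = trans (ℚP.*-zeroˡ (coshPS 0)) (sym (X-⊛-zero sinhPS))
  θ-cosh (suc zero)    = sym (trans (X-⊛-suc sinhPS 0) (X-⊛-zero sinhOverX))
  θ-cosh (suc (suc k)) = trans (sym (sinhOverX≈cosh k)) (sym (trans (X-⊛-suc sinhPS (suc k)) (X-⊛-suc sinhOverX k)))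

  cosh²≈1+sinh² : coshPS ⊛ coshPS ≈ one ⊕ sinhPS ⊛ sinhPS
  cosh²≈1+sinh² = begin
    Ch ⊛ Ch                       ≈⟨ solve 2 (λ c s → c :* c := (c :* c :- s :* s) :+ s :* s) ≈-refl Ch S ⟩
    H ⊕ S ⊛ S                   ≈⟨ ⊕-cong {H} {const (H 0)} (θ≈𝟘⇒const H θH≈𝟘) ≈-refl ⟩
    const 1ℚ ⊕ S ⊛ S            ≈⟨ ⊕-cong (λ n → ℚP.*-identityˡ (one n)) ≈-refl ⟩
    one ⊕ S ⊛ S                 ∎
    where
    Ch = coshPS
    S = sinhPS
    H = Ch ⊛ Ch ⊕ ⊖ (S ⊛ S)
    θH≈𝟘 : θ H ≈ 𝟘
    θH≈𝟘 = begin
      θ (Ch ⊛ Ch ⊕ ⊖ (S ⊛ S))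
        ≈⟨ ≈-trans (θ-⊕ (Ch ⊛ Ch) (⊖ (S ⊛ S))) (⊕-cong (θ-⊛ Ch Ch) (≈-trans (θ-⊖ (S ⊛ S)) (⊖-cong (θ-⊛ S S)))) ⟩
      (θ Ch ⊛ Ch ⊕ Ch ⊛ θ Ch) ⊕ ⊖ (θ S ⊛ S ⊕ S ⊛ θ S)
        ≈⟨ ⊕-cong (⊕-cong (⊛-congʳ Ch θ-cosh) (⊛-congˡ Ch θ-cosh)) (⊖-cong (⊕-cong (⊛-congʳ S θ-sinh) (⊛-congˡ S θ-sinh))) ⟩
      ((X ⊛ S) ⊛ Ch ⊕ Ch ⊛ (X ⊛ S)) ⊕ ⊖ ((X ⊛ Ch) ⊛ S ⊕ S ⊛ (X ⊛ Ch))
        ≈⟨ solve 3 (λ x c s → ((x :* s) :* c :+ c :* (x :* s)) :- ((x :* c) :* s :+ s :* (x :* c)) := con 0ℚ) ≈-refl X Ch S ⟩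
      const 0ℚ                                  ≈⟨ (λ n → ℚP.*-zeroˡ (one n)) ⟩
      𝟘                                         ∎

  θ-^ : ∀ f r → θ (f ^PS suc r) ≈ ℕ→ℚ (suc r) · ((f ^PS r) ⊛ θ f)
  θ-^ f zero    = begin
    θ (f ⊛ one)                   ≈⟨ θ-⊛ f one ⟩
    θ f ⊛ one ⊕ f ⊛ θ one         ≈⟨ ⊕-cong (⊛-identityʳ (θ f)) (≈-trans (⊛-congˡ f θ-one) (⊛-zeroʳ f)) ⟩
    θ f ⊕ 𝟘                       ≈⟨ (λ n → ℚP.+-identityʳ (θ f n)) ⟩
    θ f                           ≈⟨ ⊛-identityˡ (θ f) ⟨
    one ⊛ θ f                     ≈⟨ (λ n → ℚP.*-identityˡ ((one ⊛ θ f) n)) ⟨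
    1ℚ · (one ⊛ θ f)              ∎
  θ-^ f (suc r) = begin
    θ (f ⊛ (f ^PS suc r))                       ≈⟨ θ-⊛ f (f ^PS suc r) ⟩
    θ f ⊛ (f ^PS suc r) ⊕ f ⊛ θ (f ^PS suc r)   ≈⟨ ⊕-cong {θ f ⊛ (f ^PS suc r)} ≈-refl (⊛-congˡ f (θ-^ f r)) ⟩
    θ f ⊛ (f ⊛ fʳ) ⊕ f ⊛ (a · (fʳ ⊛ θ f))
      ≈⟨ ⊕-cong (solve 3 (λ d f p → d :* (f :* p) := (f :* p) :* d) ≈-refl (θ f) f fʳ)
                (≈-trans (⊛-·ʳ a f (fʳ ⊛ θ f)) (·-cong a (≈-sym (⊛-assoc f fʳ (θ f))))) ⟩
    Q ⊕ a · Q                                   ≈⟨ (λ n → trans (cong (_+ a * Q n) (sym (ℚP.*-identityˡ (Q n))))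
                                                     (trans (sym (ℚP.*-distribʳ-+ (Q n) 1ℚ a)) (cong (_* Q n) (sym (ℕ→ℚ-suc (suc r)))))) ⟩
    ℕ→ℚ (suc (suc r)) · Q                       ∎
    where
    a = ℕ→ℚ (suc r)
    fʳ = f ^PS r
    Q = (f ⊛ fʳ) ⊛ θ f

  xOverSinh-θ : xOverSinh ⊕ ⊖ θ xOverSinh ≈ xOverSinh ⊛ (xOverSinh ⊛ coshPS)
  xOverSinh-θ = ≈-sym (begin
    T ⊛ (T ⊛ coshPS)                                    ≈⟨ ⊛-congˡ T (⊛-congˡ T (≈-sym θ-sinhOverX)) ⟩
    T ⊛ (T ⊛ (θ U ⊕ U))
      ≈⟨ solve 4 (λ t dt du u → t :* (t :* (du :+ u)) := (t :* (du :* t :+ u :* dt) :- dt :* (u :* t)) :+ t :* (u :* t)) ≈-refl T (θ T) (θ U) U ⟩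
    (T ⊛ (θ U ⊛ T ⊕ U ⊛ θ T) ⊕ ⊖ (θ T ⊛ (U ⊛ T))) ⊕ T ⊛ (U ⊛ T)
      ≈⟨ ⊕-cong (⊕-cong (⊛-congˡ T θ[U⊛T]≈𝟘) (⊖-cong (⊛-congˡ (θ T) sinhOverX-⊛-xOverSinh))) (⊛-congˡ T sinhOverX-⊛-xOverSinh) ⟩
    (T ⊛ 𝟘 ⊕ ⊖ (θ T ⊛ one)) ⊕ T ⊛ one                  ≈⟨ ⊕-cong (⊕-cong (⊛-zeroʳ T) (⊖-cong (⊛-identityʳ (θ T)))) (⊛-identityʳ T) ⟩
    (𝟘 ⊕ ⊖ θ T) ⊕ T                                     ≈⟨ (λ n → trans (cong (_+ T n) (ℚP.+-identityˡ (- θ T n))) (ℚP.+-comm (- θ T n) (T n))) ⟩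
    T ⊕ ⊖ θ T                                           ∎)
    where
    T = xOverSinh
    U = sinhOverX
    θ[U⊛T]≈𝟘 : θ U ⊛ T ⊕ U ⊛ θ T ≈ 𝟘
    θ[U⊛T]≈𝟘 = ≈-trans (≈-sym (θ-⊛ U T)) (≈-trans (θ-cong sinhOverX-⊛-xOverSinh) θ-one)

  -- The residue at 0 of H(x) / sinh(x)^(k+1) dx.
  residue : ℕ → PS → ℚ
  residue k H = ((xOverSinh ^PS suc k) ⊛ H) k

  residue-cong : ∀ k {H H′} → H ≈ H′ → residue k H ≡ residue k H′
  residue-cong k H≈H′ = ⊛-congˡ (xOverSinh ^PS suc k) H≈H′ k

  residue-⊕ : ∀ k H H′ → residue k (H ⊕ H′) ≡ residue k H + residue k H′
  residue-⊕ k H H′ = ⊛-distribˡ-⊕ (xOverSinh ^PS suc k) H H′ k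

  residue-sinh : ∀ k H → residue (suc k) (sinhPS ⊛ H) ≡ residue k H
  residue-sinh k H = trans (T^[k+2]⊛[S⊛H] (suc k)) (X-⊛-suc ((T ^PS suc k) ⊛ H) k)
    where
    T = xOverSinh
    T^[k+2]⊛[S⊛H] : (T ^PS suc (suc k)) ⊛ (sinhPS ⊛ H) ≈ X ⊛ ((T ^PS suc k) ⊛ H)
    T^[k+2]⊛[S⊛H] = ≈-trans (solve 4 (λ t p s h → (t :* p) :* (s :* h) := (t :* s) :* (p :* h)) ≈-refl T (T ^PS suc k) sinhPS H)
                            (⊛-congʳ ((T ^PS suc k) ⊛ H) xOverSinh-⊛-sinh)

  residue-sinh² : ∀ k H → residue (suc (suc k)) (sinhPS ⊛ (sinhPS ⊛ H)) ≡ residue k H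
  residue-sinh² k H = trans (residue-sinh (suc k) (sinhPS ⊛ H)) (residue-sinh k H)

  -- Integration by parts against d(sinh^(-r-1)) = -(r+1) cosh / sinh^(r+2) dx: scaling the
  -- k-th coefficient by k is θ, and θ (T^(r+1) F) = θ (T^(r+1)) F + T^(r+1) θ F with T² cosh = T - θ T.
  residue-by-parts : ∀ r F → ℕ→ℚ (suc r) * residue (suc r) (coshPS ⊛ F) ≡ ((xOverSinh ^PS suc r) ⊛ θ F) (suc r)
  residue-by-parts r F = begin≡
    a * (T^[r+2] ⊛ (coshPS ⊛ F)) k                  ≡⟨ cong (a *_) (T^[r+2]⊛cosh k) ⟩
    a * ((T^[r+1] ⊛ F) k + - (D ⊛ F) k)             ≡⟨ ℚP.*-distribˡ-+ a _ _ ⟩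
    a * (T^[r+1] ⊛ F) k + a * - (D ⊛ F) k
      ≡⟨ cong₂ _+_ (θ-⊛ T^[r+1] F k) (trans (sym (ℚP.neg-distribʳ-* a _)) (cong -_ aD≈θT^[r+1])) ⟩
    ((θ T^[r+1] ⊛ F) k + (T^[r+1] ⊛ θ F) k) + - (θ T^[r+1] ⊛ F) k
      ≡⟨ ℚ-Solver.solve 2 (λ d e → (d ℚ-Solver.:+ e) ℚ-Solver.:+ ℚ-Solver.:- d ℚ-Solver.:= e) refl ((θ T^[r+1] ⊛ F) k) ((T^[r+1] ⊛ θ F) k) ⟩
    (T^[r+1] ⊛ θ F) k                               ∎≡
    where
    open ≡-Reasoning renaming (begin_ to begin≡_; _∎ to _∎≡) using (step-≡-⟩)
    T = xOverSinh
    k = suc r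
    a = ℕ→ℚ (suc r)
    T^[r+1] = T ^PS suc r
    T^[r+2] = T ^PS suc (suc r)
    D = (T ^PS r) ⊛ θ T
    T^[r+2]⊛cosh : T^[r+2] ⊛ (coshPS ⊛ F) ≈ T^[r+1] ⊛ F ⊕ ⊖ (D ⊛ F)
    T^[r+2]⊛cosh = begin
      (T ⊛ (T ⊛ (T ^PS r))) ⊛ (coshPS ⊛ F)
        ≈⟨ solve 4 (λ t p c f → (t :* (t :* p)) :* (c :* f) := p :* ((t :* (t :* c)) :* f)) ≈-refl T (T ^PS r) coshPS F ⟩
      (T ^PS r) ⊛ ((T ⊛ (T ⊛ coshPS)) ⊛ F)  ≈⟨ ⊛-congˡ (T ^PS r) (⊛-congʳ F (≈-sym xOverSinh-θ)) ⟩
      (T ^PS r) ⊛ ((T ⊕ ⊖ θ T) ⊛ F)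
        ≈⟨ solve 4 (λ t d p f → p :* ((t :- d) :* f) := (t :* p) :* f :- (p :* d) :* f) ≈-refl T (θ T) (T ^PS r) F ⟩
      T^[r+1] ⊛ F ⊕ ⊖ (D ⊛ F)               ∎
    aD≈θT^[r+1] : a * (D ⊛ F) k ≡ (θ T^[r+1] ⊛ F) k
    aD≈θT^[r+1] = sym (trans (⊛-congʳ F (θ-^ T r) k) (⊛-·ˡ a D F k))

  residue-by-parts′ : ∀ r F F′ → θ F ≈ X ⊛ F′ → ℕ→ℚ (suc r) * residue (suc r) (coshPS ⊛ F) ≡ residue r F′
  residue-by-parts′ r F F′ θF≈XF′ = begin≡
    ℕ→ℚ (suc r) * residue (suc r) (coshPS ⊛ F) ≡⟨ residue-by-parts r F ⟩
    (T^[r+1] ⊛ θ F) (suc r)                     ≡⟨ ⊛-congˡ T^[r+1] θF≈XF′ (suc r) ⟩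
    (T^[r+1] ⊛ (X ⊛ F′)) (suc r)                ≡⟨ solve 3 (λ p x f → p :* (x :* f) := x :* (p :* f)) ≈-refl T^[r+1] X F′ (suc r) ⟩
    (X ⊛ (T^[r+1] ⊛ F′)) (suc r)                ≡⟨ X-⊛-suc (T^[r+1] ⊛ F′) r ⟩
    residue r F′                                ∎≡
    where
    open ≡-Reasoning renaming (begin_ to begin≡_; _∎ to _∎≡) using (step-≡-⟩)
    T^[r+1] = xOverSinh ^PS suc r

  residue-cosh : ∀ j → residue (suc j) coshPS ≡ 0ℚ
  residue-cosh j = *-cancelˡ-ℕ→ℚ (suc j) (begin≡
    ℕ→ℚ (suc j) * residue (suc j) coshPS             ≡⟨ cong (ℕ→ℚ (suc j) *_) (residue-cong (suc j) (≈-sym (⊛-identityʳ coshPS))) ⟩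
    ℕ→ℚ (suc j) * residue (suc j) (coshPS ⊛ one)     ≡⟨ residue-by-parts′ j one 𝟘 (≈-trans θ-one (≈-sym (⊛-zeroʳ X))) ⟩
    residue j 𝟘                                      ≡⟨ ⊛-zeroʳ (xOverSinh ^PS suc j) j ⟩
    0ℚ                                               ≡⟨ ℚP.*-zeroʳ (ℕ→ℚ (suc j)) ⟨
    ℕ→ℚ (suc j) * 0ℚ                                 ∎≡)
    where open ≡-Reasoning renaming (begin_ to begin≡_; _∎ to _∎≡) using (step-≡-⟩; step-≡-⟨)

  sech⊕sinh²sech≈cosh : sechPS ⊕ sinhPS ⊛ (sinhPS ⊛ sechPS) ≈ coshPS
  sech⊕sinh²sech≈cosh = begin
    V ⊕ S ⊛ (S ⊛ V)        ≈⟨ ⊕-cong (⊛-identityˡ V) ≈-refl ⟨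
    one ⊛ V ⊕ S ⊛ (S ⊛ V)  ≈⟨ solve 3 (λ o s v → o :* v :+ s :* (s :* v) := (o :+ s :* s) :* v) ≈-refl one S V ⟩
    (one ⊕ S ⊛ S) ⊛ V      ≈⟨ ⊛-congʳ V cosh²≈1+sinh² ⟨
    (Ch ⊛ Ch) ⊛ V            ≈⟨ ⊛-assoc Ch Ch V ⟩
    Ch ⊛ (Ch ⊛ V)            ≈⟨ ⊛-congˡ Ch cosh-⊛-sech ⟩
    Ch ⊛ one                ≈⟨ ⊛-identityʳ Ch ⟩
    Ch                      ∎
    where
    Ch = coshPS
    S = sinhPS
    V = sechPS

  residue-sech-suc-suc : ∀ j → residue (suc (suc j)) sechPS ≡ - residue j sechPS
  residue-sech-suc-suc j = +-inverseˡ-unique _ _ (begin≡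
    residue (suc (suc j)) sechPS + residue j sechPS
      ≡⟨ cong (_+_ (residue (suc (suc j)) sechPS)) (residue-sinh² j sechPS) ⟨
    residue (suc (suc j)) sechPS + residue (suc (suc j)) (sinhPS ⊛ (sinhPS ⊛ sechPS))
      ≡⟨ residue-⊕ (suc (suc j)) sechPS (sinhPS ⊛ (sinhPS ⊛ sechPS)) ⟨
    residue (suc (suc j)) (sechPS ⊕ sinhPS ⊛ (sinhPS ⊛ sechPS))
      ≡⟨ residue-cong (suc (suc j)) sech⊕sinh²sech≈cosh ⟩
    residue (suc (suc j)) coshPS
      ≡⟨ residue-cosh (suc j) ⟩
    0ℚ ∎≡)
    where open ≡-Reasoning renaming (begin_ to begin≡_; _∎ to _∎≡) using (step-≡-⟩; step-≡-⟨)

  residue-sech-even : ∀ n → residue (2 ℕ.* n) sechPS ≡ sgn n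
  residue-sech-even zero    = refl
  residue-sech-even (suc n) = trans (cong (λ k → residue k sechPS) (2*suc n))
    (trans (residue-sech-suc-suc (2 ℕ.* n)) (cong -_ (residue-sech-even n)))

  coshPow : ℕ → PS
  coshPow q = coshPS ^PS suc (2 ℕ.* q)

  coshPow-suc : ∀ q F → coshPow (suc q) ⊛ F ≈ coshPow q ⊛ F ⊕ sinhPS ⊛ (sinhPS ⊛ (coshPow q ⊛ F))
  coshPow-suc q F = begin
    coshPow (suc q) ⊛ F             ≈⟨ ⊛-congʳ F (λ n → cong (λ m → (Ch ^PS suc m) n) (2*suc q)) ⟩
    (Ch ⊛ (Ch ⊛ P)) ⊛ F               ≈⟨ solve 3 (λ c p f → (c :* (c :* p)) :* f := (c :* c) :* (p :* f)) ≈-refl Ch P F ⟩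
    (Ch ⊛ Ch) ⊛ (P ⊛ F)               ≈⟨ ⊛-congʳ (P ⊛ F) cosh²≈1+sinh² ⟩
    (one ⊕ S ⊛ S) ⊛ (P ⊛ F)         ≈⟨ solve 3 (λ o s h → (o :+ s :* s) :* h := o :* h :+ s :* (s :* h)) ≈-refl one S (P ⊛ F) ⟩
    one ⊛ (P ⊛ F) ⊕ S ⊛ (S ⊛ (P ⊛ F)) ≈⟨ ⊕-cong (⊛-identityˡ (P ⊛ F)) ≈-refl ⟩
    P ⊛ F ⊕ S ⊛ (S ⊛ (P ⊛ F))       ∎
    where
    Ch = coshPS
    S = sinhPS
    P = coshPow q

  residue-coshPow-suc : ∀ k q F →
    residue (suc (suc k)) (coshPow (suc q) ⊛ F) ≡ residue (suc (suc k)) (coshPow q ⊛ F) + residue k (coshPow q ⊛ F)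
  residue-coshPow-suc k q F = trans (residue-cong (suc (suc k)) (coshPow-suc q F))
    (trans (residue-⊕ (suc (suc k)) (coshPow q ⊛ F) (sinhPS ⊛ (sinhPS ⊛ (coshPow q ⊛ F))))
           (cong (_+_ (residue (suc (suc k)) (coshPow q ⊛ F))) (residue-sinh² k (coshPow q ⊛ F))))

  residue-coshPow-zero : ∀ k F → residue k (coshPow 0 ⊛ F) ≡ residue k (coshPS ⊛ F)
  residue-coshPow-zero k F = residue-cong k (⊛-congʳ F (⊛-identityʳ coshPS))

  residue-coshPow-pascal : ∀ F (e : ℕ → ℕ) → (∀ m → e (suc m) ≡ suc (suc (e m))) →
                           PascalRecurrence (λ q t → residue (e (q ℕ.+ t)) (coshPow q ⊛ F))
  residue-coshPow-pascal F e e-suc q t = begin≡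
    residue (e (suc (q ℕ.+ t))) (coshPow (suc q) ⊛ F)
      ≡⟨ cong (λ k → residue k (coshPow (suc q) ⊛ F)) (e-suc (q ℕ.+ t)) ⟩
    residue (suc (suc (e (q ℕ.+ t)))) (coshPow (suc q) ⊛ F)
      ≡⟨ residue-coshPow-suc (e (q ℕ.+ t)) q F ⟩
    residue (suc (suc (e (q ℕ.+ t)))) (coshPow q ⊛ F) + residue (e (q ℕ.+ t)) (coshPow q ⊛ F)
      ≡⟨ cong (λ k → residue k (coshPow q ⊛ F) + residue (e (q ℕ.+ t)) (coshPow q ⊛ F))
              (trans (sym (e-suc (q ℕ.+ t))) (cong e (sym (ℕP.+-suc q t)))) ⟩
    residue (e (q ℕ.+ suc t)) (coshPow q ⊛ F) + residue (e (q ℕ.+ t)) (coshPow q ⊛ F) ∎≡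
    where open ≡-Reasoning renaming (begin_ to begin≡_; _∎ to _∎≡) using (step-≡-⟩)

open Residues

module ClosedForms where
  open ≡-Reasoning

  fracFact : ℕ → ℕ → ℕ → ℚ
  fracFact a k m = ℕ→ℚ a * invFact k * invFact m

  fracFact-raiseˡ : ∀ a k m → fracFact a k m ≡ fracFact (a ℕ.* suc k) (suc k) m
  fracFact-raiseˡ a k m = cong (_* invFact m) (begin
    ℕ→ℚ a * invFact k                              ≡⟨ cong (ℕ→ℚ a *_) (invFact-suc k) ⟨
    ℕ→ℚ a * (ℕ→ℚ (suc k) * invFact (suc k))        ≡⟨ ℚP.*-assoc (ℕ→ℚ a) _ _ ⟨
    (ℕ→ℚ a * ℕ→ℚ (suc k)) * invFact (suc k)        ≡⟨ cong (_* invFact (suc k)) (ℕ→ℚ-* a (suc k)) ⟨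
    ℕ→ℚ (a ℕ.* suc k) * invFact (suc k)            ∎)

  fracFact-raiseʳ : ∀ a k m → fracFact a k m ≡ fracFact (a ℕ.* suc m) k (suc m)
  fracFact-raiseʳ a k m = begin
    ℕ→ℚ a * invFact k * invFact m                            ≡⟨ cong (ℕ→ℚ a * invFact k *_) (invFact-suc m) ⟨
    ℕ→ℚ a * invFact k * (ℕ→ℚ (suc m) * invFact (suc m))
      ≡⟨ ℚ-Solver.solve 4 (λ a i s j → a :* i :* (s :* j) := a :* s :* i :* j) refl (ℕ→ℚ a) (invFact k) (ℕ→ℚ (suc m)) (invFact (suc m)) ⟩
    ℕ→ℚ a * ℕ→ℚ (suc m) * invFact k * invFact (suc m)        ≡⟨ cong (λ z → z * invFact k * invFact (suc m)) (ℕ→ℚ-* a (suc m)) ⟨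
    ℕ→ℚ (a ℕ.* suc m) * invFact k * invFact (suc m)          ∎
    where open ℚ-Solver

  fracFact-+ : ∀ a b k m → fracFact a k m + fracFact b k m ≡ fracFact (a ℕ.+ b) k m
  fracFact-+ a b k m = begin
    ℕ→ℚ a * invFact k * invFact m + ℕ→ℚ b * invFact k * invFact m
      ≡⟨ ℚ-Solver.solve 4 (λ a b i j → a :* i :* j :+ b :* i :* j := (a :+ b) :* i :* j) refl (ℕ→ℚ a) (ℕ→ℚ b) (invFact k) (invFact m) ⟩
    (ℕ→ℚ a + ℕ→ℚ b) * invFact k * invFact m                         ≡⟨ cong (λ z → z * invFact k * invFact m) (ℕ→ℚ-+ a b) ⟨
    ℕ→ℚ (a ℕ.+ b) * invFact k * invFact m                           ∎
    where open ℚ-Solver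

  ℕ→ℚ-*-fracFact : ∀ c a k m → ℕ→ℚ c * fracFact a k m ≡ fracFact (c ℕ.* a) k m
  ℕ→ℚ-*-fracFact c a k m = begin
    ℕ→ℚ c * (ℕ→ℚ a * invFact k * invFact m)
      ≡⟨ ℚ-Solver.solve 4 (λ c a i j → c :* (a :* i :* j) := c :* a :* i :* j) refl (ℕ→ℚ c) (ℕ→ℚ a) (invFact k) (invFact m) ⟩
    ℕ→ℚ c * ℕ→ℚ a * invFact k * invFact m       ≡⟨ cong (λ z → z * invFact k * invFact m) (ℕ→ℚ-* c a) ⟨
    ℕ→ℚ (c ℕ.* a) * invFact k * invFact m       ∎
    where open ℚ-Solver

  fracFact-!! : ∀ k m → fracFact (k ! ℕ.* m !) k m ≡ 1ℚ
  fracFact-!! k m = begin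
    ℕ→ℚ (k ! ℕ.* m !) * invFact k * invFact m              ≡⟨ cong (λ z → z * invFact k * invFact m) (ℕ→ℚ-* (k !) (m !)) ⟩
    ℕ→ℚ (k !) * ℕ→ℚ (m !) * invFact k * invFact m
      ≡⟨ ℚ-Solver.solve 4 (λ a b i j → a :* b :* i :* j := (a :* i) :* (b :* j)) refl (ℕ→ℚ (k !)) (ℕ→ℚ (m !)) (invFact k) (invFact m) ⟩
    (ℕ→ℚ (k !) * invFact k) * (ℕ→ℚ (m !) * invFact m)      ≡⟨ cong₂ _*_ (!*invFact k) (!*invFact m) ⟩
    1ℚ                                                     ∎
    where open ℚ-Solver

  -- The Beta integral B(q + 1, t + 1).
  β : ℕ → ℕ → ℚ
  β q t = fracFact (q ! ℕ.* t !) 0 (suc (q ℕ.+ t))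

  β-recurrence : BetaRecurrence β
  β-recurrence q t = begin
    fracFact (q ! ℕ.* t !) 0 (suc (q ℕ.+ t))
      ≡⟨ fracFact-raiseʳ (q ! ℕ.* t !) 0 (suc (q ℕ.+ t)) ⟩
    fracFact (q ! ℕ.* t ! ℕ.* suc (suc (q ℕ.+ t))) 0 (suc (suc (q ℕ.+ t)))
      ≡⟨ cong (λ a → fracFact a 0 (suc (suc (q ℕ.+ t)))) numerators ⟩
    fracFact (suc q ! ℕ.* t ! ℕ.+ q ! ℕ.* suc t !) 0 (suc (suc (q ℕ.+ t)))
      ≡⟨ fracFact-+ (suc q ! ℕ.* t !) (q ! ℕ.* suc t !) 0 (suc (suc (q ℕ.+ t))) ⟨
    β (suc q) t + fracFact (q ! ℕ.* suc t !) 0 (suc (suc (q ℕ.+ t)))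
      ≡⟨ cong (λ m → β (suc q) t + fracFact (q ! ℕ.* suc t !) 0 (suc m)) (ℕP.+-suc q t) ⟨
    β (suc q) t + β q (suc t) ∎
    where
    numerators : q ! ℕ.* t ! ℕ.* suc (suc (q ℕ.+ t)) ≡ suc q ! ℕ.* t ! ℕ.+ q ! ℕ.* suc t !
    numerators = ℕ-Solver.solve 4 (λ q t F G → F :* G :* (con 2 :+ (q :+ t)) := (con 1 :+ q) :* F :* G :+ F :* ((con 1 :+ t) :* G))
                   refl q t (q !) (t !)
      where open ℕ-Solver

  γnum : ℕ → ℕ → ℕ
  γnum q t = 2 ℕ.^ (2 ℕ.* q ℕ.+ 1) ℕ.* q ! ℕ.* suc (q ℕ.+ t) ! ℕ.* (2 ℕ.* t) !

  -- B(q + 1, t + ½) / 2.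
  γ : ℕ → ℕ → ℚ
  γ q t = fracFact (γnum q t) t (2 ℕ.* suc (q ℕ.+ t))

  γnum-sucˡ : ∀ q t → γnum (suc q) t ≡ 4 ℕ.* suc q ℕ.* suc (suc (q ℕ.+ t)) ℕ.* γnum q t
  γnum-sucˡ q t = begin
    γnum (suc q) t
      ≡⟨ cong (λ e → 2 ℕ.^ (e ℕ.+ 1) ℕ.* suc q ! ℕ.* suc (suc (q ℕ.+ t)) ! ℕ.* (2 ℕ.* t) !) (2*suc q) ⟩
    2 ℕ.* (2 ℕ.* P) ℕ.* (suc q ℕ.* q !) ℕ.* (suc (suc (q ℕ.+ t)) ℕ.* suc (q ℕ.+ t) !) ℕ.* (2 ℕ.* t) !
      ≡⟨ ℕ-Solver.solve 6 (λ q s P F G H → con 2 :* (con 2 :* P) :* ((con 1 :+ q) :* F) :* ((con 1 :+ s) :* G) :* H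
                                         := con 4 :* (con 1 :+ q) :* (con 1 :+ s) :* (P :* F :* G :* H)) refl q (suc (q ℕ.+ t)) P (q !) (suc (q ℕ.+ t) !) ((2 ℕ.* t) !) ⟩
    4 ℕ.* suc q ℕ.* suc (suc (q ℕ.+ t)) ℕ.* γnum q t ∎
    where
    open ℕ-Solver
    P = 2 ℕ.^ (2 ℕ.* q ℕ.+ 1)

  γnum-sucʳ : ∀ q t → γnum q (suc t) ≡ suc (suc (q ℕ.+ t)) ℕ.* (suc (suc (2 ℕ.* t)) ℕ.* suc (2 ℕ.* t)) ℕ.* γnum q t
  γnum-sucʳ q t = begin
    γnum q (suc t)
      ≡⟨ cong₂ (λ m e → P ℕ.* q ! ℕ.* suc m ! ℕ.* e !) (ℕP.+-suc q t) (2*suc t) ⟩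
    P ℕ.* q ! ℕ.* (suc (suc (q ℕ.+ t)) ℕ.* suc (q ℕ.+ t) !) ℕ.* (suc (suc (2 ℕ.* t)) ℕ.* (suc (2 ℕ.* t) ℕ.* (2 ℕ.* t) !))
      ≡⟨ ℕ-Solver.solve 6 (λ s u P F G H → P :* F :* ((con 1 :+ s) :* G) :* ((con 2 :+ u) :* ((con 1 :+ u) :* H))
                                           := (con 1 :+ s) :* ((con 2 :+ u) :* (con 1 :+ u)) :* (P :* F :* G :* H))
           refl (suc (q ℕ.+ t)) (2 ℕ.* t) P (q !) (suc (q ℕ.+ t) !) ((2 ℕ.* t) !) ⟩
    suc (suc (q ℕ.+ t)) ℕ.* (suc (suc (2 ℕ.* t)) ℕ.* suc (2 ℕ.* t)) ℕ.* γnum q t ∎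
    where
    open ℕ-Solver
    P = 2 ℕ.^ (2 ℕ.* q ℕ.+ 1)

  γ-recurrence : BetaRecurrence γ
  γ-recurrence q t = begin
    fracFact N t (2 ℕ.* s)
      ≡⟨ fracFact-raiseˡ N t (2 ℕ.* s) ⟩
    fracFact (N ℕ.* suc t) (suc t) (2 ℕ.* s)
      ≡⟨ fracFact-raiseʳ (N ℕ.* suc t) (suc t) (2 ℕ.* s) ⟩
    fracFact (N ℕ.* suc t ℕ.* suc (2 ℕ.* s)) (suc t) (suc (2 ℕ.* s))
      ≡⟨ fracFact-raiseʳ (N ℕ.* suc t ℕ.* suc (2 ℕ.* s)) (suc t) (suc (2 ℕ.* s)) ⟩
    fracFact (N ℕ.* suc t ℕ.* suc (2 ℕ.* s) ℕ.* suc (suc (2 ℕ.* s))) (suc t) (suc (suc (2 ℕ.* s)))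
      ≡⟨ cong₂ (fracFact′ (suc t)) numerators (sym (2*suc s)) ⟩
    fracFact (γnum (suc q) t ℕ.* suc t ℕ.+ γnum q (suc t)) (suc t) (2 ℕ.* suc s)
      ≡⟨ fracFact-+ (γnum (suc q) t ℕ.* suc t) (γnum q (suc t)) (suc t) (2 ℕ.* suc s) ⟨
    fracFact (γnum (suc q) t ℕ.* suc t) (suc t) (2 ℕ.* suc s) + fracFact (γnum q (suc t)) (suc t) (2 ℕ.* suc s)
      ≡⟨ cong₂ _+_ (fracFact-raiseˡ (γnum (suc q) t) t (2 ℕ.* suc s))
                   (cong (λ m → fracFact (γnum q (suc t)) (suc t) (2 ℕ.* suc m)) (ℕP.+-suc q t)) ⟨
    γ (suc q) t + γ q (suc t) ∎
    where
    open ℕ-Solver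
    s = suc (q ℕ.+ t)
    N = γnum q t
    fracFact′ : ℕ → ℕ → ℕ → ℚ
    fracFact′ k a m = fracFact a k m
    numerators : N ℕ.* suc t ℕ.* suc (2 ℕ.* s) ℕ.* suc (suc (2 ℕ.* s)) ≡ γnum (suc q) t ℕ.* suc t ℕ.+ γnum q (suc t)
    numerators = begin
      N ℕ.* suc t ℕ.* suc (2 ℕ.* s) ℕ.* suc (suc (2 ℕ.* s))
        ≡⟨ solve 3 (λ q t N → N :* (con 1 :+ t) :* (con 1 :+ con 2 :* (con 1 :+ (q :+ t))) :* (con 2 :+ con 2 :* (con 1 :+ (q :+ t)))
                     := con 4 :* (con 1 :+ q) :* (con 2 :+ (q :+ t)) :* N :* (con 1 :+ t)
                        :+ (con 2 :+ (q :+ t)) :* ((con 2 :+ con 2 :* t) :* (con 1 :+ con 2 :* t)) :* N) refl q t N ⟩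
      4 ℕ.* suc q ℕ.* suc (suc (q ℕ.+ t)) ℕ.* N ℕ.* suc t ℕ.+ suc (suc (q ℕ.+ t)) ℕ.* (suc (suc (2 ℕ.* t)) ℕ.* suc (2 ℕ.* t)) ℕ.* N
        ≡⟨ cong₂ (λ a b → a ℕ.* suc t ℕ.+ b) (γnum-sucˡ q t) (γnum-sucʳ q t) ⟨
      γnum (suc q) t ℕ.* suc t ℕ.+ γnum q (suc t) ∎

  γnum-zero : ∀ t → suc (2 ℕ.* t) ℕ.* γnum 0 t ≡ t ! ℕ.* (2 ℕ.* suc t) !
  γnum-zero t = begin
      suc (2 ℕ.* t) ℕ.* (2 ℕ.* 1 ℕ.* (suc t ℕ.* t !) ℕ.* (2 ℕ.* t) !)
        ≡⟨ solve 3 (λ t T H → (con 1 :+ con 2 :* t) :* (con 2 :* con 1 :* ((con 1 :+ t) :* T) :* H)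
                              := T :* ((con 2 :+ con 2 :* t) :* ((con 1 :+ con 2 :* t) :* H))) refl t (t !) ((2 ℕ.* t) !) ⟩
      t ! ℕ.* (suc (suc (2 ℕ.* t)) ℕ.* (suc (2 ℕ.* t) ℕ.* (2 ℕ.* t) !))
        ≡⟨ cong (λ m → t ! ℕ.* m !) (2*suc t) ⟨
      t ! ℕ.* (2 ℕ.* suc t) ! ∎
    where open ℕ-Solver

  ρ₁ ρ₂ : ℕ → ℕ → ℚ
  ρ₁ q t = sgn t * (½ * β q t)
  ρ₂ q t = sgn t * γ q t

  ρ₁-pascal : PascalRecurrence ρ₁
  ρ₁-pascal = alternating-pascal (λ q t → trans (cong (½ *_) (β-recurrence q t)) (ℚP.*-distribˡ-+ ½ (β (suc q) t) (β q (suc t))))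

  ρ₂-pascal : PascalRecurrence ρ₂
  ρ₂-pascal = alternating-pascal γ-recurrence

  ρ₁-base : ∀ t → ℕ→ℚ (suc (suc (2 ℕ.* t))) * ρ₁ 0 t ≡ sgn t
  ρ₁-base t = begin
    ℕ→ℚ (suc (suc (2 ℕ.* t))) * (sgn t * (½ * β 0 t))     ≡⟨ cong (λ m → ℕ→ℚ m * (sgn t * (½ * β 0 t))) (2*suc t) ⟨
    ℕ→ℚ (2 ℕ.* suc t) * (sgn t * (½ * β 0 t))             ≡⟨ cong (_* (sgn t * (½ * β 0 t))) (ℕ→ℚ-* 2 (suc t)) ⟩
    ℕ→ℚ 2 * ℕ→ℚ (suc t) * (sgn t * (½ * β 0 t))
      ≡⟨ ℚ-Solver.solve 3 (λ a s b → con (ℕ→ℚ 2) :* a :* (s :* (con ½ :* b)) := s :* (a :* b)) refl (ℕ→ℚ (suc t)) (sgn t) (β 0 t) ⟩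
    sgn t * (ℕ→ℚ (suc t) * β 0 t)                         ≡⟨ cong (sgn t *_) (ℕ→ℚ-*-fracFact (suc t) (1 ℕ.* t !) 0 (suc t)) ⟩
    sgn t * fracFact (suc t ℕ.* (1 ℕ.* t !)) 0 (suc t)     ≡⟨ cong (λ a → sgn t * fracFact a 0 (suc t)) (ℕP.*-comm (suc t) (1 ℕ.* t !)) ⟩
    sgn t * fracFact (1 ℕ.* t ! ℕ.* suc t) 0 (suc t)       ≡⟨ cong (λ a → sgn t * fracFact a 0 (suc t)) (ℕP.*-assoc 1 (t !) (suc t)) ⟩
    sgn t * fracFact (1 ℕ.* (t ! ℕ.* suc t)) 0 (suc t)     ≡⟨ cong (λ a → sgn t * fracFact (1 ℕ.* a) 0 (suc t)) (ℕP.*-comm (t !) (suc t)) ⟩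
    sgn t * fracFact (0 ! ℕ.* suc t !) 0 (suc t)          ≡⟨ cong (sgn t *_) (fracFact-!! 0 (suc t)) ⟩
    sgn t * 1ℚ                                            ≡⟨ ℚP.*-identityʳ (sgn t) ⟩
    sgn t                                                 ∎
    where open ℚ-Solver

  ρ₂-base : ∀ t → ℕ→ℚ (suc (2 ℕ.* t)) * ρ₂ 0 t ≡ sgn t
  ρ₂-base t = begin
    ℕ→ℚ (suc (2 ℕ.* t)) * (sgn t * γ 0 t)
      ≡⟨ ℚ-Solver.solve 3 (λ a s g → a :* (s :* g) := s :* (a :* g)) refl (ℕ→ℚ (suc (2 ℕ.* t))) (sgn t) (γ 0 t) ⟩
    sgn t * (ℕ→ℚ (suc (2 ℕ.* t)) * γ 0 t)                 ≡⟨ cong (sgn t *_) (ℕ→ℚ-*-fracFact (suc (2 ℕ.* t)) (γnum 0 t) t (2 ℕ.* suc t)) ⟩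
    sgn t * fracFact (suc (2 ℕ.* t) ℕ.* γnum 0 t) t (2 ℕ.* suc t) ≡⟨ cong (λ a → sgn t * fracFact a t (2 ℕ.* suc t)) (γnum-zero t) ⟩
    sgn t * fracFact (t ! ℕ.* (2 ℕ.* suc t) !) t (2 ℕ.* suc t)    ≡⟨ cong (sgn t *_) (fracFact-!! t (2 ℕ.* suc t)) ⟩
    sgn t * 1ℚ                                            ≡⟨ ℚP.*-identityʳ (sgn t) ⟩
    sgn t                                                 ∎
    where open ℚ-Solver

  closedForm₁ closedForm₂ : ℕ → ℕ → ℚ
  closedForm₁ q n = sgn (q ℕ.+ n ℕ.+ 1) * ((+ 1) / 2) * ℕ→ℚ (q ! ℕ.* (n ∸ q ∸ 1) !) * invFact n
  closedForm₂ q n = sgn (q ℕ.+ n ℕ.+ 1)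
    * ℕ→ℚ (2 ℕ.^ (2 ℕ.* q ℕ.+ 1) ℕ.* q ! ℕ.* n ! ℕ.* (2 ℕ.* n ∸ 2 ℕ.* q ∸ 2) !)
    * invFact (n ∸ q ∸ 1) * invFact (2 ℕ.* n)

  sgn-q+n+1 : ∀ q t → sgn (q ℕ.+ suc (q ℕ.+ t) ℕ.+ 1) ≡ sgn t
  sgn-q+n+1 q t = trans (cong sgn (ℕ-Solver.solve 2 (λ q t → q :+ (con 1 :+ (q :+ t)) :+ con 1 := con 2 :* (con 1 :+ q) :+ t) refl q t))
                        (sgn-2*+ (suc q) t)
    where open ℕ-Solver

  n∸q∸1 : ∀ q t → suc (q ℕ.+ t) ∸ q ∸ 1 ≡ t
  n∸q∸1 zero    t = refl
  n∸q∸1 (suc q) t = n∸q∸1 q t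

  2n∸2q∸2 : ∀ q t → 2 ℕ.* suc (q ℕ.+ t) ∸ 2 ℕ.* q ∸ 2 ≡ 2 ℕ.* t
  2n∸2q∸2 q t = begin
    2 ℕ.* suc (q ℕ.+ t) ∸ 2 ℕ.* q ∸ 2
      ≡⟨ cong (λ m → m ∸ 2 ℕ.* q ∸ 2) (ℕ-Solver.solve 2 (λ q t → con 2 :* (con 1 :+ (q :+ t)) := con 2 :* q :+ (con 2 :* t :+ con 2)) refl q t) ⟩
    2 ℕ.* q ℕ.+ (2 ℕ.* t ℕ.+ 2) ∸ 2 ℕ.* q ∸ 2 ≡⟨ cong (_∸ 2) (ℕP.m+n∸m≡n (2 ℕ.* q) (2 ℕ.* t ℕ.+ 2)) ⟩
    2 ℕ.* t ℕ.+ 2 ∸ 2                       ≡⟨ ℕP.m+n∸n≡m (2 ℕ.* t) 2 ⟩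
    2 ℕ.* t                                 ∎
    where open ℕ-Solver

  closedForm₁≡ρ₁ : ∀ q t → closedForm₁ q (suc (q ℕ.+ t)) ≡ ρ₁ q t
  closedForm₁≡ρ₁ q t = begin
    sgn (q ℕ.+ n ℕ.+ 1) * ½ * ℕ→ℚ (q ! ℕ.* (n ∸ q ∸ 1) !) * invFact n
      ≡⟨ cong₂ (λ s m → s * ½ * ℕ→ℚ (q ! ℕ.* m !) * invFact n) (sgn-q+n+1 q t) (n∸q∸1 q t) ⟩
    sgn t * ½ * ℕ→ℚ (q ! ℕ.* t !) * invFact n
      ≡⟨ ℚ-Solver.solve 3 (λ s a i → s :* con ½ :* a :* i := s :* (con ½ :* (a :* con 1ℚ :* i))) refl (sgn t) (ℕ→ℚ (q ! ℕ.* t !)) (invFact n) ⟩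
    ρ₁ q t ∎
    where
    open ℚ-Solver
    n = suc (q ℕ.+ t)

  closedForm₂≡ρ₂ : ∀ q t → closedForm₂ q (suc (q ℕ.+ t)) ≡ ρ₂ q t
  closedForm₂≡ρ₂ q t = begin
    sgn (q ℕ.+ n ℕ.+ 1) * ℕ→ℚ (P ℕ.* q ! ℕ.* n ! ℕ.* (2 ℕ.* n ∸ 2 ℕ.* q ∸ 2) !) * invFact (n ∸ q ∸ 1) * invFact (2 ℕ.* n)
      ≡⟨ cong₃ (sgn-q+n+1 q t) (2n∸2q∸2 q t) (n∸q∸1 q t) ⟩
    sgn t * ℕ→ℚ (γnum q t) * invFact t * invFact (2 ℕ.* n)
      ≡⟨ ℚ-Solver.solve 4 (λ s a i j → s :* a :* i :* j := s :* (a :* i :* j)) refl (sgn t) (ℕ→ℚ (γnum q t)) (invFact t) (invFact (2 ℕ.* n)) ⟩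
    ρ₂ q t ∎
    where
    open ℚ-Solver
    n = suc (q ℕ.+ t)
    P = 2 ℕ.^ (2 ℕ.* q ℕ.+ 1)
    cong₃ : ∀ {x x′ e e′ m m′} → x ≡ x′ → e ≡ e′ → m ≡ m′ →
            x * ℕ→ℚ (P ℕ.* q ! ℕ.* n ! ℕ.* e !) * invFact m * invFact (2 ℕ.* n)
              ≡ x′ * ℕ→ℚ (P ℕ.* q ! ℕ.* n ! ℕ.* e′ !) * invFact m′ * invFact (2 ℕ.* n)
    cong₃ refl refl refl = refl

open ClosedForms

module Exponential where
  open ≈-Reasoning using (begin_; _∎; step-≈-⟩; step-≈-⟨)

  linear-ode-unique : ∀ c F G → θ F ≈ c · (X ⊛ F) → θ G ≈ c · (X ⊛ G) → F 0 ≡ G 0 → F ≈ G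
  linear-ode-unique c F G θF θG F0≡G0 zero    = F0≡G0
  linear-ode-unique c F G θF θG F0≡G0 (suc n) = *-cancelˡ-ℕ→ℚ (suc n) (begin≡
    ℕ→ℚ (suc n) * F (suc n)    ≡⟨ θF (suc n) ⟩
    c * (X ⊛ F) (suc n)        ≡⟨ cong (c *_) (X-⊛-suc F n) ⟩
    c * F n                    ≡⟨ cong (c *_) (linear-ode-unique c F G θF θG F0≡G0 n) ⟩
    c * G n                    ≡⟨ cong (c *_) (X-⊛-suc G n) ⟨
    c * (X ⊛ G) (suc n)        ≡⟨ θG (suc n) ⟨
    ℕ→ℚ (suc n) * G (suc n)    ∎≡)
    where open ≡-Reasoning renaming (begin_ to begin≡_; _∎ to _∎≡) using (step-≡-⟩; step-≡-⟨)

  expPS : PS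
  expPS = invFact

  θ-exp : θ expPS ≈ X ⊛ expPS
  θ-exp zero    = trans (ℚP.*-zeroˡ (expPS 0)) (sym (X-⊛-zero expPS))
  θ-exp (suc n) = trans (invFact-suc n) (sym (X-⊛-suc expPS n))

  expAt : ℚ → PS
  expAt a = σ a expPS

  θ-expAt : ∀ a → θ (expAt a) ≈ a · (X ⊛ expAt a)
  θ-expAt a = begin
    θ (σ a expPS)            ≈⟨ σ-θ a expPS ⟩
    σ a (θ expPS)            ≈⟨ σ-cong a θ-exp ⟩
    σ a (X ⊛ expPS)          ≈⟨ σ-⊛ a X expPS ⟩
    σ a X ⊛ σ a expPS        ≈⟨ ⊛-congʳ (σ a expPS) (σ-X a) ⟩
    (a · X) ⊛ σ a expPS      ≈⟨ ⊛-·ˡ a X (σ a expPS) ⟩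
    a · (X ⊛ expAt a)        ∎

  expAt-+ : ∀ a b → expAt a ⊛ expAt b ≈ expAt (a + b)
  expAt-+ a b = linear-ode-unique (a + b) (expAt a ⊛ expAt b) (expAt (a + b)) θ-product (θ-expAt (a + b)) refl
    where
    open PS-Solver
    A = expAt a
    B′ = expAt b
    θ-product : θ (A ⊛ B′) ≈ (a + b) · (X ⊛ (A ⊛ B′))
    θ-product = begin
      θ (A ⊛ B′)                                    ≈⟨ θ-⊛ A B′ ⟩
      θ A ⊛ B′ ⊕ A ⊛ θ B′                           ≈⟨ ⊕-cong (⊛-congʳ B′ (≈-trans (θ-expAt a) (≈-sym (const-⊛ a (X ⊛ A)))))
                                                              (⊛-congˡ A (≈-trans (θ-expAt b) (≈-sym (const-⊛ b (X ⊛ B′))))) ⟩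
      (const a ⊛ (X ⊛ A)) ⊛ B′ ⊕ A ⊛ (const b ⊛ (X ⊛ B′))
        ≈⟨ solve 5 (λ ka kb x p q → (ka :* (x :* p)) :* q :+ p :* (kb :* (x :* q)) := (ka :+ kb) :* (x :* (p :* q))) ≈-refl (const a) (const b) X A B′ ⟩
      (const a ⊕ const b) ⊛ (X ⊛ (A ⊛ B′))         ≈⟨ ⊛-congʳ (X ⊛ (A ⊛ B′)) (const-+ a b) ⟨
      const (a + b) ⊛ (X ⊛ (A ⊛ B′))                ≈⟨ const-⊛ (a + b) (X ⊛ (A ⊛ B′)) ⟩
      (a + b) · (X ⊛ (A ⊛ B′))                      ∎

  expAt-0 : expAt 0ℚ ≈ one
  expAt-0 zero    = refl
  expAt-0 (suc n) = trans (cong (_* invFact (suc n)) (ℚP.*-zeroˡ (0ℚ ^ n))) (ℚP.*-zeroˡ (invFact (suc n)))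

  1^n : ∀ n → 1ℚ ^ n ≡ 1ℚ
  1^n zero    = refl
  1^n (suc n) = trans (ℚP.*-identityˡ (1ℚ ^ n)) (1^n n)

  expAt-1 : expAt 1ℚ ≈ expPS
  expAt-1 n = trans (cong (_* expPS n) (1^n n)) (ℚP.*-identityˡ (expPS n))

  exp⁻ : PS
  exp⁻ = expAt (- 1ℚ)

  exp-⊛-exp⁻ : expPS ⊛ exp⁻ ≈ one
  exp-⊛-exp⁻ = ≈-trans (⊛-congʳ exp⁻ (≈-sym expAt-1)) (≈-trans (expAt-+ 1ℚ (- 1ℚ)) expAt-0)

  sinh≈exp : sinhPS ≈ const ½ ⊛ (expPS ⊕ ⊖ exp⁻)
  sinh≈exp n = trans (sinh-coeff n) (sym (const-⊛ ½ (expPS ⊕ ⊖ exp⁻) n))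
    where
    sinh-coeff : ∀ n → sinhPS n ≡ ½ * (expPS n + - exp⁻ n)
    sinh-coeff n with parity n
    ... | even zero    = refl
    ... | even (suc i) = trans (cong sinhPS (2*suc i)) (trans (X-⊛-suc sinhOverX (suc (2 ℕ.* i))) (trans (evenPart-odd _ i)
                           (sym (trans (cong (λ z → ½ * (expPS (2 ℕ.* suc i) + - (z * expPS (2 ℕ.* suc i)))) (-1^-even (suc i)))
                             (solve 1 (λ x → con ½ :* (x :+ :- (con 1ℚ :* x)) := con 0ℚ) refl (expPS (2 ℕ.* suc i)))))))
      where open ℚ-Solver
    ... | odd j        = trans (X-⊛-suc sinhOverX (2 ℕ.* j)) (trans (evenPart-even _ j)
                           (sym (trans (cong (λ z → ½ * (expPS (suc (2 ℕ.* j)) + - (z * expPS (suc (2 ℕ.* j))))) (-1^-odd j))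
                             (solve 1 (λ x → con ½ :* (x :+ :- (con (- 1ℚ) :* x)) := x) refl (expPS (suc (2 ℕ.* j)))))))
      where open ℚ-Solver

  cosh≈exp : coshPS ≈ const ½ ⊛ (expPS ⊕ exp⁻)
  cosh≈exp n = trans (cosh-coeff n) (sym (const-⊛ ½ (expPS ⊕ exp⁻) n))
    where
    cosh-coeff : ∀ n → coshPS n ≡ ½ * (expPS n + exp⁻ n)
    cosh-coeff n with parity n
    ... | even j = trans (evenPart-even _ j)
                     (sym (trans (cong (λ z → ½ * (expPS (2 ℕ.* j) + z * expPS (2 ℕ.* j))) (-1^-even j))
                       (solve 1 (λ x → con ½ :* (x :+ con 1ℚ :* x) := x) refl (expPS (2 ℕ.* j)))))
      where open ℚ-Solver
    ... | odd j  = trans (evenPart-odd _ j)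
                     (sym (trans (cong (λ z → ½ * (expPS (suc (2 ℕ.* j)) + z * expPS (suc (2 ℕ.* j)))) (-1^-odd j))
                       (solve 1 (λ x → con ½ :* (x :+ con (- 1ℚ) :* x) := con 0ℚ) refl (expPS (suc (2 ℕ.* j))))))
      where open ℚ-Solver

  σ2-exp : σ (ℕ→ℚ 2) expPS ≈ expPS ⊛ expPS
  σ2-exp = ≈-sym (≈-trans (⊛-cong (≈-sym expAt-1) (≈-sym expAt-1)) (expAt-+ 1ℚ 1ℚ))

  σ2-exp⁻ : σ (ℕ→ℚ 2) exp⁻ ≈ exp⁻ ⊛ exp⁻
  σ2-exp⁻ = ≈-trans (σ-σ (ℕ→ℚ 2) (- 1ℚ) expPS) (≈-sym (expAt-+ (- 1ℚ) (- 1ℚ)))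

  σ2-sinh : σ (ℕ→ℚ 2) sinhPS ≈ const (ℕ→ℚ 2) ⊛ (sinhPS ⊛ coshPS)
  σ2-sinh = begin
    σ 2ℚ sinhPS                                   ≈⟨ σ-cong 2ℚ sinh≈exp ⟩
    σ 2ℚ (const ½ ⊛ (e ⊕ ⊖ e⁻))                   ≈⟨ σ-⊛ 2ℚ (const ½) (e ⊕ ⊖ e⁻) ⟩
    σ 2ℚ (const ½) ⊛ σ 2ℚ (e ⊕ ⊖ e⁻)              ≈⟨ ⊛-cong (≈-trans (σ-· 2ℚ ½ one) (·-cong ½ (σ-one 2ℚ)))
                                                       (≈-trans (σ-⊕ 2ℚ e (⊖ e⁻)) (⊕-cong σ2-exp (≈-trans (σ-⊖ 2ℚ e⁻) (⊖-cong σ2-exp⁻)))) ⟩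
    const ½ ⊛ (e ⊛ e ⊕ ⊖ (e⁻ ⊛ e⁻))
      ≈⟨ solve 2 (λ e f → con ½ :* (e :* e :- f :* f) := con 2ℚ :* ((con ½ :* (e :- f)) :* (con ½ :* (e :+ f)))) ≈-refl e e⁻ ⟩
    const 2ℚ ⊛ ((const ½ ⊛ (e ⊕ ⊖ e⁻)) ⊛ (const ½ ⊛ (e ⊕ e⁻))) ≈⟨ ⊛-congˡ (const 2ℚ) (⊛-cong (≈-sym sinh≈exp) (≈-sym cosh≈exp)) ⟩
    const 2ℚ ⊛ (sinhPS ⊛ coshPS)                  ∎
    where
    open PS-Solver
    2ℚ = ℕ→ℚ 2
    e = expPS
    e⁻ = exp⁻

  σ2-cosh : σ (ℕ→ℚ 2) coshPS ≈ one ⊕ const (ℕ→ℚ 2) ⊛ (sinhPS ⊛ sinhPS)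
  σ2-cosh = begin
    σ 2ℚ coshPS                                   ≈⟨ σ-cong 2ℚ cosh≈exp ⟩
    σ 2ℚ (const ½ ⊛ (e ⊕ e⁻))                     ≈⟨ σ-⊛ 2ℚ (const ½) (e ⊕ e⁻) ⟩
    σ 2ℚ (const ½) ⊛ σ 2ℚ (e ⊕ e⁻)
      ≈⟨ ⊛-cong (≈-trans (σ-· 2ℚ ½ one) (·-cong ½ (σ-one 2ℚ))) (≈-trans (σ-⊕ 2ℚ e e⁻) (⊕-cong σ2-exp σ2-exp⁻)) ⟩
    const ½ ⊛ (e ⊛ e ⊕ e⁻ ⊛ e⁻)
      ≈⟨ solve 2 (λ e f → con ½ :* (e :* e :+ f :* f) := e :* f :+ con 2ℚ :* ((con ½ :* (e :- f)) :* (con ½ :* (e :- f)))) ≈-refl e e⁻ ⟩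
    e ⊛ e⁻ ⊕ const 2ℚ ⊛ ((const ½ ⊛ (e ⊕ ⊖ e⁻)) ⊛ (const ½ ⊛ (e ⊕ ⊖ e⁻)))
      ≈⟨ ⊕-cong exp-⊛-exp⁻ (⊛-congˡ (const 2ℚ) (⊛-cong (≈-sym sinh≈exp) (≈-sym sinh≈exp))) ⟩
    one ⊕ const 2ℚ ⊛ (sinhPS ⊛ sinhPS)            ∎
    where
    open PS-Solver
    2ℚ = ℕ→ℚ 2
    e = expPS
    e⁻ = exp⁻

open Exponential

module LogCosh where
  open ≈-Reasoning using (begin_; _∎; step-≈-⟩; step-≈-⟨)

  private
    2ℚ : ℚ
    2ℚ = ℕ→ℚ 2

  bernoulliGF : PS
  bernoulliGF = inv1 expm1OverX

  bernoulliGF-⊛-expm1OverX : bernoulliGF ⊛ expm1OverX ≈ one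
  bernoulliGF-⊛-expm1OverX = ≈-trans (⊛-comm bernoulliGF expm1OverX) (⊛-inv1 expm1OverX refl)

  X-⊛-expm1OverX : X ⊛ expm1OverX ≈ expPS ⊕ ⊖ one
  X-⊛-expm1OverX zero    = X-⊛-zero expm1OverX
  X-⊛-expm1OverX (suc n) = trans (X-⊛-suc expm1OverX n) (sym (ℚP.+-identityʳ (invFact (suc n))))

  σ-1-expm1OverX : σ (- 1ℚ) expm1OverX ≈ exp⁻ ⊛ expm1OverX
  σ-1-expm1OverX = X-⊛-cancel (begin
    X ⊛ σ −1 E₁                        ≈⟨ solve 2 (λ x f → x :* f := con −1 :* ((con −1 :* x) :* f)) ≈-refl X (σ −1 E₁) ⟩
    const −1 ⊛ ((const −1 ⊛ X) ⊛ σ −1 E₁) ≈⟨ ⊛-congˡ (const −1) (⊛-congʳ (σ −1 E₁) (≈-trans (const-⊛ −1 X) (≈-sym (σ-X −1)))) ⟩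
    const −1 ⊛ (σ −1 X ⊛ σ −1 E₁)       ≈⟨ ⊛-congˡ (const −1) (≈-trans (≈-sym (σ-⊛ −1 X E₁)) (σ-cong −1 X-⊛-expm1OverX)) ⟩
    const −1 ⊛ σ −1 (expPS ⊕ ⊖ one)
      ≈⟨ ⊛-congˡ (const −1) (≈-trans (σ-⊕ −1 expPS (⊖ one)) (⊕-cong (≈-refl {exp⁻}) (≈-trans (σ-⊖ −1 one) (⊖-cong (σ-one −1))))) ⟩
    const −1 ⊛ (exp⁻ ⊕ ⊖ one)           ≈⟨ solve 2 (λ f o → con −1 :* (f :- o) := o :- f) ≈-refl exp⁻ one ⟩
    one ⊕ ⊖ exp⁻                        ≈⟨ ⊕-cong exp-⊛-exp⁻ (⊖-cong (⊛-identityʳ exp⁻)) ⟨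
    expPS ⊛ exp⁻ ⊕ ⊖ (exp⁻ ⊛ one)       ≈⟨ solve 3 (λ e f o → e :* f :- f :* o := f :* (e :- o)) ≈-refl expPS exp⁻ one ⟩
    exp⁻ ⊛ (expPS ⊕ ⊖ one)              ≈⟨ ⊛-congˡ exp⁻ X-⊛-expm1OverX ⟨
    exp⁻ ⊛ (X ⊛ E₁)                     ≈⟨ solve 3 (λ f x e → f :* (x :* e) := x :* (f :* e)) ≈-refl exp⁻ X E₁ ⟩
    X ⊛ (exp⁻ ⊛ E₁)                     ∎)
    where
    open PS-Solver
    −1 : ℚ
    −1 = - 1ℚ
    E₁ = expm1OverX

  σ-1-bernoulliGF : σ (- 1ℚ) bernoulliGF ≈ bernoulliGF ⊕ X
  σ-1-bernoulliGF = begin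
    σ −1 b                          ≈⟨ ⊛-identityʳ (σ −1 b) ⟨
    σ −1 b ⊛ one                    ≈⟨ ⊛-congˡ (σ −1 b) (≈-trans (≈-sym exp-⊛-exp⁻) (⊛-comm expPS exp⁻)) ⟩
    σ −1 b ⊛ (exp⁻ ⊛ expPS)         ≈⟨ ⊛-assoc (σ −1 b) exp⁻ expPS ⟨
    (σ −1 b ⊛ exp⁻) ⊛ expPS         ≈⟨ ⊛-congʳ expPS σ-1b⊛exp⁻≈b ⟩
    b ⊛ expPS                       ≈⟨ ⊛-congˡ b exp≈1+X⊛E₁ ⟩
    b ⊛ (one ⊕ X ⊛ E₁)              ≈⟨ solve 4 (λ b o x e → b :* (o :+ x :* e) := b :* o :+ x :* (b :* e)) ≈-refl b one X E₁ ⟩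
    b ⊛ one ⊕ X ⊛ (b ⊛ E₁)          ≈⟨ ⊕-cong (⊛-identityʳ b) (≈-trans (⊛-congˡ X bernoulliGF-⊛-expm1OverX) (⊛-identityʳ X)) ⟩
    b ⊕ X                           ∎
    where
    open PS-Solver
    −1 : ℚ
    −1 = - 1ℚ
    b = bernoulliGF
    E₁ = expm1OverX
    exp≈1+X⊛E₁ : expPS ≈ one ⊕ X ⊛ E₁
    exp≈1+X⊛E₁ n = sym (trans (cong (_+_ (one n)) (X-⊛-expm1OverX n))
      (ℚ-Solver.solve 2 (λ o e → o ℚ-Solver.:+ (e ℚ-Solver.:+ ℚ-Solver.:- o) ℚ-Solver.:= e) refl (one n) (expPS n)))
    σ-1b⊛exp⁻≈b : σ −1 b ⊛ exp⁻ ≈ b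
    σ-1b⊛exp⁻≈b = inverse-unique {E₁} (begin
      E₁ ⊛ (σ −1 b ⊛ exp⁻)          ≈⟨ solve 3 (λ e b f → e :* (b :* f) := b :* (f :* e)) ≈-refl E₁ (σ −1 b) exp⁻ ⟩
      σ −1 b ⊛ (exp⁻ ⊛ E₁)          ≈⟨ ⊛-congˡ (σ −1 b) σ-1-expm1OverX ⟨
      σ −1 b ⊛ σ −1 E₁              ≈⟨ σ-⊛ −1 b E₁ ⟨
      σ −1 (b ⊛ E₁)                 ≈⟨ σ-cong −1 bernoulliGF-⊛-expm1OverX ⟩
      σ −1 one                      ≈⟨ σ-one −1 ⟩
      one                           ∎) (⊛-inv1 E₁ refl)

  evenBernoulliGF : PS
  evenBernoulliGF = bernoulliGF ⊕ ½ · X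

  evenBernoulliGF-even : Even evenBernoulliGF
  evenBernoulliGF-even = σ-1≈⇒even {evenBernoulliGF} (begin
    σ −1 (b ⊕ ½ · X)             ≈⟨ σ-⊕ −1 b (½ · X) ⟩
    σ −1 b ⊕ σ −1 (½ · X)        ≈⟨ ⊕-cong σ-1-bernoulliGF (≈-trans (σ-· −1 ½ X) (·-cong ½ (σ-X −1))) ⟩
    (b ⊕ X) ⊕ ½ · (−1 · X)       ≈⟨ (λ n → ℚ-Solver.solve 2 (λ b x → (b :+ x) :+ con ½ :* (con −1 :* x) := b :+ con ½ :* x) refl (b n) (X n)) ⟩
    b ⊕ ½ · X                    ∎)
    where
    open ℚ-Solver using (_:+_; _:*_; _:=_; con)
    −1 : ℚ
    −1 = - 1ℚ
    b = bernoulliGF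

  -- x coth x = 2x / (e^(2x) - 1) + x
  xCothX : PS
  xCothX = σ 2ℚ evenBernoulliGF

  X-⊛-σ2-expm1OverX : X ⊛ σ 2ℚ expm1OverX ≈ expPS ⊛ sinhPS
  X-⊛-σ2-expm1OverX = begin
    X ⊛ σ 2ℚ E₁                           ≈⟨ solve 2 (λ x f → x :* f := con ½ :* ((con 2ℚ :* x) :* f)) ≈-refl X (σ 2ℚ E₁) ⟩
    const ½ ⊛ ((const 2ℚ ⊛ X) ⊛ σ 2ℚ E₁)   ≈⟨ ⊛-congˡ (const ½) (⊛-congʳ (σ 2ℚ E₁) (≈-trans (const-⊛ 2ℚ X) (≈-sym (σ-X 2ℚ)))) ⟩
    const ½ ⊛ (σ 2ℚ X ⊛ σ 2ℚ E₁)           ≈⟨ ⊛-congˡ (const ½) (≈-trans (≈-sym (σ-⊛ 2ℚ X E₁)) (σ-cong 2ℚ X-⊛-expm1OverX)) ⟩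
    const ½ ⊛ σ 2ℚ (expPS ⊕ ⊖ one)         ≈⟨ ⊛-congˡ (const ½) (≈-trans (σ-⊕ 2ℚ expPS (⊖ one))
                                                (⊕-cong σ2-exp (≈-trans (σ-⊖ 2ℚ one) (⊖-cong (≈-trans (σ-one 2ℚ) (≈-sym exp-⊛-exp⁻)))))) ⟩
    const ½ ⊛ (expPS ⊛ expPS ⊕ ⊖ (expPS ⊛ exp⁻))
      ≈⟨ solve 2 (λ e f → con ½ :* (e :* e :- e :* f) := e :* (con ½ :* (e :- f))) ≈-refl expPS exp⁻ ⟩
    expPS ⊛ (const ½ ⊛ (expPS ⊕ ⊖ exp⁻))   ≈⟨ ⊛-congˡ expPS sinh≈exp ⟨
    expPS ⊛ sinhPS                         ∎
    where
    open PS-Solver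
    E₁ = expm1OverX

  σ2-bernoulliGF-⊛-sinh : σ 2ℚ bernoulliGF ⊛ sinhPS ≈ X ⊛ exp⁻
  σ2-bernoulliGF-⊛-sinh = ≈-sym (begin
    X ⊛ exp⁻                                    ≈⟨ ⊛-congʳ exp⁻ (⊛-identityʳ X) ⟨
    (X ⊛ one) ⊛ exp⁻                            ≈⟨ ⊛-congʳ exp⁻ (⊛-congˡ X σ2b⊛σ2E₁≈1) ⟨
    (X ⊛ (σ 2ℚ b ⊛ σ 2ℚ E₁)) ⊛ exp⁻             ≈⟨ solve 4 (λ x b f e → (x :* (b :* f)) :* e := b :* (x :* f) :* e) ≈-refl X (σ 2ℚ b) (σ 2ℚ E₁) exp⁻ ⟩
    (σ 2ℚ b ⊛ (X ⊛ σ 2ℚ E₁)) ⊛ exp⁻             ≈⟨ ⊛-congʳ exp⁻ (⊛-congˡ (σ 2ℚ b) X-⊛-σ2-expm1OverX) ⟩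
    (σ 2ℚ b ⊛ (expPS ⊛ sinhPS)) ⊛ exp⁻
      ≈⟨ solve 4 (λ b e s f → (b :* (e :* s)) :* f := (b :* s) :* (e :* f)) ≈-refl (σ 2ℚ b) expPS sinhPS exp⁻ ⟩
    (σ 2ℚ b ⊛ sinhPS) ⊛ (expPS ⊛ exp⁻)          ≈⟨ ⊛-congˡ (σ 2ℚ b ⊛ sinhPS) exp-⊛-exp⁻ ⟩
    (σ 2ℚ b ⊛ sinhPS) ⊛ one                     ≈⟨ ⊛-identityʳ (σ 2ℚ b ⊛ sinhPS) ⟩
    σ 2ℚ b ⊛ sinhPS                             ∎)
    where
    open PS-Solver
    b = bernoulliGF
    E₁ = expm1OverX
    σ2b⊛σ2E₁≈1 : σ 2ℚ b ⊛ σ 2ℚ E₁ ≈ one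
    σ2b⊛σ2E₁≈1 = ≈-trans (≈-sym (σ-⊛ 2ℚ b E₁)) (≈-trans (σ-cong 2ℚ bernoulliGF-⊛-expm1OverX) (σ-one 2ℚ))

  xCothX-⊛-sinh : xCothX ⊛ sinhPS ≈ X ⊛ coshPS
  xCothX-⊛-sinh = begin
    σ 2ℚ (b ⊕ ½ · X) ⊛ S                  ≈⟨ ⊛-congʳ S (≈-trans (σ-⊕ 2ℚ b (½ · X)) (⊕-cong (≈-refl {σ 2ℚ b}) σ2[½X]≈X)) ⟩
    (σ 2ℚ b ⊕ X) ⊛ S                      ≈⟨ solve 3 (λ b x s → (b :+ x) :* s := b :* s :+ x :* s) ≈-refl (σ 2ℚ b) X S ⟩
    σ 2ℚ b ⊛ S ⊕ X ⊛ S                    ≈⟨ ⊕-cong σ2-bernoulliGF-⊛-sinh (⊛-congˡ X sinh≈exp) ⟩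
    X ⊛ exp⁻ ⊕ X ⊛ (const ½ ⊛ (expPS ⊕ ⊖ exp⁻))
      ≈⟨ solve 3 (λ x f e → x :* f :+ x :* (con ½ :* (e :- f)) := x :* (con ½ :* (e :+ f))) ≈-refl X exp⁻ expPS ⟩
    X ⊛ (const ½ ⊛ (expPS ⊕ exp⁻))        ≈⟨ ⊛-congˡ X cosh≈exp ⟨
    X ⊛ coshPS                            ∎
    where
    open PS-Solver
    b = bernoulliGF
    S = sinhPS
    σ2[½X]≈X : σ 2ℚ (½ · X) ≈ X
    σ2[½X]≈X = ≈-trans (σ-· 2ℚ ½ X) (≈-trans (·-cong ½ (σ-X 2ℚ)) (λ n → trans (sym (ℚP.*-assoc ½ 2ℚ (X n))) (ℚP.*-identityˡ (X n))))

  sinh-⊛-cancel : ∀ {A A′} → sinhPS ⊛ A ≈ sinhPS ⊛ A′ → A ≈ A′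
  sinh-⊛-cancel {A} {A′} SA≈SA′ = begin
    A                     ≈⟨ ⊛-identityˡ A ⟨
    one ⊛ A               ≈⟨ ⊛-congʳ A xOverSinh-⊛-sinhOverX ⟨
    (T ⊛ U) ⊛ A           ≈⟨ ⊛-assoc T U A ⟩
    T ⊛ (U ⊛ A)           ≈⟨ ⊛-congˡ T (X-⊛-cancel {U ⊛ A} {U ⊛ A′} (≈-trans (≈-sym (⊛-assoc X U A)) (≈-trans SA≈SA′ (⊛-assoc X U A′)))) ⟩
    T ⊛ (U ⊛ A′)          ≈⟨ ⊛-assoc T U A′ ⟨
    (T ⊛ U) ⊛ A′          ≈⟨ ⊛-congʳ A′ xOverSinh-⊛-sinhOverX ⟩
    one ⊛ A′              ≈⟨ ⊛-identityˡ A′ ⟩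
    A′                    ∎
    where
    T = xOverSinh
    U = sinhOverX

  -- 2x coth 2x - x coth x = x tanh x, in the form (2x coth 2x - x coth x) cosh x = x sinh x.
  σ2xCothX-xCothX-⊛-cosh : (σ 2ℚ xCothX ⊕ ⊖ xCothX) ⊛ coshPS ≈ X ⊛ sinhPS
  σ2xCothX-xCothX-⊛-cosh = sinh-⊛-cancel (begin
    S ⊛ ((p ⊕ ⊖ q) ⊛ Ch)
      ≈⟨ solve 4 (λ s p q c → s :* ((p :- q) :* c) := con ½ :* (p :* (con 2ℚ :* (s :* c))) :- (q :* s) :* c) ≈-refl S p q Ch ⟩
    const ½ ⊛ (p ⊛ (const 2ℚ ⊛ (S ⊛ Ch))) ⊕ ⊖ ((q ⊛ S) ⊛ Ch)
      ≈⟨ ⊕-cong (⊛-congˡ (const ½) σ2xCothX-⊛-σ2sinh) (⊖-cong (⊛-congʳ Ch xCothX-⊛-sinh)) ⟩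
    const ½ ⊛ ((const 2ℚ ⊛ X) ⊛ (one ⊕ const 2ℚ ⊛ (S ⊛ S))) ⊕ ⊖ ((X ⊛ Ch) ⊛ Ch)
      ≈⟨ solve 4 (λ x o s c → con ½ :* ((con 2ℚ :* x) :* (o :+ con 2ℚ :* (s :* s))) :- (x :* c) :* c
                              := (x :* o :+ con 2ℚ :* (x :* (s :* s))) :- x :* (c :* c)) ≈-refl X one S Ch ⟩
    (X ⊛ one ⊕ const 2ℚ ⊛ (X ⊛ (S ⊛ S))) ⊕ ⊖ (X ⊛ (Ch ⊛ Ch))
      ≈⟨ ⊕-cong (≈-refl {X ⊛ one ⊕ const 2ℚ ⊛ (X ⊛ (S ⊛ S))}) (⊖-cong (⊛-congˡ X cosh²≈1+sinh²)) ⟩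
    (X ⊛ one ⊕ const 2ℚ ⊛ (X ⊛ (S ⊛ S))) ⊕ ⊖ (X ⊛ (one ⊕ S ⊛ S))
      ≈⟨ solve 3 (λ x o s → (x :* o :+ con 2ℚ :* (x :* (s :* s))) :- x :* (o :+ s :* s) := s :* (x :* s)) ≈-refl X one S ⟩
    S ⊛ (X ⊛ S) ∎)
    where
    open PS-Solver
    S = sinhPS
    Ch = coshPS
    q = xCothX
    p = σ 2ℚ xCothX
    σ2xCothX-⊛-σ2sinh : p ⊛ (const 2ℚ ⊛ (S ⊛ Ch)) ≈ (const 2ℚ ⊛ X) ⊛ (one ⊕ const 2ℚ ⊛ (S ⊛ S))
    σ2xCothX-⊛-σ2sinh = begin
      p ⊛ (const 2ℚ ⊛ (S ⊛ Ch))     ≈⟨ ⊛-congˡ p σ2-sinh ⟨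
      σ 2ℚ q ⊛ σ 2ℚ S              ≈⟨ σ-⊛ 2ℚ q S ⟨
      σ 2ℚ (q ⊛ S)                 ≈⟨ σ-cong 2ℚ xCothX-⊛-sinh ⟩
      σ 2ℚ (X ⊛ Ch)                 ≈⟨ σ-⊛ 2ℚ X Ch ⟩
      σ 2ℚ X ⊛ σ 2ℚ Ch              ≈⟨ ⊛-cong (≈-trans (σ-X 2ℚ) (≈-sym (const-⊛ 2ℚ X))) σ2-cosh ⟩
      (const 2ℚ ⊛ X) ⊛ (one ⊕ const 2ℚ ⊛ (S ⊛ S)) ∎

  xTanhX : σ 2ℚ xCothX ⊕ ⊖ xCothX ≈ X ⊛ (sinhPS ⊛ sechPS)
  xTanhX = begin
    D                     ≈⟨ ⊛-identityʳ D ⟨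
    D ⊛ one               ≈⟨ ⊛-congˡ D cosh-⊛-sech ⟨
    D ⊛ (coshPS ⊛ sechPS) ≈⟨ ⊛-assoc D coshPS sechPS ⟨
    (D ⊛ coshPS) ⊛ sechPS ≈⟨ ⊛-congʳ sechPS σ2xCothX-xCothX-⊛-cosh ⟩
    (X ⊛ sinhPS) ⊛ sechPS ≈⟨ ⊛-assoc X sinhPS sechPS ⟩
    X ⊛ (sinhPS ⊛ sechPS) ∎
    where
    D = σ 2ℚ xCothX ⊕ ⊖ xCothX

  logCoshNumerator : ℕ → ℚ
  logCoshNumerator zero    = 0ℚ
  logCoshNumerator (suc i) = ((+ (2 ℕ.^ (2 ℕ.* suc i ∸ 1) ℕ.* (2 ℕ.^ (2 ℕ.* suc i) ∸ 1))) / suc i) * B (2 ℕ.* suc i)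

  logCoshCoeff : ℕ → ℚ
  logCoshCoeff i = logCoshNumerator i * invFact (2 ℕ.* i)

  logCosh : PS
  logCosh = evenPart logCoshCoeff

  B*invFact : ∀ m → B m * invFact m ≡ bernoulliGF m
  B*invFact m = begin≡
    ℕ→ℚ (m !) * bernoulliGF m * invFact m
      ≡⟨ ℚ-Solver.solve 3 (λ f b i → f :* b :* i := b :* (f :* i)) refl (ℕ→ℚ (m !)) (bernoulliGF m) (invFact m) ⟩
    bernoulliGF m * (ℕ→ℚ (m !) * invFact m)   ≡⟨ cong (bernoulliGF m *_) (!*invFact m) ⟩
    bernoulliGF m * 1ℚ                        ≡⟨ ℚP.*-identityʳ (bernoulliGF m) ⟩
    bernoulliGF m                             ∎≡
    where
    open ℚ-Solver
    open ≡-Reasoning renaming (begin_ to begin≡_; _∎ to _∎≡) using (step-≡-⟩)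

  θ-logCosh-even : ∀ i → ℕ→ℚ (2 ℕ.* suc i) * logCoshCoeff (suc i)
                         ≡ 2ℚ ^ (2 ℕ.* suc i) * (2ℚ ^ (2 ℕ.* suc i) * bernoulliGF (2 ℕ.* suc i)) + - (2ℚ ^ (2 ℕ.* suc i) * bernoulliGF (2 ℕ.* suc i))
  θ-logCosh-even i = begin≡
    ℕ→ℚ m * (ℓ * B m * invFact m)
      ≡⟨ ℚ-Solver.solve 4 (λ a l b i → a :* (l :* b :* i) := (a :* l) :* (b :* i)) refl (ℕ→ℚ m) ℓ (B m) (invFact m) ⟩
    (ℕ→ℚ m * ℓ) * (B m * invFact m)               ≡⟨ cong₂ _*_ 2s*ℓ (B*invFact m) ⟩
    (t * (t + - 1ℚ)) * bernoulliGF m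
      ≡⟨ ℚ-Solver.solve 2 (λ t b → (t :* (t :+ :- con 1ℚ)) :* b := t :* (t :* b) :+ :- (t :* b)) refl t (bernoulliGF m) ⟩
    t * (t * bernoulliGF m) + - (t * bernoulliGF m) ≡⟨ cong (λ z → z * (z * bernoulliGF m) + - (z * bernoulliGF m)) (ℕ→ℚ-^ 2 m) ⟨
    _ ∎≡
    where
    open ℚ-Solver
    open ≡-Reasoning renaming (begin_ to begin≡_; _∎ to _∎≡) using (step-≡-⟩; step-≡-⟨)
    m = 2 ℕ.* suc i
    T = 2 ℕ.^ m
    t = ℕ→ℚ T
    ℓ = (+ (2 ℕ.^ (m ∸ 1) ℕ.* (T ∸ 1))) / suc i
    2*2^[m∸1] : 2 ℕ.* 2 ℕ.^ (m ∸ 1) ≡ T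
    2*2^[m∸1] = trans (cong (λ k → 2 ℕ.* 2 ℕ.^ (k ∸ 1)) (2*suc i)) (cong (2 ℕ.^_) (sym (2*suc i)))
    2s*ℓ : ℕ→ℚ m * ℓ ≡ t * (t + - 1ℚ)
    2s*ℓ = begin≡
      ℕ→ℚ m * ℓ                                   ≡⟨ cong (_* ℓ) (ℕ→ℚ-* 2 (suc i)) ⟩
      ℕ→ℚ 2 * ℕ→ℚ (suc i) * ℓ                     ≡⟨ ℚP.*-assoc (ℕ→ℚ 2) (ℕ→ℚ (suc i)) ℓ ⟩
      ℕ→ℚ 2 * (ℕ→ℚ (suc i) * ℓ)                   ≡⟨ cong (ℕ→ℚ 2 *_) (ℕ→ℚ-*-/ (suc i) (2 ℕ.^ (m ∸ 1) ℕ.* (T ∸ 1))) ⟩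
      ℕ→ℚ 2 * ℕ→ℚ (2 ℕ.^ (m ∸ 1) ℕ.* (T ∸ 1))     ≡⟨ ℕ→ℚ-* 2 (2 ℕ.^ (m ∸ 1) ℕ.* (T ∸ 1)) ⟨
      ℕ→ℚ (2 ℕ.* (2 ℕ.^ (m ∸ 1) ℕ.* (T ∸ 1)))     ≡⟨ cong ℕ→ℚ (trans (sym (ℕP.*-assoc 2 (2 ℕ.^ (m ∸ 1)) (T ∸ 1))) (cong (ℕ._* (T ∸ 1)) 2*2^[m∸1])) ⟩
      ℕ→ℚ (T ℕ.* (T ∸ 1))                         ≡⟨ ℕ→ℚ-* T (T ∸ 1) ⟩
      t * ℕ→ℚ (T ∸ 1)                             ≡⟨ cong (t *_) (ℕ→ℚ-∸ (ℕP.m^n>0 2 m)) ⟩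
      t * (t + - 1ℚ)                              ∎≡

  θ-logCosh≈xTanhX : θ logCosh ≈ σ 2ℚ xCothX ⊕ ⊖ xCothX
  θ-logCosh≈xTanhX n with parity n
  ... | even zero    = refl
  ... | even (suc i) = trans (cong (ℕ→ℚ (2 ℕ.* suc i) *_) (evenPart-even logCoshCoeff (suc i)))
                         (trans (θ-logCosh-even i) (cong (λ z → t * (t * z) + - (t * z)) (sym evenB≈b)))
    where
    t = 2ℚ ^ (2 ℕ.* suc i)
    evenB≈b : evenBernoulliGF (2 ℕ.* suc i) ≡ bernoulliGF (2 ℕ.* suc i)
    evenB≈b = trans (cong (λ k → bernoulliGF (2 ℕ.* suc i) + ½ * X k) (2*suc i))
                (trans (cong (_+_ (bernoulliGF (2 ℕ.* suc i))) (ℚP.*-zeroʳ ½)) (ℚP.+-identityʳ _))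
  ... | odd j        = trans (cong (ℕ→ℚ (suc (2 ℕ.* j)) *_) (evenPart-odd logCoshCoeff j))
                         (trans (ℚP.*-zeroʳ (ℕ→ℚ (suc (2 ℕ.* j))))
                           (sym (trans (cong (λ z → t * (t * z) + - (t * z)) (evenBernoulliGF-even j))
                             (ℚ-Solver.solve 1 (λ t → t :* (t :* con 0ℚ) :+ :- (t :* con 0ℚ) := con 0ℚ) refl t))))
    where
    open ℚ-Solver
    t = 2ℚ ^ suc (2 ℕ.* j)

  θ-logCosh : θ logCosh ≈ X ⊛ (sinhPS ⊛ sechPS)
  θ-logCosh = ≈-trans θ-logCosh≈xTanhX xTanhX

open LogCosh

module Gudermannian where
  open ≡-Reasoning

  sech-even : Even sechPS
  sech-even = even-inv1 {coshPS} refl (evenPart-odd _)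

  gudermannianCoeff : ℕ → ℚ
  gudermannianCoeff p = E (2 ℕ.* p) * invFact (suc (2 ℕ.* p))

  -- gd x = ∫₀ˣ sech
  gudermannian : PS
  gudermannian zero    = 0ℚ
  gudermannian (suc n) = evenPart gudermannianCoeff n

  gudermannian-odd : Odd gudermannian
  gudermannian-odd zero    = refl
  gudermannian-odd (suc i) = trans (cong gudermannian (2*suc i)) (evenPart-odd gudermannianCoeff i)

  θ-gudermannian : θ gudermannian ≈ X ⊛ sechPS
  θ-gudermannian zero    = trans (ℚP.*-zeroˡ 0ℚ) (sym (X-⊛-zero sechPS))
  θ-gudermannian (suc n) = trans (coefficient n) (sym (X-⊛-suc sechPS n))
    where
    coefficient : ∀ n → ℕ→ℚ (suc n) * evenPart gudermannianCoeff n ≡ sechPS n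
    coefficient n with parity n
    ... | even j = begin
      ℕ→ℚ (suc m) * evenPart gudermannianCoeff m            ≡⟨ cong (ℕ→ℚ (suc m) *_) (evenPart-even gudermannianCoeff j) ⟩
      ℕ→ℚ (suc m) * ((ℕ→ℚ (m !) * sechPS m) * invFact (suc m))
        ≡⟨ ℚ-Solver.solve 4 (λ a f v i → a :* ((f :* v) :* i) := ((a :* f) :* i) :* v) refl (ℕ→ℚ (suc m)) (ℕ→ℚ (m !)) (sechPS m) (invFact (suc m)) ⟩
      ((ℕ→ℚ (suc m) * ℕ→ℚ (m !)) * invFact (suc m)) * sechPS m ≡⟨ cong (λ z → (z * invFact (suc m)) * sechPS m) (ℕ→ℚ-* (suc m) (m !)) ⟨
      (ℕ→ℚ (suc m !) * invFact (suc m)) * sechPS m           ≡⟨ cong (_* sechPS m) (!*invFact (suc m)) ⟩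
      1ℚ * sechPS m                                         ≡⟨ ℚP.*-identityˡ (sechPS m) ⟩
      sechPS m                                              ∎
      where
      open ℚ-Solver
      m = 2 ℕ.* j
    ... | odd j  = trans (cong (ℕ→ℚ (suc (suc (2 ℕ.* j))) *_) (evenPart-odd gudermannianCoeff j))
                     (trans (ℚP.*-zeroʳ (ℕ→ℚ (suc (suc (2 ℕ.* j))))) (sym (sech-even j)))

open Gudermannian

module CoshPowers where
  open ≡-Reasoning

  private
    PS-commutativeSemiring : CommutativeSemiring _ _
    PS-commutativeSemiring = CommutativeRing.commutativeSemiring PS-commutativeRing
    module PS-Binomial = Algebra.Properties.CommutativeSemiring.Binomial PS-commutativeSemiring
    module PS-+ = Algebra.Definitions.RawMonoid (CommutativeSemiring.+-rawMonoid PS-commutativeSemiring)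
    module PS-* = Algebra.Definitions.RawMonoid (CommutativeSemiring.*-rawMonoid PS-commutativeSemiring)

    foldr-⊕ : ∀ N (F : ℕ → PS) m → Vector.foldr _⊕_ 𝟘 {N} (λ i → F (toℕ i)) m ≡ ∑ N (λ k → F k m)
    foldr-⊕ zero    F m = refl
    foldr-⊕ (suc N) F m = trans (cong (_+_ (F 0 m)) (foldr-⊕ N (λ k → F (suc k)) m)) (sym (∑-unfoldˡ N (λ k → F k m)))

    ×-coefficient : ∀ k f m → (k PS-+.× f) m ≡ ℕ→ℚ k * f m
    ×-coefficient zero    f m = sym (ℚP.*-zeroˡ (f m))
    ×-coefficient (suc k) f m = begin
      f m + (k PS-+.× f) m         ≡⟨ cong (_+_ (f m)) (×-coefficient k f m) ⟩
      f m + ℕ→ℚ k * f m            ≡⟨ cong (_+ ℕ→ℚ k * f m) (ℚP.*-identityˡ (f m)) ⟨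
      1ℚ * f m + ℕ→ℚ k * f m       ≡⟨ ℚP.*-distribʳ-+ (f m) 1ℚ (ℕ→ℚ k) ⟨
      (1ℚ + ℕ→ℚ k) * f m           ≡⟨ cong (_* f m) (ℕ→ℚ-suc k) ⟨
      ℕ→ℚ (suc k) * f m            ∎

    ×≈^PS : ∀ N f → N PS-*.× f ≈ f ^PS N
    ×≈^PS zero    f = ≈-refl
    ×≈^PS (suc N) f = ⊛-congˡ f (×≈^PS N f)

  ^PS-binomial : ∀ N f g m → ((f ⊕ g) ^PS N) m ≡ ∑ (suc N) (λ k → ℕ→ℚ (N C k) * ((f ^PS k) ⊛ (g ^PS (N ∸ k))) m)
  ^PS-binomial N f g m = begin
    ((f ⊕ g) ^PS N) m                 ≡⟨ ×≈^PS N (f ⊕ g) m ⟨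
    (N PS-*.× (f ⊕ g)) m              ≡⟨ PS-Binomial.theorem N f g m ⟩
    PS-Binomial.binomialExpansion f g N m
      ≡⟨ foldr-⊕ (suc N) (λ k → (N C k) PS-+.× ((k PS-*.× f) ⊛ ((N ∸ k) PS-*.× g))) m ⟩
    ∑ (suc N) (λ k → ((N C k) PS-+.× ((k PS-*.× f) ⊛ ((N ∸ k) PS-*.× g))) m)
      ≡⟨ ∑-cong (suc N) (λ k → trans (×-coefficient (N C k) _ m) (cong (ℕ→ℚ (N C k) *_) (⊛-cong (×≈^PS k f) (×≈^PS (N ∸ k) g) m))) ⟩
    ∑ (suc N) (λ k → ℕ→ℚ (N C k) * ((f ^PS k) ⊛ (g ^PS (N ∸ k))) m) ∎

  ^PS-cong : ∀ N {f g} → f ≈ g → f ^PS N ≈ g ^PS N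
  ^PS-cong zero    f≈g = ≈-refl
  ^PS-cong (suc N) f≈g = ⊛-cong f≈g (^PS-cong N f≈g)

  ^PS-· : ∀ N a f → (a · f) ^PS N ≈ a ^ N · (f ^PS N)
  ^PS-· zero    a f n = sym (ℚP.*-identityˡ (one n))
  ^PS-· (suc N) a f   = ≈-trans (⊛-congˡ (a · f) (^PS-· N a f))
    (≈-trans (⊛-·ˡ a f (a ^ N · (f ^PS N))) (≈-trans (·-cong a (⊛-·ʳ (a ^ N) f (f ^PS N))) (λ n → sym (ℚP.*-assoc a (a ^ N) _))))

  expAt-^PS : ∀ a k → expAt a ^PS k ≈ expAt (ℕ→ℚ k * a)
  expAt-^PS a zero    = ≈-trans (≈-sym expAt-0) (λ n → cong (λ z → expAt z n) (sym (ℚP.*-zeroˡ a)))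
  expAt-^PS a (suc k) = ≈-trans (⊛-congˡ (expAt a) (expAt-^PS a k)) (≈-trans (expAt-+ a (ℕ→ℚ k * a))
    (λ n → cong (λ z → expAt z n) (trans (cong (_+ ℕ→ℚ k * a) (sym (ℚP.*-identityˡ a)))
      (trans (sym (ℚP.*-distribʳ-+ a 1ℚ (ℕ→ℚ k))) (cong (_* a) (sym (ℕ→ℚ-suc k)))))))

  coshPS^-coefficient : ∀ N m → (coshPS ^PS N) m ≡ ½ ^ N * ∑ (suc N) (λ k → ℕ→ℚ (N C k) * ((ℕ→ℚ k + - ℕ→ℚ (N ∸ k)) ^ m * invFact m))
  coshPS^-coefficient N m = begin
    (coshPS ^PS N) m
      ≡⟨ ^PS-cong N (≈-trans cosh≈exp (const-⊛ ½ (expPS ⊕ exp⁻))) m ⟩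
    ((½ · (expPS ⊕ exp⁻)) ^PS N) m
      ≡⟨ ^PS-· N ½ (expPS ⊕ exp⁻) m ⟩
    ½ ^ N * ((expPS ⊕ exp⁻) ^PS N) m
      ≡⟨ cong (½ ^ N *_) (^PS-binomial N expPS exp⁻ m) ⟩
    ½ ^ N * ∑ (suc N) (λ k → ℕ→ℚ (N C k) * ((expPS ^PS k) ⊛ (exp⁻ ^PS (N ∸ k))) m)
      ≡⟨ cong (½ ^ N *_) (∑-cong (suc N) (λ k → cong (ℕ→ℚ (N C k) *_) (term k))) ⟩
    ½ ^ N * ∑ (suc N) (λ k → ℕ→ℚ (N C k) * ((ℕ→ℚ k + - ℕ→ℚ (N ∸ k)) ^ m * invFact m)) ∎
    where
    term : ∀ k → ((expPS ^PS k) ⊛ (exp⁻ ^PS (N ∸ k))) m ≡ (ℕ→ℚ k + - ℕ→ℚ (N ∸ k)) ^ m * invFact m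
    term k = begin
      ((expPS ^PS k) ⊛ (exp⁻ ^PS (N ∸ k))) m
        ≡⟨ ⊛-cong (≈-trans (^PS-cong k (≈-sym expAt-1)) (expAt-^PS 1ℚ k)) (expAt-^PS (- 1ℚ) (N ∸ k)) m ⟩
      (expAt (ℕ→ℚ k * 1ℚ) ⊛ expAt (ℕ→ℚ (N ∸ k) * - 1ℚ)) m
        ≡⟨ expAt-+ (ℕ→ℚ k * 1ℚ) (ℕ→ℚ (N ∸ k) * - 1ℚ) m ⟩
      expAt (ℕ→ℚ k * 1ℚ + ℕ→ℚ (N ∸ k) * - 1ℚ) m
        ≡⟨ cong (λ z → expAt z m) (ℚ-Solver.solve 2 (λ a b → a ℚ-Solver.:* ℚ-Solver.con 1ℚ ℚ-Solver.:+ b ℚ-Solver.:* ℚ-Solver.con (- 1ℚ) ℚ-Solver.:= a ℚ-Solver.:+ ℚ-Solver.:- b) refl (ℕ→ℚ k) (ℕ→ℚ (N ∸ k))) ⟩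
      (ℕ→ℚ k + - ℕ→ℚ (N ∸ k)) ^ m * invFact m ∎

  ∑-fold-symmetric : ∀ q (g : ℕ → ℚ) → (∀ k → k ≤ suc (2 ℕ.* q) → g (suc (2 ℕ.* q) ∸ k) ≡ g k) →
                     ∑ (suc (suc (2 ℕ.* q))) g ≡ ∑ (suc q) g + ∑ (suc q) g
  ∑-fold-symmetric q g g-symmetric = begin
    ∑ (suc (suc (2 ℕ.* q))) g                               ≡⟨ cong (λ n → ∑ n g) 2+2q≡[1+q]+[1+q] ⟩
    ∑ (suc q ℕ.+ suc q) g                                   ≡⟨ ∑-split (suc q) (suc q) g ⟩
    ∑ (suc q) g + ∑ (suc q) (λ k → g (suc q ℕ.+ k))         ≡⟨ cong (_+_ (∑ (suc q) g)) (∑-reverse (suc q) (λ k → g (suc q ℕ.+ k))) ⟩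
    ∑ (suc q) g + ∑ (suc q) (λ k → g (suc q ℕ.+ (q ∸ k)))   ≡⟨ cong (_+_ (∑ (suc q) g)) (∑-cong-< (suc q) mirror) ⟩
    ∑ (suc q) g + ∑ (suc q) g                               ∎
    where
    open ℕ-Solver
    2+2q≡[1+q]+[1+q] : suc (suc (2 ℕ.* q)) ≡ suc q ℕ.+ suc q
    2+2q≡[1+q]+[1+q] = solve 1 (λ q → con 2 :+ con 2 :* q := (con 1 :+ q) :+ (con 1 :+ q)) refl q
    mirror : ∀ k → k ℕ.< suc q → g (suc q ℕ.+ (q ∸ k)) ≡ g k
    mirror k k<1+q = trans (cong g index) (g-symmetric k (ℕP.≤-trans k≤q (ℕP.m≤n⇒m≤1+n (ℕP.m≤n*m q 2))))
      where
      k≤q = ℕP.≤-pred k<1+q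
      index : suc q ℕ.+ (q ∸ k) ≡ suc (2 ℕ.* q) ∸ k
      index = trans (sym (ℕP.+-∸-assoc (suc q) k≤q))
                    (cong (_∸ k) (solve 1 (λ q → (con 1 :+ q) :+ q := con 1 :+ con 2 :* q) refl q))

  k-[N-k]-mirror : ∀ {N k} p → k ≤ N →
    (ℕ→ℚ (N ∸ k) + - ℕ→ℚ (N ∸ (N ∸ k))) ^ (2 ℕ.* p) ≡ (ℕ→ℚ k + - ℕ→ℚ (N ∸ k)) ^ (2 ℕ.* p)
  k-[N-k]-mirror {N} {k} p k≤N = begin
    (ℕ→ℚ (N ∸ k) + - ℕ→ℚ (N ∸ (N ∸ k))) ^ (2 ℕ.* p)  ≡⟨ cong (λ z → (ℕ→ℚ (N ∸ k) + - ℕ→ℚ z) ^ (2 ℕ.* p)) (ℕP.m∸[m∸n]≡n k≤N) ⟩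
    (ℕ→ℚ (N ∸ k) + - ℕ→ℚ k) ^ (2 ℕ.* p)              ≡⟨ cong (_^ (2 ℕ.* p)) (solve 2 (λ a b → a :+ :- b := :- (b :+ :- a)) refl (ℕ→ℚ (N ∸ k)) (ℕ→ℚ k)) ⟩
    (- (ℕ→ℚ k + - ℕ→ℚ (N ∸ k))) ^ (2 ℕ.* p)          ≡⟨ ^-neg-even _ p ⟩
    (ℕ→ℚ k + - ℕ→ℚ (N ∸ k)) ^ (2 ℕ.* p)              ∎
    where open ℚ-Solver

  k-[N-k]-small : ∀ {N k} p → 2 ℕ.* k ≤ N → (ℕ→ℚ k + - ℕ→ℚ (N ∸ k)) ^ (2 ℕ.* p) ≡ ℕ→ℚ ((N ∸ 2 ℕ.* k) ℕ.^ (2 ℕ.* p))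
  k-[N-k]-small {N} {k} p 2k≤N = begin
    (ℕ→ℚ k + - ℕ→ℚ (N ∸ k)) ^ (2 ℕ.* p)
      ≡⟨ cong (λ z → (ℕ→ℚ k + - ℕ→ℚ z) ^ (2 ℕ.* p)) N∸k≡[N∸2k]+k ⟩
    (ℕ→ℚ k + - ℕ→ℚ ((N ∸ 2 ℕ.* k) ℕ.+ k)) ^ (2 ℕ.* p)
      ≡⟨ cong (λ z → (ℕ→ℚ k + - z) ^ (2 ℕ.* p)) (ℕ→ℚ-+ (N ∸ 2 ℕ.* k) k) ⟩
    (ℕ→ℚ k + - (ℕ→ℚ (N ∸ 2 ℕ.* k) + ℕ→ℚ k)) ^ (2 ℕ.* p)
      ≡⟨ cong (_^ (2 ℕ.* p)) (ℚ-Solver.solve 2 (λ a k → k ℚ-Solver.:+ ℚ-Solver.:- (a ℚ-Solver.:+ k) ℚ-Solver.:= ℚ-Solver.:- a) refl (ℕ→ℚ (N ∸ 2 ℕ.* k)) (ℕ→ℚ k)) ⟩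
    (- ℕ→ℚ (N ∸ 2 ℕ.* k)) ^ (2 ℕ.* p)
      ≡⟨ ^-neg-even _ p ⟩
    ℕ→ℚ (N ∸ 2 ℕ.* k) ^ (2 ℕ.* p)
      ≡⟨ ℕ→ℚ-^ (N ∸ 2 ℕ.* k) (2 ℕ.* p) ⟩
    ℕ→ℚ ((N ∸ 2 ℕ.* k) ℕ.^ (2 ℕ.* p)) ∎
    where
    open ℕ-Solver
    N∸k≡[N∸2k]+k : N ∸ k ≡ (N ∸ 2 ℕ.* k) ℕ.+ k
    N∸k≡[N∸2k]+k = begin
      N ∸ k                                  ≡⟨ cong (_∸ k) (ℕP.m∸n+n≡m 2k≤N) ⟨
      (N ∸ 2 ℕ.* k) ℕ.+ 2 ℕ.* k ∸ k          ≡⟨ cong (_∸ k) (solve 2 (λ a k → a :+ con 2 :* k := (a :+ k) :+ k) refl (N ∸ 2 ℕ.* k) k) ⟩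
      (N ∸ 2 ℕ.* k) ℕ.+ k ℕ.+ k ∸ k          ≡⟨ ℕP.m+n∸n≡m (N ∸ 2 ℕ.* k ℕ.+ k) k ⟩
      (N ∸ 2 ℕ.* k) ℕ.+ k                    ∎

  coshPow-coefficient : ∀ q p → coshPow q (2 ℕ.* p) ≡ Ω q p * invFact (2 ℕ.* p)
  coshPow-coefficient q p = begin
    coshPow q (2 ℕ.* p)                          ≡⟨ coshPS^-coefficient N (2 ℕ.* p) ⟩
    ½ ^ N * ∑ (suc N) g                          ≡⟨ cong (½ ^ N *_) (∑-fold-symmetric q g g-symmetric) ⟩
    ½ ^ N * (∑ (suc q) g + ∑ (suc q) g)          ≡⟨ ℚ-Solver.solve 2 (λ a s → (con ½ :* a) :* (s :+ s) := a :* s) refl (½ ^ (2 ℕ.* q)) (∑ (suc q) g) ⟩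
    ½ ^ (2 ℕ.* q) * ∑ (suc q) g                  ≡⟨ cong₂ _*_ (½^-even q) (∑-cong-< (suc q) (λ k k<1+q → g-small k (ℕP.≤-pred k<1+q))) ⟩
    ¼^q * ∑ (suc q) (λ k → ℕ→ℚ (term k) * i)     ≡⟨ cong (¼^q *_) (*-distribʳ-∑ (suc q) i (λ k → ℕ→ℚ (term k))) ⟨
    ¼^q * (∑ (suc q) (λ k → ℕ→ℚ (term k)) * i)   ≡⟨ ℚP.*-assoc ¼^q _ i ⟨
    Ω q p * invFact (2 ℕ.* p)                    ∎
    where
    open ℚ-Solver
    N = suc (2 ℕ.* q)
    i = invFact (2 ℕ.* p)
    ¼^q = (+ 1 / 4 ℕ.^ q) {{ℕP.m^n≢0 4 q}}
    term : ℕ → ℕ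
    term k = (N C k) ℕ.* ((N ∸ 2 ℕ.* k) ℕ.^ (2 ℕ.* p))
    g : ℕ → ℚ
    g k = ℕ→ℚ (N C k) * ((ℕ→ℚ k + - ℕ→ℚ (N ∸ k)) ^ (2 ℕ.* p) * i)
    g-symmetric : ∀ k → k ≤ N → g (N ∸ k) ≡ g k
    g-symmetric k k≤N = cong₂ (λ u v → ℕ→ℚ u * (v * i)) (sym (nCk≡nC[n∸k] k≤N)) (k-[N-k]-mirror {N} {k} p k≤N)
    g-small : ∀ k → k ≤ q → g k ≡ ℕ→ℚ (term k) * i
    g-small k k≤q = begin
      ℕ→ℚ (N C k) * ((ℕ→ℚ k + - ℕ→ℚ (N ∸ k)) ^ (2 ℕ.* p) * i)
        ≡⟨ cong (λ z → ℕ→ℚ (N C k) * (z * i)) (k-[N-k]-small {N} {k} p (ℕP.m≤n⇒m≤1+n (ℕP.*-monoʳ-≤ 2 k≤q))) ⟩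
      ℕ→ℚ (N C k) * (ℕ→ℚ ((N ∸ 2 ℕ.* k) ℕ.^ (2 ℕ.* p)) * i)
        ≡⟨ ℚP.*-assoc (ℕ→ℚ (N C k)) _ i ⟨
      ℕ→ℚ (N C k) * ℕ→ℚ ((N ∸ 2 ℕ.* k) ℕ.^ (2 ℕ.* p)) * i
        ≡⟨ cong (_* i) (ℕ→ℚ-* (N C k) _) ⟨
      ℕ→ℚ (term k) * i ∎

open CoshPowers

module Coefficients where
  open ≡-Reasoning

  ⊛-even-coefficient : ∀ {f} g → Even f → ∀ m → (f ⊛ g) (2 ℕ.* m) ≡ ∑ (suc m) (λ i → f (2 ℕ.* i) * g (2 ℕ.* m ∸ 2 ℕ.* i))
  ⊛-even-coefficient {f} g ef m = begin
    ∑ (2 ℕ.* m) h + h (2 ℕ.* m)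
      ≡⟨ cong (_+ h (2 ℕ.* m)) (∑-evens-odds m h) ⟩
    (∑ m (λ i → h (2 ℕ.* i)) + ∑ m (λ i → h (suc (2 ℕ.* i)))) + h (2 ℕ.* m)
      ≡⟨ cong (λ z → (∑ m (λ i → h (2 ℕ.* i)) + z) + h (2 ℕ.* m)) odd-terms-vanish ⟩
    (∑ m (λ i → h (2 ℕ.* i)) + 0ℚ) + h (2 ℕ.* m)
      ≡⟨ cong (_+ h (2 ℕ.* m)) (ℚP.+-identityʳ (∑ m (λ i → h (2 ℕ.* i)))) ⟩
    ∑ (suc m) (λ i → h (2 ℕ.* i)) ∎
    where
    h : ℕ → ℚ
    h k = f k * g (2 ℕ.* m ∸ k)
    odd-terms-vanish : ∑ m (λ i → h (suc (2 ℕ.* i))) ≡ 0ℚ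
    odd-terms-vanish = trans (∑-cong m (λ i → trans (cong (_* g (2 ℕ.* m ∸ suc (2 ℕ.* i))) (ef i)) (ℚP.*-zeroˡ (g (2 ℕ.* m ∸ suc (2 ℕ.* i)))))) (∑-zero m)

  ⊛-odd-coefficient : ∀ {f} g → Odd f → ∀ m → (f ⊛ g) (suc (2 ℕ.* m)) ≡ ∑ (suc m) (λ i → f (suc (2 ℕ.* i)) * g (2 ℕ.* m ∸ 2 ℕ.* i))
  ⊛-odd-coefficient {f} g of m = begin
    ∑ (suc (suc (2 ℕ.* m))) h
      ≡⟨ cong (λ n → ∑ n h) (2*suc m) ⟨
    ∑ (2 ℕ.* suc m) h
      ≡⟨ ∑-evens-odds (suc m) h ⟩
    ∑ (suc m) (λ i → h (2 ℕ.* i)) + ∑ (suc m) (λ i → h (suc (2 ℕ.* i)))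
      ≡⟨ cong (_+ ∑ (suc m) (λ i → h (suc (2 ℕ.* i)))) even-terms-vanish ⟩
    0ℚ + ∑ (suc m) (λ i → h (suc (2 ℕ.* i)))
      ≡⟨ ℚP.+-identityˡ _ ⟩
    ∑ (suc m) (λ i → h (suc (2 ℕ.* i))) ∎
    where
    h : ℕ → ℚ
    h k = f k * g (suc (2 ℕ.* m) ∸ k)
    even-terms-vanish : ∑ (suc m) (λ i → h (2 ℕ.* i)) ≡ 0ℚ
    even-terms-vanish = trans (∑-cong (suc m) (λ i → trans (cong (_* g (suc (2 ℕ.* m) ∸ 2 ℕ.* i)) (of i)) (ℚP.*-zeroˡ (g (suc (2 ℕ.* m) ∸ 2 ℕ.* i))))) (∑-zero (suc m))

  egf-⊛-even : ∀ {f g} (a b : ℕ → ℚ) → Even f →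
               (∀ i → f (2 ℕ.* i) ≡ a i * invFact (2 ℕ.* i)) → (∀ j → g (2 ℕ.* j) ≡ b j * invFact (2 ℕ.* j)) →
               ∀ m → invFact (2 ℕ.* m) * ∑ (suc m) (λ i → ℕ→ℚ ((2 ℕ.* m) C (2 ℕ.* m ∸ 2 ℕ.* i)) * b (m ∸ i) * a i)
                     ≡ (f ⊛ g) (2 ℕ.* m)
  egf-⊛-even {f} {g} a b ef f≡a g≡b m = begin
    invFact (2 ℕ.* m) * ∑ (suc m) (λ i → ℕ→ℚ ((2 ℕ.* m) C (2 ℕ.* m ∸ 2 ℕ.* i)) * b (m ∸ i) * a i)
      ≡⟨ *-distribˡ-∑ (suc m) (invFact (2 ℕ.* m)) _ ⟩
    ∑ (suc m) (λ i → invFact (2 ℕ.* m) * (ℕ→ℚ ((2 ℕ.* m) C (2 ℕ.* m ∸ 2 ℕ.* i)) * b (m ∸ i) * a i))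
      ≡⟨ ∑-cong-< (suc m) (λ i i<1+m → term i (ℕP.≤-pred i<1+m)) ⟩
    ∑ (suc m) (λ i → f (2 ℕ.* i) * g (2 ℕ.* m ∸ 2 ℕ.* i))
      ≡⟨ ⊛-even-coefficient {f} g ef m ⟨
    (f ⊛ g) (2 ℕ.* m) ∎
    where
    term : ∀ i → i ≤ m → invFact (2 ℕ.* m) * (ℕ→ℚ ((2 ℕ.* m) C (2 ℕ.* m ∸ 2 ℕ.* i)) * b (m ∸ i) * a i)
                         ≡ f (2 ℕ.* i) * g (2 ℕ.* m ∸ 2 ℕ.* i)
    term i i≤m = begin
      invFact (2 ℕ.* m) * (ℕ→ℚ ((2 ℕ.* m) C (2 ℕ.* m ∸ 2 ℕ.* i)) * b (m ∸ i) * a i)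
        ≡⟨ ℚ-Solver.solve 4 (λ n c x y → n :* (c :* x :* y) := (n :* c) :* (y :* x)) refl (invFact (2 ℕ.* m)) (ℕ→ℚ ((2 ℕ.* m) C (2 ℕ.* m ∸ 2 ℕ.* i))) (b (m ∸ i)) (a i) ⟩
      (invFact (2 ℕ.* m) * ℕ→ℚ ((2 ℕ.* m) C (2 ℕ.* m ∸ 2 ℕ.* i))) * (a i * b (m ∸ i))
        ≡⟨ cong (_* (a i * b (m ∸ i))) (binomial-invFact (ℕP.m∸n≤m (2 ℕ.* m) (2 ℕ.* i))) ⟩
      (invFact (2 ℕ.* m ∸ 2 ℕ.* i) * invFact (2 ℕ.* m ∸ (2 ℕ.* m ∸ 2 ℕ.* i))) * (a i * b (m ∸ i))
        ≡⟨ cong (λ k → (invFact (2 ℕ.* m ∸ 2 ℕ.* i) * invFact k) * (a i * b (m ∸ i))) (ℕP.m∸[m∸n]≡n (ℕP.*-monoʳ-≤ 2 i≤m)) ⟩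
      (invFact (2 ℕ.* m ∸ 2 ℕ.* i) * invFact (2 ℕ.* i)) * (a i * b (m ∸ i))
        ≡⟨ ℚ-Solver.solve 4 (λ u v x y → (u :* v) :* (x :* y) := (x :* v) :* (y :* u)) refl (invFact (2 ℕ.* m ∸ 2 ℕ.* i)) (invFact (2 ℕ.* i)) (a i) (b (m ∸ i)) ⟩
      (a i * invFact (2 ℕ.* i)) * (b (m ∸ i) * invFact (2 ℕ.* m ∸ 2 ℕ.* i))
        ≡⟨ cong₂ _*_ (f≡a i) (trans (g≡b (m ∸ i)) (cong (λ k → b (m ∸ i) * invFact k) (ℕP.*-distribˡ-∸ 2 m i))) ⟨
      f (2 ℕ.* i) * g (2 ℕ.* (m ∸ i))
        ≡⟨ cong (λ k → f (2 ℕ.* i) * g k) (ℕP.*-distribˡ-∸ 2 m i) ⟩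
      f (2 ℕ.* i) * g (2 ℕ.* m ∸ 2 ℕ.* i) ∎
      where open ℚ-Solver using (_:*_; _:=_)

  egf-⊛-odd : ∀ {f g} (a b : ℕ → ℚ) → Odd f →
              (∀ i → f (suc (2 ℕ.* i)) ≡ a i * invFact (suc (2 ℕ.* i))) → (∀ j → g (2 ℕ.* j) ≡ b j * invFact (2 ℕ.* j)) →
              ∀ m → invFact (suc (2 ℕ.* m)) * ∑ (suc m) (λ i → ℕ→ℚ (suc (2 ℕ.* m) C (2 ℕ.* m ∸ 2 ℕ.* i)) * b (m ∸ i) * a i)
                    ≡ (f ⊛ g) (suc (2 ℕ.* m))
  egf-⊛-odd {f} {g} a b of f≡a g≡b m = begin
    invFact (suc (2 ℕ.* m)) * ∑ (suc m) (λ i → ℕ→ℚ (suc (2 ℕ.* m) C (2 ℕ.* m ∸ 2 ℕ.* i)) * b (m ∸ i) * a i)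
      ≡⟨ *-distribˡ-∑ (suc m) (invFact (suc (2 ℕ.* m))) _ ⟩
    ∑ (suc m) (λ i → invFact (suc (2 ℕ.* m)) * (ℕ→ℚ (suc (2 ℕ.* m) C (2 ℕ.* m ∸ 2 ℕ.* i)) * b (m ∸ i) * a i))
      ≡⟨ ∑-cong-< (suc m) (λ i i<1+m → term i (ℕP.≤-pred i<1+m)) ⟩
    ∑ (suc m) (λ i → f (suc (2 ℕ.* i)) * g (2 ℕ.* m ∸ 2 ℕ.* i))
      ≡⟨ ⊛-odd-coefficient {f} g of m ⟨
    (f ⊛ g) (suc (2 ℕ.* m)) ∎
    where
    term : ∀ i → i ≤ m → invFact (suc (2 ℕ.* m)) * (ℕ→ℚ (suc (2 ℕ.* m) C (2 ℕ.* m ∸ 2 ℕ.* i)) * b (m ∸ i) * a i)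
                         ≡ f (suc (2 ℕ.* i)) * g (2 ℕ.* m ∸ 2 ℕ.* i)
    term i i≤m = begin
      invFact (suc (2 ℕ.* m)) * (ℕ→ℚ (suc (2 ℕ.* m) C (2 ℕ.* m ∸ 2 ℕ.* i)) * b (m ∸ i) * a i)
        ≡⟨ ℚ-Solver.solve 4 (λ n c x y → n :* (c :* x :* y) := (n :* c) :* (y :* x)) refl
             (invFact (suc (2 ℕ.* m))) (ℕ→ℚ (suc (2 ℕ.* m) C (2 ℕ.* m ∸ 2 ℕ.* i))) (b (m ∸ i)) (a i) ⟩
      (invFact (suc (2 ℕ.* m)) * ℕ→ℚ (suc (2 ℕ.* m) C (2 ℕ.* m ∸ 2 ℕ.* i))) * (a i * b (m ∸ i))
        ≡⟨ cong (_* (a i * b (m ∸ i))) (binomial-invFact (ℕP.m≤n⇒m≤1+n (ℕP.m∸n≤m (2 ℕ.* m) (2 ℕ.* i)))) ⟩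
      (invFact (2 ℕ.* m ∸ 2 ℕ.* i) * invFact (suc (2 ℕ.* m) ∸ (2 ℕ.* m ∸ 2 ℕ.* i))) * (a i * b (m ∸ i))
        ≡⟨ cong (λ k → (invFact (2 ℕ.* m ∸ 2 ℕ.* i) * invFact k) * (a i * b (m ∸ i))) complement ⟩
      (invFact (2 ℕ.* m ∸ 2 ℕ.* i) * invFact (suc (2 ℕ.* i))) * (a i * b (m ∸ i))
        ≡⟨ ℚ-Solver.solve 4 (λ u v x y → (u :* v) :* (x :* y) := (x :* v) :* (y :* u)) refl
             (invFact (2 ℕ.* m ∸ 2 ℕ.* i)) (invFact (suc (2 ℕ.* i))) (a i) (b (m ∸ i)) ⟩
      (a i * invFact (suc (2 ℕ.* i))) * (b (m ∸ i) * invFact (2 ℕ.* m ∸ 2 ℕ.* i))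
        ≡⟨ cong₂ _*_ (f≡a i) (trans (g≡b (m ∸ i)) (cong (λ k → b (m ∸ i) * invFact k) (ℕP.*-distribˡ-∸ 2 m i))) ⟨
      f (suc (2 ℕ.* i)) * g (2 ℕ.* (m ∸ i))
        ≡⟨ cong (λ k → f (suc (2 ℕ.* i)) * g k) (ℕP.*-distribˡ-∸ 2 m i) ⟩
      f (suc (2 ℕ.* i)) * g (2 ℕ.* m ∸ 2 ℕ.* i) ∎
      where
      open ℚ-Solver using (_:*_; _:=_)
      complement : suc (2 ℕ.* m) ∸ (2 ℕ.* m ∸ 2 ℕ.* i) ≡ suc (2 ℕ.* i)
      complement = trans (ℕP.+-∸-assoc 1 (ℕP.m∸n≤m (2 ℕ.* m) (2 ℕ.* i))) (cong suc (ℕP.m∸[m∸n]≡n (ℕP.*-monoʳ-≤ 2 i≤m)))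

  coshPow-even : ∀ q → Even (coshPow q)
  coshPow-even q = even-^ {coshPS} (suc (2 ℕ.* q)) (evenPart-odd _)

  bernoulliSide : ℕ → ℕ → ℚ
  bernoulliSide q n = ∑ (suc n) (λ m → c (2 ℕ.* n ∸ 2 ℕ.* m) n * invFact (2 ℕ.* m)
    * ∑ m (λ i → ℕ→ℚ ((2 ℕ.* m) C (2 ℕ.* m ∸ 2 ℕ.* suc i)) * Ω q (m ∸ suc i)
        * ((+ (2 ℕ.^ (2 ℕ.* suc i ∸ 1) ℕ.* (2 ℕ.^ (2 ℕ.* suc i) ∸ 1))) / suc i)
        * B (2 ℕ.* suc i)))

  eulerSide : ℕ → ℕ → ℚ
  eulerSide q n = ∑ n (λ m → d (2 ℕ.* n ∸ 2 ℕ.* m ∸ 2) n * invFact (suc (2 ℕ.* m))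
    * ∑ (suc m) (λ p → ℕ→ℚ ((suc (2 ℕ.* m)) C (2 ℕ.* m ∸ 2 ℕ.* p)) * Ω q (m ∸ p) * E (2 ℕ.* p)))

  logCosh-⊛-coshPow : ∀ q m → invFact (2 ℕ.* m) * ∑ m (λ i → ℕ→ℚ ((2 ℕ.* m) C (2 ℕ.* m ∸ 2 ℕ.* suc i)) * Ω q (m ∸ suc i)
                            * ((+ (2 ℕ.^ (2 ℕ.* suc i ∸ 1) ℕ.* (2 ℕ.^ (2 ℕ.* suc i) ∸ 1))) / suc i) * B (2 ℕ.* suc i))
                          ≡ (logCosh ⊛ coshPow q) (2 ℕ.* m)
  logCosh-⊛-coshPow q m = begin
    invFact (2 ℕ.* m) * ∑ m (λ i → binom (suc i) * Ω q (m ∸ suc i) * ℓ i * B (2 ℕ.* suc i))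
      ≡⟨ cong (invFact (2 ℕ.* m) *_) (∑-cong m (λ i → ℚP.*-assoc (binom (suc i) * Ω q (m ∸ suc i)) (ℓ i) (B (2 ℕ.* suc i)))) ⟩
    invFact (2 ℕ.* m) * ∑ m (λ i → binom (suc i) * Ω q (m ∸ suc i) * logCoshNumerator (suc i))
      ≡⟨ cong (invFact (2 ℕ.* m) *_) (trans (cong (_+ S) (ℚP.*-zeroʳ (binom 0 * Ω q m))) (ℚP.+-identityˡ S)) ⟨
    invFact (2 ℕ.* m) * (binom 0 * Ω q m * 0ℚ + ∑ m (λ i → binom (suc i) * Ω q (m ∸ suc i) * logCoshNumerator (suc i)))
      ≡⟨ cong (invFact (2 ℕ.* m) *_) (∑-unfoldˡ m (λ i → binom i * Ω q (m ∸ i) * logCoshNumerator i)) ⟨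
    invFact (2 ℕ.* m) * ∑ (suc m) (λ i → binom i * Ω q (m ∸ i) * logCoshNumerator i)
      ≡⟨ egf-⊛-even {logCosh} {coshPow q} logCoshNumerator (Ω q) (evenPart-odd logCoshCoeff) (evenPart-even logCoshCoeff) (coshPow-coefficient q) m ⟩
    (logCosh ⊛ coshPow q) (2 ℕ.* m) ∎
    where
    binom : ℕ → ℚ
    binom i = ℕ→ℚ ((2 ℕ.* m) C (2 ℕ.* m ∸ 2 ℕ.* i))
    ℓ : ℕ → ℚ
    ℓ i = (+ (2 ℕ.^ (2 ℕ.* suc i ∸ 1) ℕ.* (2 ℕ.^ (2 ℕ.* suc i) ∸ 1))) / suc i
    S = ∑ m (λ i → binom (suc i) * Ω q (m ∸ suc i) * logCoshNumerator (suc i))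

  gudermannian-⊛-coshPow : ∀ q m → invFact (suc (2 ℕ.* m)) * ∑ (suc m) (λ p → ℕ→ℚ ((suc (2 ℕ.* m)) C (2 ℕ.* m ∸ 2 ℕ.* p)) * Ω q (m ∸ p) * E (2 ℕ.* p))
                                 ≡ (gudermannian ⊛ coshPow q) (suc (2 ℕ.* m))
  gudermannian-⊛-coshPow q = egf-⊛-odd {gudermannian} {coshPow q} (λ p → E (2 ℕ.* p)) (Ω q) gudermannian-odd
    (evenPart-even gudermannianCoeff) (coshPow-coefficient q)

  bernoulliSide≡residue : ∀ q n → bernoulliSide q n ≡ residue (2 ℕ.* n) (coshPow q ⊛ logCosh)
  bernoulliSide≡residue q n = begin
    bernoulliSide q n
      ≡⟨ ∑-cong (suc n) (λ m → trans (ℚP.*-assoc (T^ (2 ℕ.* n ∸ 2 ℕ.* m)) _ _)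
           (trans (cong (T^ (2 ℕ.* n ∸ 2 ℕ.* m) *_) (logCosh-⊛-coshPow q m)) (ℚP.*-comm (T^ (2 ℕ.* n ∸ 2 ℕ.* m)) _))) ⟩
    ∑ (suc n) (λ m → (logCosh ⊛ coshPow q) (2 ℕ.* m) * T^ (2 ℕ.* n ∸ 2 ℕ.* m))
      ≡⟨ ⊛-even-coefficient {logCosh ⊛ coshPow q} T^ (even-⊛ {logCosh} {coshPow q} (evenPart-odd logCoshCoeff) (coshPow-even q)) n ⟨
    ((logCosh ⊛ coshPow q) ⊛ T^) (2 ℕ.* n)
      ≡⟨ ≈-trans (⊛-comm (logCosh ⊛ coshPow q) T^) (⊛-congˡ T^ (⊛-comm logCosh (coshPow q))) (2 ℕ.* n) ⟩
    residue (2 ℕ.* n) (coshPow q ⊛ logCosh) ∎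
    where
    T^ = xOverSinh ^PS suc (2 ℕ.* n)

  eulerSide≡residue : ∀ q n → eulerSide q (suc n) ≡ residue (suc (2 ℕ.* n)) (coshPow q ⊛ gudermannian)
  eulerSide≡residue q n = begin
    eulerSide q (suc n)
      ≡⟨ ∑-cong (suc n) (λ m → trans (ℚP.*-assoc (d (2 ℕ.* suc n ∸ 2 ℕ.* m ∸ 2) (suc n)) _ _)
           (trans (cong (d (2 ℕ.* suc n ∸ 2 ℕ.* m ∸ 2) (suc n) *_) (gudermannian-⊛-coshPow q m))
           (trans (ℚP.*-comm (d (2 ℕ.* suc n ∸ 2 ℕ.* m ∸ 2) (suc n)) _) (cong ((gudermannian ⊛ coshPow q) (suc (2 ℕ.* m)) *_) (index m))))) ⟩
    ∑ (suc n) (λ m → (gudermannian ⊛ coshPow q) (suc (2 ℕ.* m)) * T^ (2 ℕ.* n ∸ 2 ℕ.* m))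
      ≡⟨ ⊛-odd-coefficient {gudermannian ⊛ coshPow q} T^ (odd-⊛ {gudermannian} {coshPow q} gudermannian-odd (coshPow-even q)) n ⟨
    ((gudermannian ⊛ coshPow q) ⊛ T^) (suc (2 ℕ.* n))
      ≡⟨ ≈-trans (⊛-comm (gudermannian ⊛ coshPow q) T^) (⊛-congˡ T^ (⊛-comm gudermannian (coshPow q))) (suc (2 ℕ.* n)) ⟩
    residue (suc (2 ℕ.* n)) (coshPow q ⊛ gudermannian) ∎
    where
    T^ = xOverSinh ^PS suc (suc (2 ℕ.* n))
    index : ∀ m → d (2 ℕ.* suc n ∸ 2 ℕ.* m ∸ 2) (suc n) ≡ T^ (2 ℕ.* n ∸ 2 ℕ.* m)
    index m = cong₂ (λ k r → (xOverSinh ^PS r) k)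
      (trans (ℕP.∸-+-assoc (2 ℕ.* suc n) (2 ℕ.* m) 2) (trans (cong (2 ℕ.* suc n ∸_) (ℕP.+-comm (2 ℕ.* m) 2))
        (cong (_∸ (2 ℕ.+ 2 ℕ.* m)) (2*suc n))))
      (2*suc n)

  residue-logCosh≡ρ₁ : ∀ q t → residue (2 ℕ.* suc (q ℕ.+ t)) (coshPow q ⊛ logCosh) ≡ ρ₁ q t
  residue-logCosh≡ρ₁ = pascal-unique (residue-coshPow-pascal logCosh (λ m → 2 ℕ.* suc m) (λ m → 2*suc (suc m))) ρ₁-pascal
    (λ t → *-cancelˡ-ℕ→ℚ (suc (suc (2 ℕ.* t))) (trans (base t) (sym (ρ₁-base t))))
    where
    base : ∀ t → ℕ→ℚ (suc (suc (2 ℕ.* t))) * residue (2 ℕ.* suc t) (coshPow 0 ⊛ logCosh) ≡ sgn t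
    base t = begin
      ℕ→ℚ (suc (suc (2 ℕ.* t))) * residue (2 ℕ.* suc t) (coshPow 0 ⊛ logCosh)
        ≡⟨ cong (ℕ→ℚ (suc (suc (2 ℕ.* t))) *_) (trans (cong (λ k → residue k (coshPow 0 ⊛ logCosh)) (2*suc t)) (residue-coshPow-zero (suc (suc (2 ℕ.* t))) logCosh)) ⟩
      ℕ→ℚ (suc (suc (2 ℕ.* t))) * residue (suc (suc (2 ℕ.* t))) (coshPS ⊛ logCosh)
        ≡⟨ residue-by-parts′ (suc (2 ℕ.* t)) logCosh (sinhPS ⊛ sechPS) θ-logCosh ⟩
      residue (suc (2 ℕ.* t)) (sinhPS ⊛ sechPS)
        ≡⟨ residue-sinh (2 ℕ.* t) sechPS ⟩
      residue (2 ℕ.* t) sechPS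
        ≡⟨ residue-sech-even t ⟩
      sgn t ∎

  residue-gudermannian≡ρ₂ : ∀ q t → residue (suc (2 ℕ.* (q ℕ.+ t))) (coshPow q ⊛ gudermannian) ≡ ρ₂ q t
  residue-gudermannian≡ρ₂ = pascal-unique (residue-coshPow-pascal gudermannian (λ m → suc (2 ℕ.* m)) (λ m → cong suc (2*suc m))) ρ₂-pascal
    (λ t → *-cancelˡ-ℕ→ℚ (suc (2 ℕ.* t)) (trans (base t) (sym (ρ₂-base t))))
    where
    base : ∀ t → ℕ→ℚ (suc (2 ℕ.* t)) * residue (suc (2 ℕ.* t)) (coshPow 0 ⊛ gudermannian) ≡ sgn t
    base t = begin
      ℕ→ℚ (suc (2 ℕ.* t)) * residue (suc (2 ℕ.* t)) (coshPow 0 ⊛ gudermannian)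
        ≡⟨ cong (ℕ→ℚ (suc (2 ℕ.* t)) *_) (residue-coshPow-zero (suc (2 ℕ.* t)) gudermannian) ⟩
      ℕ→ℚ (suc (2 ℕ.* t)) * residue (suc (2 ℕ.* t)) (coshPS ⊛ gudermannian)
        ≡⟨ residue-by-parts′ (2 ℕ.* t) gudermannian sechPS θ-gudermannian ⟩
      residue (2 ℕ.* t) sechPS
        ≡⟨ residue-sech-even t ⟩
      sgn t ∎

open Coefficients

mainTheorem9 : (q n : ℕ) → q < n →
    (∑ (suc n) (λ m → c (2 ℕ.* n ∸ 2 ℕ.* m) n * invFact (2 ℕ.* m)
        * ∑ m (λ i → ℕ→ℚ ((2 ℕ.* m) C (2 ℕ.* m ∸ 2 ℕ.* suc i)) * Ω q (m ∸ suc i)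
            * ((+ (2 ℕ.^ (2 ℕ.* suc i ∸ 1) ℕ.* (2 ℕ.^ (2 ℕ.* suc i) ∸ 1))) / suc i)
            * B (2 ℕ.* suc i)))
      ≡ sgn (q ℕ.+ n ℕ.+ 1) * ((+ 1) / 2) * ℕ→ℚ (q ! ℕ.* (n ∸ q ∸ 1) !) * invFact n)
    ×
    (∑ n (λ m → d (2 ℕ.* n ∸ 2 ℕ.* m ∸ 2) n * invFact (suc (2 ℕ.* m))
        * ∑ (suc m) (λ p → ℕ→ℚ ((suc (2 ℕ.* m)) C (2 ℕ.* m ∸ 2 ℕ.* p)) * Ω q (m ∸ p)
            * E (2 ℕ.* p)))
      ≡ sgn (q ℕ.+ n ℕ.+ 1)
        * ℕ→ℚ (2 ℕ.^ (2 ℕ.* q ℕ.+ 1) ℕ.* q ! ℕ.* n ! ℕ.* (2 ℕ.* n ∸ 2 ℕ.* q ∸ 2) !)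
        * invFact (n ∸ q ∸ 1) * invFact (2 ℕ.* n))
mainTheorem9 q n q<n = subst (λ n → (bernoulliSide q n ≡ closedForm₁ q n) × (eulerSide q n ≡ closedForm₂ q n))
  (ℕP.m+[n∸m]≡n q<n) (bernoulli-identity (n ∸ suc q) , euler-identity (n ∸ suc q))
  where
  open ≡-Reasoning
  bernoulli-identity : ∀ t → bernoulliSide q (suc (q ℕ.+ t)) ≡ closedForm₁ q (suc (q ℕ.+ t))
  bernoulli-identity t = begin
    bernoulliSide q (suc (q ℕ.+ t))                                    ≡⟨ bernoulliSide≡residue q (suc (q ℕ.+ t)) ⟩
    residue (2 ℕ.* suc (q ℕ.+ t)) (coshPow q ⊛ logCosh)                ≡⟨ residue-logCosh≡ρ₁ q t ⟩
    ρ₁ q t                                                             ≡⟨ closedForm₁≡ρ₁ q t ⟨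
    closedForm₁ q (suc (q ℕ.+ t))                                      ∎
  euler-identity : ∀ t → eulerSide q (suc (q ℕ.+ t)) ≡ closedForm₂ q (suc (q ℕ.+ t))
  euler-identity t = begin
    eulerSide q (suc (q ℕ.+ t))                                        ≡⟨ eulerSide≡residue q (q ℕ.+ t) ⟩
    residue (suc (2 ℕ.* (q ℕ.+ t))) (coshPow q ⊛ gudermannian)         ≡⟨ residue-gudermannian≡ρ₂ q t ⟩
    ρ₂ q t                                                             ≡⟨ closedForm₂≡ρ₂ q t ⟨
    closedForm₂ q (suc (q ℕ.+ t))                                      ∎
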